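{- For any set of primes $\mathscr S$, the abelian groups $\mathcal{S}(V_{\mathscr S})$ and $\mathcal{S}(V_{\mathscr S}')$ are free.
   Context: $V=\mathbb{Q}^2$ with the topology generated by lattices (rank 2 $\mathbb{Z}$-submodules); $\mathcal{S}(V)$ is the group of locally constant functions $V\to\mathbb{Z}$ supported in some lattice. For a prime $\ell$, $\mathcal{S}(V_\ell)$: locally constant compactly supported $\mathbb{Z}$-valued functions on $\mathbb{Q}_\ell^2$; $f^0_\ell$ the characteristic function of $\mathbb{Z}_\ell^2$; $\mathcal{S}(V_{\mathbb{A}}^{\mathscr S})=\bigotimes'_{\ell\notin\mathscr S}\mathcal{S}(V_\ell)$ (restricted tensor product w.r.t. $f^0_\ell$). $\mathcal{S}(V_{\mathscr S})\subset\mathcal{S}(V)$ is the image of $\mathcal{S}(V_{\mathbb{A}}^{\mathscr S})$ under $f\mapsto$ the restriction to $V$ of $f\otimes\bigotimes_{\ell\in\mathscr S}f^0_\ell$ (a simple tensor $\otimes_\ell f_\ell$ restricts to $v\mapsto\prod_\ell f_\ell(v)$). $\mathcal{S}(V_{\mathscr S}')$ is the subgroup of $\mathcal{S}(V_{\mathscr S})$ of functions vanishing at $0$. -}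

module Defs where

open import Data.Nat as ℕ using (ℕ; zero; suc; _<_; _⊔_)
open import Data.Nat.Divisibility using (_∣_; _∣?_)
open import Data.Nat.Primality using (Prime; prime?)
open import Data.Integer as ℤ using (ℤ; +_)
open import Data.Rational as ℚ using (ℚ; ↧ₙ_; 0ℚ)
open import Data.Product using (Σ; ∃; _×_; _,_; proj₁; proj₂)
open import Data.List using (List; []; _∷_; map; foldr; upTo)
open import Data.List.Relation.Unary.All using (All)
open import Data.List.Relation.Unary.Unique.Propositional using (Unique)
open import Relation.Nullary using (¬_; yes; no)
open import Relation.Binary.PropositionalEquality using (_≡_)

V : Set
V = ℚ × ℚ

0V : V
0V = 0ℚ , 0ℚ

_-V_ : V → V → V
(a , b) -V (c , d) = (a ℚ.- c) , (b ℚ.- d)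

pow : ℕ → ℕ → ℚ
pow ℓ n = (+ (ℓ ℕ.^ n)) ℚ./ 1

-- q ∈ ℤ_(ℓ) = ℚ ∩ ℤ_ℓ  (denominator prime to ℓ)
Integral : ℕ → ℚ → Set
Integral ℓ q = ¬ (ℓ ∣ (↧ₙ q))

InSmall : ℕ → ℕ → ℚ → Set
InSmall ℓ n q = Σ ℚ λ r → Integral ℓ r × (q ≡ pow ℓ n ℚ.* r)

InBig : ℕ → ℕ → ℚ → Set
InBig ℓ n q = Integral ℓ (pow ℓ n ℚ.* q)

-- Elements of 𝒮(V_ℓ), identified with their (injective, by density) restrictions
-- to V = ℚ² : Z-valued, constant on cosets of ℓ^n ℤ_ℓ², supported in ℓ^(-n) ℤ_ℓ²
-- for some n.
IsLocalSchwartz : ℕ → (V → ℤ) → Set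
IsLocalSchwartz ℓ f = Σ ℕ λ n →
  (∀ v w → InSmall ℓ n (proj₁ (v -V w)) → InSmall ℓ n (proj₂ (v -V w)) → f v ≡ f w)
  × (∀ v → ¬ (f v ≡ + 0) → InBig ℓ n (proj₁ v) × InBig ℓ n (proj₂ v))

-- f⁰_ℓ restricted to V : characteristic function of ℤ_ℓ²
f0 : ℕ → V → ℤ
f0 ℓ (x , y) with ℓ ∣? ↧ₙ x | ℓ ∣? ↧ₙ y
... | no _ | no _ = + 1
... | _    | _    = + 0

-- A pure tensor ⊗_ℓ φ_ℓ over all primes ℓ, with φ_ℓ ∈ 𝒮(V_ℓ), φ_ℓ = f⁰_ℓ for ℓ ∈ 𝒮
-- and for all ℓ > N.  (This is f ⊗ ⊗_{ℓ∈𝒮} f⁰_ℓ for a pure tensor f of 𝒮(V_𝔸^𝒮).)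
record PureTensor (S : ℕ → Set) : Set where
  field
    φ        : ℕ → V → ℤ
    N        : ℕ
    local    : ∀ ℓ → Prime ℓ → IsLocalSchwartz ℓ (φ ℓ)
    onS      : ∀ ℓ → Prime ℓ → S ℓ → ∀ v → φ ℓ v ≡ f0 ℓ v
    cofinite : ∀ ℓ → Prime ℓ → N < ℓ → ∀ v → φ ℓ v ≡ f0 ℓ v

prodℤ : List ℤ → ℤ
prodℤ = foldr ℤ._*_ (+ 1)

sumℤ : List ℤ → ℤ
sumℤ = foldr ℤ._+_ (+ 0)

-- restriction to V of a pure tensor: v ↦ ∏_ℓ φ_ℓ(v).  All factors with
-- ℓ > max(N, denominators of v) equal f⁰_ℓ(v) = 1, so the infinite product is
-- the finite product over primes ℓ ≤ that bound.
restrict : {S : ℕ → Set} → PureTensor S → V → ℤ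
restrict t (x , y) = prodℤ (map factor (upTo (suc (N ⊔ (↧ₙ x ⊔ ↧ₙ y)))))
  where
    open PureTensor t
    factor : ℕ → ℤ
    factor ℓ with prime? ℓ
    ... | yes _ = φ ℓ (x , y)
    ... | no _  = + 1

-- 𝒮(V_𝒮): image in the functions V → ℤ of 𝒮(V_𝔸^𝒮), i.e. the ℤ-span of
-- restrictions of pure tensors.
InSVS : (S : ℕ → Set) → (V → ℤ) → Set
InSVS S f = Σ (List (ℤ × PureTensor S)) λ cs →
  ∀ v → f v ≡ sumℤ (map (λ ct → proj₁ ct ℤ.* restrict (proj₂ ct) v) cs)

InSVS' : (S : ℕ → Set) → (V → ℤ) → Set
InSVS' S f = InSVS S f × (f 0V ≡ + 0)

lincomb : {I : Set} → (I → V → ℤ) → List (ℤ × I) → V → ℤ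
lincomb b cs v = sumℤ (map (λ ci → proj₁ ci ℤ.* b (proj₂ ci) v) cs)

IsFree : ((V → ℤ) → Set) → Set₁
IsFree P = Σ Set λ I → Σ (I → V → ℤ) λ b →
    (∀ i → P (b i))
  × (∀ f → P f → Σ (List (ℤ × I)) λ cs → ∀ v → f v ≡ lincomb b cs v)
  × (∀ (cs : List (ℤ × I)) → Unique (map proj₂ cs) →
       (∀ v → lincomb b cs v ≡ + 0) → All (λ ci → proj₁ ci ≡ + 0) cs)

{-# OPTIONS --safe #-}
module Submission where

open import Defs
open import Data.Nat using (ℕ)
open import Data.Nat.Primality using (Prime)
open import Data.Product using (_×_)

open import Data.Bool using (Bool; true; false; not; T)
open import Data.Bool.Properties using (T-irrelevant)
open import Data.Empty using (⊥-elim; ⊥-elim-irr)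
open import Data.Unit using (⊤; tt)
open import Data.Sum using (_⊎_; inj₁; inj₂)
open import Data.Product using (Σ; ∃; _,_; proj₁; proj₂)
open import Data.Nat as ℕ using (zero; suc; NonZero; _^_; _<_; _≤_; _⊔_; z≤n; s≤s)
import Data.Nat.Properties as ℕP
import Data.Nat.Divisibility as ND
import Data.Nat.DivMod as NDM
import Data.Nat.Coprimality as NC
open import Data.Nat.GCD using (module Bézout)
open import Data.Nat.Primality using (prime?; ¬prime[1]; prime⇒nonZero; prime⇒nonTrivial; prime⇒irreducible; euclidsLemma)
open import Data.Integer as ℤ using (ℤ; +_)
import Data.Integer.Properties as ℤP
import Data.Integer.Divisibility.Signed as ZD
import Data.Integer.GCD as ℤG
import Data.Integer.DivMod as ZDM
open import Data.Rational as ℚ using (ℚ; _/_; ↥_; ↧_; ↧ₙ_; 0ℚ)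
import Data.Rational.Properties as ℚP
import Data.Rational.Unnormalised as ℚᵘ
import Data.Rational.Unnormalised.Properties as ℚᵘP
open import Data.List using (List; []; _∷_; map; _++_; concatMap; filter; foldr; upTo; applyUpTo; length; deduplicate; null)
open import Data.List.Properties using (map-cong; map-cong-local; map-∘; length-map)
import Data.List.Properties as ListP
open import Data.List.Extrema.Nat using (max; xs≤max)
open import Data.List.Membership.Propositional using (_∈_; _∉_; lose; mapWith∈)
open import Data.List.Membership.Propositional.Properties using (∈-map⁺; ∈-map⁻; ∈-concatMap⁺; ∈-filter⁺; ∈-filter⁻; ∈-deduplicate⁺; ∈-deduplicate⁻; ∈-upTo⁺)
open import Data.List.Membership.DecPropositional ℕ._≟_ using (_∈?_)
open import Data.List.Relation.Unary.Any using (here; there)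
open import Data.List.Relation.Unary.All as All using (All; []; _∷_)
import Data.List.Relation.Unary.All.Properties as AllP
open import Data.List.Relation.Unary.AllPairs as AllPairs using (AllPairs; []; _∷_)
import Data.List.Relation.Unary.AllPairs.Properties as AllPairsP
open import Data.List.Relation.Unary.Unique.Propositional using (Unique)
import Data.List.Relation.Unary.Unique.Propositional.Properties as UniqueP
open import Data.List.Relation.Unary.Unique.DecPropositional.Properties using (deduplicate-!)
open import Relation.Nullary using (¬_; ¬?; Dec; yes; no; recompute; _×-dec_)
open import Relation.Unary using (Decidable)
open import Relation.Binary.Definitions using (DecidableEquality; tri<; tri≈; tri>)
open import Relation.Binary.PropositionalEquality
import Data.Integer.Solver
import Data.Nat.Solver
import Data.Rational.Solver

-- For each prime ℓ, 𝒮(V_ℓ) has an explicit ℤ-basis of Haar type: f⁰ together with the indicators of the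
-- balls (a , b)/ℓ^(k+1) + ℓ^(k+1) ℤ_ℓ² in ℓ^-(k+1) ℤ_ℓ², leaving out the balls centred at a level-k centre.
-- Each basis vector has a dual functional given by values at one or two rational points, and a function of
-- level n killed by all functionals of level ≤ n is zero; this gives the expansion of every local function.
-- Restrictions to V of products of local basis vectors that are f⁰ at the primes of 𝒮 and at almost all
-- others span 𝒮(V_𝒮), by multiplying out the local expansions. They are independent: moving the point by a
-- rational that approximates any target at one prime ℓ₁ but is negligible at the other relevant primes turns
-- a vanishing combination into a function of the target at ℓ₁, whose ℓ₁-dual functionals split the
-- combination by the index at ℓ₁; induction on the primes finishes. The product with all factors f⁰ is 1 at
-- 0, so subtracting multiples of it from the other basis vectors gives a basis of 𝒮(V_𝒮').

private
  module ℤS = Data.Integer.Solver.+-*-Solver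
  module ℕS = Data.Nat.Solver.+-*-Solver
  module ℚS = Data.Rational.Solver.+-*-Solver

-- Fractions and finite sums

*≡*⇒/≡/ : ∀ (a b : ℤ) (d e : ℕ) .{{_ : NonZero d}} .{{_ : NonZero e}} →
          a ℤ.* + e ≡ b ℤ.* + d → a / d ≡ b / e
*≡*⇒/≡/ a b (suc d) (suc e) eq = ℚP.fromℚᵘ-cong {ℚᵘ.mkℚᵘ a d} {ℚᵘ.mkℚᵘ b e} (ℚᵘ.*≡* eq)

/≡/⇒*≡* : ∀ (a b : ℤ) (d e : ℕ) .{{_ : NonZero d}} .{{_ : NonZero e}} →
          a / d ≡ b / e → a ℤ.* + e ≡ b ℤ.* + d
/≡/⇒*≡* a b (suc d) (suc e) eq with ℚP./-injective-≃ (ℚᵘ.mkℚᵘ a d) (ℚᵘ.mkℚᵘ b e) eq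
... | ℚᵘ.*≡* p = p

p≡↥p/↧p : ∀ p → p ≡ ↥ p / ↧ₙ p
p≡↥p/↧p p = sym (ℚP.↥p/↧p≡p p)

↧ₙ-/-∣ : ∀ a d .{{_ : NonZero d}} → ↧ₙ (a / d) ND.∣ d
↧ₙ-/-∣ a d = ZD.∣⇒∣ᵤ {↧ (a / d)} {+ d}
  (ZD.divides (ℤG.gcd a (+ d)) (trans (sym (ℚP.↧-/ a d)) (ℤP.*-comm (↧ (a / d)) (ℤG.gcd a (+ d)))))

toℚᵘ-/ : ∀ (a : ℤ) (d : ℕ) → ℚ.toℚᵘ (a / suc d) ℚᵘ.≃ ℚᵘ.mkℚᵘ a d
toℚᵘ-/ a d = ℚP.toℚᵘ-fromℚᵘ (ℚᵘ.mkℚᵘ a d)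

/+/≡ : ∀ (a b : ℤ) (d e : ℕ) .{{_ : NonZero d}} .{{_ : NonZero e}} →
       a / d ℚ.+ b / e ≡ _/_ (a ℤ.* + e ℤ.+ b ℤ.* + d) (d ℕ.* e) {{ℕP.m*n≢0 d e}}
/+/≡ a b (suc d) (suc e) = trans (sym (ℚP.fromℚᵘ-toℚᵘ (a / suc d ℚ.+ b / suc e)))
  (ℚP.fromℚᵘ-cong (ℚᵘP.≃-trans (ℚP.toℚᵘ-homo-+ (a / suc d) (b / suc e)) (ℚᵘP.+-cong (toℚᵘ-/ a d) (toℚᵘ-/ b e))))

/*/≡ : ∀ (a b : ℤ) (d e : ℕ) .{{_ : NonZero d}} .{{_ : NonZero e}} →
       (a / d) ℚ.* (b / e) ≡ _/_ (a ℤ.* b) (d ℕ.* e) {{ℕP.m*n≢0 d e}}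
/*/≡ a b (suc d) (suc e) = trans (sym (ℚP.fromℚᵘ-toℚᵘ ((a / suc d) ℚ.* (b / suc e))))
  (ℚP.fromℚᵘ-cong (ℚᵘP.≃-trans (ℚP.toℚᵘ-homo-* (a / suc d) (b / suc e)) (ℚᵘP.*-cong (toℚᵘ-/ a d) (toℚᵘ-/ b e))))

-[/]≡ : ∀ (a : ℤ) (d : ℕ) .{{_ : NonZero d}} → ℚ.- (a / d) ≡ (ℤ.- a) / d
-[/]≡ a (suc d) = trans (sym (ℚP.fromℚᵘ-toℚᵘ (ℚ.- (a / suc d))))
  (ℚP.fromℚᵘ-cong (ℚᵘP.≃-trans (ℚP.toℚᵘ-homo‿- (a / suc d)) (ℚᵘP.-‿cong (toℚᵘ-/ a d))))

/-/≡ : ∀ (a b : ℤ) (d e : ℕ) .{{_ : NonZero d}} .{{_ : NonZero e}} →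
       a / d ℚ.- b / e ≡ _/_ (a ℤ.* + e ℤ.- b ℤ.* + d) (d ℕ.* e) {{ℕP.m*n≢0 d e}}
/-/≡ a b d e = trans (cong (a / d ℚ.+_) (-[/]≡ b e))
  (trans (/+/≡ a (ℤ.- b) d e) (ℚP./-cong {{ℕP.m*n≢0 d e}} {{ℕP.m*n≢0 d e}} (cong (λ z → a ℤ.* + e ℤ.+ z) (sym (ℤP.neg-distribˡ-* b (+ d)))) refl))

/-/≡-sameDen : ∀ (a b : ℤ) (d : ℕ) .{{_ : NonZero d}} → a / d ℚ.- b / d ≡ (a ℤ.- b) / d
/-/≡-sameDen a b d = trans (/-/≡ a b d d) (*≡*⇒/≡/ (a ℤ.* + d ℤ.- b ℤ.* + d) (a ℤ.- b) (d ℕ.* d) d {{ℕP.m*n≢0 d d}} (begin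
    (a ℤ.* + d ℤ.- b ℤ.* + d) ℤ.* + d ≡⟨ solve 3 (λ a b d → (a :* d :- b :* d) :* d := (a :- b) :* (d :* d)) refl a b (+ d) ⟩
    (a ℤ.- b) ℤ.* (+ d ℤ.* + d)       ≡⟨ cong ((a ℤ.- b) ℤ.*_) (sym (ℤP.pos-* d d)) ⟩
    (a ℤ.- b) ℤ.* + (d ℕ.* d)         ∎))
  where
  open ≡-Reasoning
  open ℤS

y≡x-[x-y] : ∀ x y → y ≡ x ℚ.- (x ℚ.- y)
y≡x-[x-y] = solve 2 (λ x y → y := x :- (x :- y)) refl
  where open ℚS

x+[y-x]≡y : ∀ x y → x ℚ.+ (y ℚ.- x) ≡ y
x+[y-x]≡y = solve 2 (λ x y → x :+ (y :- x) := y) refl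
  where open ℚS

x-z≡[x-y]+[y-z] : ∀ x y z → x ℚ.- z ≡ (x ℚ.- y) ℚ.+ (y ℚ.- z)
x-z≡[x-y]+[y-z] = solve 3 (λ x y z → x :- z := (x :- y) :+ (y :- z)) refl
  where open ℚS

y-x≡-[x-y] : ∀ x y → y ℚ.- x ≡ ℚ.- (x ℚ.- y)
y-x≡-[x-y] = solve 2 (λ x y → y :- x := :- (x :- y)) refl
  where open ℚS

x-0≡x : ∀ x → x ℚ.- 0ℚ ≡ x
x-0≡x = solve 1 (λ x → x :- con 0ℚ := x) refl
  where open ℚS

∣∧<⇒≡0 : ∀ {N d} → N ND.∣ d → d < N → d ≡ 0
∣∧<⇒≡0 {d = zero}  _  _  = refl
∣∧<⇒≡0 {d = suc d} dv lt = ⊥-elim (ℕP.<⇒≱ lt (ND.∣⇒≤ dv))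

∣-∧<⇒≡ : ∀ N x y → x < N → y < N → (+ N) ZD.∣ (+ x ℤ.- + y) → x ≡ y
∣-∧<⇒≡ N x y x<N y<N N∣x-y with ℕP.≤-total y x
... | inj₁ y≤x = ℕP.≤-antisym (ℕP.m∸n≡0⇒m≤n (∣∧<⇒≡0 (ZD.∣⇒∣ᵤ (subst ((+ N) ZD.∣_) x-y≡ N∣x-y)) (ℕP.≤-<-trans (ℕP.m∸n≤m x y) x<N))) y≤x
  where
  x-y≡ : + x ℤ.- + y ≡ + (x ℕ.∸ y)
  x-y≡ = trans (ℤP.m-n≡m⊖n x y) (ℤP.⊖-≥ y≤x)
... | inj₂ x≤y = ℕP.≤-antisym x≤y (ℕP.m∸n≡0⇒m≤n (∣∧<⇒≡0 (ZD.∣⇒∣ᵤ (subst ((+ N) ZD.∣_) y-x≡ (ZD.∣m⇒∣-m N∣x-y))) (ℕP.≤-<-trans (ℕP.m∸n≤m y x) y<N)))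
  where
  y-x≡ : ℤ.- (+ x ℤ.- + y) ≡ + (y ℕ.∸ x)
  y-x≡ = trans (cong ℤ.-_ (trans (ℤP.m-n≡m⊖n x y) (ℤP.⊖-≤ x≤y))) (ℤP.neg-involutive _)

ℓ^-mono-∣ : ∀ ℓ {a b} → a ≤ b → ℓ ^ a ND.∣ ℓ ^ b
ℓ^-mono-∣ ℓ {a} {b} a≤b = ND.divides (ℓ ^ (b ℕ.∸ a)) (begin
    ℓ ^ b                     ≡⟨ cong (ℓ ^_) (sym (ℕP.m+[n∸m]≡n a≤b)) ⟩
    ℓ ^ (a ℕ.+ (b ℕ.∸ a))     ≡⟨ ℕP.^-distribˡ-+-* ℓ a (b ℕ.∸ a) ⟩
    ℓ ^ a ℕ.* ℓ ^ (b ℕ.∸ a)   ≡⟨ ℕP.*-comm (ℓ ^ a) (ℓ ^ (b ℕ.∸ a)) ⟩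
    ℓ ^ (b ℕ.∸ a) ℕ.* ℓ ^ a   ∎)
  where open ≡-Reasoning

/-/≡-common : ∀ (A B : ℤ) (L D : ℕ) .{{_ : NonZero L}} .{{_ : NonZero D}} →
              _/_ A (L ℕ.* D) {{ℕP.m*n≢0 L D}} ℚ.- B / L ≡ _/_ (A ℤ.- B ℤ.* + D) (L ℕ.* D) {{ℕP.m*n≢0 L D}}
/-/≡-common A B L D = trans (/-/≡ A B (L ℕ.* D) L {{LD≢0}})
  (*≡*⇒/≡/ (A ℤ.* + L ℤ.- B ℤ.* + (L ℕ.* D)) (A ℤ.- B ℤ.* + D) ((L ℕ.* D) ℕ.* L) (L ℕ.* D) {{ℕP.m*n≢0 (L ℕ.* D) L {{LD≢0}}}} {{LD≢0}} (begin
    (A ℤ.* + L ℤ.- B ℤ.* + (L ℕ.* D)) ℤ.* + (L ℕ.* D)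
      ≡⟨ cong (λ z → (A ℤ.* + L ℤ.- B ℤ.* z) ℤ.* z) (ℤP.pos-* L D) ⟩
    (A ℤ.* + L ℤ.- B ℤ.* (+ L ℤ.* + D)) ℤ.* (+ L ℤ.* + D)
      ≡⟨ solve 4 (λ a b l d → (a :* l :- b :* (l :* d)) :* (l :* d) := (a :- b :* d) :* ((l :* d) :* l)) refl A B (+ L) (+ D) ⟩
    (A ℤ.- B ℤ.* + D) ℤ.* ((+ L ℤ.* + D) ℤ.* + L)
      ≡⟨ cong (λ z → (A ℤ.- B ℤ.* + D) ℤ.* (z ℤ.* + L)) (sym (ℤP.pos-* L D)) ⟩
    (A ℤ.- B ℤ.* + D) ℤ.* (+ (L ℕ.* D) ℤ.* + L)
      ≡⟨ cong ((A ℤ.- B ℤ.* + D) ℤ.*_) (sym (ℤP.pos-* (L ℕ.* D) L)) ⟩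
    (A ℤ.- B ℤ.* + D) ℤ.* + ((L ℕ.* D) ℕ.* L) ∎))
  where
  open ≡-Reasoning
  open ℤS
  LD≢0 = ℕP.m*n≢0 L D

sumℤ-++ : ∀ {A : Set} (f : A → ℤ) L M → sumℤ (map f (L ++ M)) ≡ sumℤ (map f L) ℤ.+ sumℤ (map f M)
sumℤ-++ f []      M = sym (ℤP.+-identityˡ _)
sumℤ-++ f (x ∷ L) M = trans (cong (λ z → f x ℤ.+ z) (sumℤ-++ f L M)) (sym (ℤP.+-assoc (f x) _ _))

prodℤ-++ : ∀ {A : Set} (f : A → ℤ) L M → prodℤ (map f (L ++ M)) ≡ prodℤ (map f L) ℤ.* prodℤ (map f M)
prodℤ-++ f []      M = sym (ℤP.*-identityˡ _)
prodℤ-++ f (x ∷ L) M = trans (cong (f x ℤ.*_) (prodℤ-++ f L M)) (sym (ℤP.*-assoc (f x) _ _))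

sumℤ-concatMap : ∀ {A B : Set} (f : B → ℤ) (g : A → List B) L →
                 sumℤ (map f (concatMap g L)) ≡ sumℤ (map (λ x → sumℤ (map f (g x))) L)
sumℤ-concatMap f g []      = refl
sumℤ-concatMap f g (x ∷ L) = trans (sumℤ-++ f (g x) (concatMap g L)) (cong (λ z → sumℤ (map f (g x)) ℤ.+ z) (sumℤ-concatMap f g L))

*-sumℤ : ∀ {A : Set} a (f : A → ℤ) L → a ℤ.* sumℤ (map f L) ≡ sumℤ (map (λ x → a ℤ.* f x) L)
*-sumℤ a f []      = ℤP.*-zeroʳ a
*-sumℤ a f (x ∷ L) = trans (ℤP.*-distribˡ-+ a (f x) _) (cong (λ z → a ℤ.* f x ℤ.+ z) (*-sumℤ a f L))

sumℤ-* : ∀ {A : Set} a (f : A → ℤ) L → sumℤ (map f L) ℤ.* a ≡ sumℤ (map (λ x → f x ℤ.* a) L)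
sumℤ-* a f []      = refl
sumℤ-* a f (x ∷ L) = trans (ℤP.*-distribʳ-+ a (f x) _) (cong (λ z → f x ℤ.* a ℤ.+ z) (sumℤ-* a f L))

sumℤ-0 : ∀ {A : Set} (f : A → ℤ) L → All (λ x → f x ≡ + 0) L → sumℤ (map f L) ≡ + 0
sumℤ-0 f []      []           = refl
sumℤ-0 f (x ∷ L) (fx≡0 ∷ f≡0) = cong₂ ℤ._+_ fx≡0 (sumℤ-0 f L f≡0)

sumℤ-filter : ∀ {A : Set} {P : A → Set} (P? : Decidable P) (f : A → ℤ) L → (∀ x → ¬ P x → f x ≡ + 0) →
              sumℤ (map f (filter P? L)) ≡ sumℤ (map f L)
sumℤ-filter P? f []      _ = refl
sumℤ-filter P? f (x ∷ L) ¬P⇒0 with P? x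
... | yes _  = cong (λ z → f x ℤ.+ z) (sumℤ-filter P? f L ¬P⇒0)
... | no ¬Px = trans (sumℤ-filter P? f L ¬P⇒0) (sym (trans (cong (ℤ._+ sumℤ (map f L)) (¬P⇒0 x ¬Px)) (ℤP.+-identityˡ _)))

-- ℓ-adic size of rationals

-- The primality proof is an irrelevant parameter, so that the local basis does not depend on it: keys carry
-- their validity proofs irrelevantly.
module Adic (ℓ : ℕ) .(ℓ-prime₀ : Prime ℓ) where

  ℓ-prime : Prime ℓ
  ℓ-prime = recompute (prime? ℓ) ℓ-prime₀

  instance
    ℓ≢0 : NonZero ℓ
    ℓ≢0 = prime⇒nonZero ℓ-prime

  ℓ^≢0 : ∀ k → NonZero (ℓ ^ k)
  ℓ^≢0 k = ℕP.m^n≢0 ℓ k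

  1<ℓ : 1 < ℓ
  1<ℓ = ℕ.nonTrivial⇒n>1 ℓ {{prime⇒nonTrivial ℓ-prime}}

  ℓ∤1 : ¬ ℓ ND.∣ 1
  ℓ∤1 ℓ∣1 = ¬prime[1] (subst Prime (ND.∣1⇒≡1 ℓ∣1) ℓ-prime)

  ∤⇒≢0 : ∀ {D} → ¬ ℓ ND.∣ D → NonZero D
  ∤⇒≢0 {zero}  ℓ∤0 = ⊥-elim (ℓ∤0 (ND._∣0 ℓ))
  ∤⇒≢0 {suc D} _   = _

  ∤-* : ∀ {a b} → ¬ ℓ ND.∣ a → ¬ ℓ ND.∣ b → ¬ ℓ ND.∣ a ℕ.* b
  ∤-* {a} {b} ℓ∤a ℓ∤b ℓ∣ab with euclidsLemma a b ℓ-prime ℓ∣ab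
  ... | inj₁ ℓ∣a = ℓ∤a ℓ∣a
  ... | inj₂ ℓ∣b = ℓ∤b ℓ∣b

  ∤-^ : ∀ {a} → ¬ ℓ ND.∣ a → ∀ k → ¬ ℓ ND.∣ a ^ k
  ∤-^ ℓ∤a zero    = ℓ∤1
  ∤-^ ℓ∤a (suc k) = ∤-* ℓ∤a (∤-^ ℓ∤a k)

  ℓ^-coprime : ∀ {D} → ¬ ℓ ND.∣ D → ∀ K → NC.Coprime (ℓ ^ K) D
  ℓ^-coprime {D} ℓ∤D K {i} (i∣ℓ^K , i∣D) = ND.∣1⇒≡1 (coprime-∣ℓ^ K i∣ℓ^K)
    where
    i-coprime-ℓ : NC.Coprime i ℓ
    i-coprime-ℓ (d∣i , d∣ℓ) with prime⇒irreducible ℓ-prime d∣ℓ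
    ... | inj₁ d≡1 = d≡1
    ... | inj₂ refl = ⊥-elim (ℓ∤D (ND.∣-trans d∣i i∣D))
    coprime-∣ℓ^ : ∀ K → i ND.∣ ℓ ^ K → i ND.∣ 1
    coprime-∣ℓ^ zero    i∣1 = i∣1
    coprime-∣ℓ^ (suc K) i∣ℓℓ^K = coprime-∣ℓ^ K (NC.coprime-divisor i-coprime-ℓ i∣ℓℓ^K)

  ℓ^∣*∤⇒∣ : ∀ {x b} m → ¬ ℓ ND.∣ b → ℓ ^ m ND.∣ x ℕ.* b → ℓ ^ m ND.∣ x
  ℓ^∣*∤⇒∣ {x} {b} m ℓ∤b ∣xb = NC.coprime-divisor (ℓ^-coprime ℓ∤b m) (subst (ℓ ^ m ND.∣_) (ℕP.*-comm x b) ∣xb)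

  ℓ^∣ℤ*∤⇒∣ : ∀ {A : ℤ} {b : ℕ} m → ¬ ℓ ND.∣ b → (+ (ℓ ^ m)) ZD.∣ (A ℤ.* + b) → (+ (ℓ ^ m)) ZD.∣ A
  ℓ^∣ℤ*∤⇒∣ {A} {b} m ℓ∤b ∣Ab = ZD.∣ᵤ⇒∣ (ℓ^∣*∤⇒∣ m ℓ∤b (subst (ℓ ^ m ND.∣_) (ℤP.abs-* A (+ b)) (ZD.∣⇒∣ᵤ ∣Ab)))

  inverse-mod-ℓ^ : ∀ {D} → ¬ ℓ ND.∣ D → (K : ℕ) → Σ ℤ λ u → (+ (ℓ ^ K)) ZD.∣ (u ℤ.* + D ℤ.- + 1)
  inverse-mod-ℓ^ {D} ℓ∤D K with NC.coprime-Bézout (NC.sym (ℓ^-coprime ℓ∤D K))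
  ... | Bézout.+- x y eq = + x , ZD.divides (+ y) (begin
          + x ℤ.* + D ℤ.- + 1              ≡⟨ cong (ℤ._- + 1) (sym (ℤP.pos-* x D)) ⟩
          + (x ℕ.* D) ℤ.- + 1              ≡⟨ cong (λ z → + z ℤ.- + 1) (sym eq) ⟩
          + (1 ℕ.+ y ℕ.* ℓ ^ K) ℤ.- + 1    ≡⟨ cong (ℤ._- + 1) (ℤP.pos-+ 1 (y ℕ.* ℓ ^ K)) ⟩
          + 1 ℤ.+ + (y ℕ.* ℓ ^ K) ℤ.- + 1  ≡⟨ solve 1 (λ z → con (+ 1) :+ z :- con (+ 1) := z) refl (+ (y ℕ.* ℓ ^ K)) ⟩
          + (y ℕ.* ℓ ^ K)                  ≡⟨ ℤP.pos-* y (ℓ ^ K) ⟩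
          + y ℤ.* + (ℓ ^ K)                ∎)
    where
    open ≡-Reasoning
    open ℤS
  ... | Bézout.-+ x y eq = ℤ.- + x , ZD.divides (ℤ.- + y) (begin
          ℤ.- + x ℤ.* + D ℤ.- + 1          ≡⟨ solve 2 (λ a b → (:- a) :* b :- con (+ 1) := :- (con (+ 1) :+ a :* b)) refl (+ x) (+ D) ⟩
          ℤ.- (+ 1 ℤ.+ + x ℤ.* + D)        ≡⟨ cong (λ z → ℤ.- (+ 1 ℤ.+ z)) (sym (ℤP.pos-* x D)) ⟩
          ℤ.- (+ 1 ℤ.+ + (x ℕ.* D))        ≡⟨ cong ℤ.-_ (sym (ℤP.pos-+ 1 (x ℕ.* D))) ⟩
          ℤ.- (+ (1 ℕ.+ x ℕ.* D))          ≡⟨ cong (λ z → ℤ.- (+ z)) eq ⟩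
          ℤ.- (+ (y ℕ.* ℓ ^ K))            ≡⟨ cong ℤ.-_ (ℤP.pos-* y (ℓ ^ K)) ⟩
          ℤ.- (+ y ℤ.* + (ℓ ^ K))          ≡⟨ ℤP.neg-distribˡ-* (+ y) (+ (ℓ ^ K)) ⟩
          ℤ.- + y ℤ.* + (ℓ ^ K)            ∎)
    where
    open ≡-Reasoning
    open ℤS

  Integral-/ : ∀ (a : ℤ) (d : ℕ) .{{_ : NonZero d}} → ¬ ℓ ND.∣ d → Integral ℓ (a / d)
  Integral-/ a d ℓ∤d ℓ∣↧ = ℓ∤d (ND.∣-trans ℓ∣↧ (↧ₙ-/-∣ a d))

  pow*≡/ : ∀ n q → pow ℓ n ℚ.* q ≡ (+ (ℓ ^ n) ℤ.* ↥ q) / (1 ℕ.* ↧ₙ q)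
  pow*≡/ n q = trans (cong (pow ℓ n ℚ.*_) (p≡↥p/↧p q)) (/*/≡ (+ (ℓ ^ n)) (↥ q) 1 (↧ₙ q))

  ∣⇒InSmall : ∀ (A : ℤ) n k D M .{{_ : NonZero M}} → M ≡ ℓ ^ k ℕ.* D → ¬ ℓ ND.∣ D →
              (+ (ℓ ^ (n ℕ.+ k))) ZD.∣ A → InSmall ℓ n (A / M)
  ∣⇒InSmall A n k D M M≡ ℓ∤D (ZD.divides B A≡) =
    _/_ B D {{D≢0}} , Integral-/ B D {{D≢0}} ℓ∤D ,
    sym (trans (/*/≡ (+ (ℓ ^ n)) B 1 D {{_}} {{D≢0}}) (*≡*⇒/≡/ (+ (ℓ ^ n) ℤ.* B) A (1 ℕ.* D) M {{ℕP.m*n≢0 1 D {{_}} {{D≢0}}}} (begin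
      + (ℓ ^ n) ℤ.* B ℤ.* + M                  ≡⟨ cong (λ z → + (ℓ ^ n) ℤ.* B ℤ.* + z) M≡ ⟩
      + (ℓ ^ n) ℤ.* B ℤ.* + (ℓ ^ k ℕ.* D)      ≡⟨ cong (λ z → + (ℓ ^ n) ℤ.* B ℤ.* z) (ℤP.pos-* (ℓ ^ k) D) ⟩
      + (ℓ ^ n) ℤ.* B ℤ.* (+ (ℓ ^ k) ℤ.* + D)  ≡⟨ solve 4 (λ x b y d → x :* b :* (y :* d) := b :* (x :* y) :* d) refl (+ (ℓ ^ n)) B (+ (ℓ ^ k)) (+ D) ⟩
      B ℤ.* (+ (ℓ ^ n) ℤ.* + (ℓ ^ k)) ℤ.* + D  ≡⟨ cong (λ z → B ℤ.* z ℤ.* + D) (sym (ℤP.pos-* (ℓ ^ n) (ℓ ^ k))) ⟩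
      B ℤ.* + (ℓ ^ n ℕ.* ℓ ^ k) ℤ.* + D        ≡⟨ cong (λ z → B ℤ.* + z ℤ.* + D) (sym (ℕP.^-distribˡ-+-* ℓ n k)) ⟩
      B ℤ.* + (ℓ ^ (n ℕ.+ k)) ℤ.* + D          ≡⟨ cong (ℤ._* + D) (sym A≡) ⟩
      A ℤ.* + D                                ≡⟨ cong (λ z → A ℤ.* + z) (sym (ℕP.*-identityˡ D)) ⟩
      A ℤ.* + (1 ℕ.* D)                        ∎)))
    where
    open ≡-Reasoning
    open ℤS
    D≢0 = ∤⇒≢0 ℓ∤D

  InSmall⇒∣ : ∀ (A : ℤ) n k D M .{{_ : NonZero M}} → M ≡ ℓ ^ k ℕ.* D → ¬ ℓ ND.∣ D →
              InSmall ℓ n (A / M) → (+ (ℓ ^ (n ℕ.+ k))) ZD.∣ A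
  InSmall⇒∣ A n k D M M≡ ℓ∤D (r , ℓ∤↧r , A/M≡) = ℓ^∣ℤ*∤⇒∣ (n ℕ.+ k) ℓ∤↧r (ZD.divides (↥ r ℤ.* + D) (begin
      A ℤ.* + ↧ₙ r                              ≡⟨ cong (λ z → A ℤ.* + z) (sym (ℕP.*-identityˡ (↧ₙ r))) ⟩
      A ℤ.* + (1 ℕ.* ↧ₙ r)                      ≡⟨ /≡/⇒*≡* A (+ (ℓ ^ n) ℤ.* ↥ r) M (1 ℕ.* ↧ₙ r) (trans A/M≡ (pow*≡/ n r)) ⟩
      (+ (ℓ ^ n) ℤ.* ↥ r) ℤ.* + M               ≡⟨ cong (λ z → (+ (ℓ ^ n) ℤ.* ↥ r) ℤ.* + z) M≡ ⟩
      (+ (ℓ ^ n) ℤ.* ↥ r) ℤ.* + (ℓ ^ k ℕ.* D)   ≡⟨ cong ((+ (ℓ ^ n) ℤ.* ↥ r) ℤ.*_) (ℤP.pos-* (ℓ ^ k) D) ⟩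
      (+ (ℓ ^ n) ℤ.* ↥ r) ℤ.* (+ (ℓ ^ k) ℤ.* + D) ≡⟨ solve 4 (λ x b y d → (x :* b) :* (y :* d) := b :* d :* (x :* y)) refl (+ (ℓ ^ n)) (↥ r) (+ (ℓ ^ k)) (+ D) ⟩
      ↥ r ℤ.* + D ℤ.* (+ (ℓ ^ n) ℤ.* + (ℓ ^ k)) ≡⟨ cong (↥ r ℤ.* + D ℤ.*_) (sym (ℤP.pos-* (ℓ ^ n) (ℓ ^ k))) ⟩
      ↥ r ℤ.* + D ℤ.* + (ℓ ^ n ℕ.* ℓ ^ k)       ≡⟨ cong (λ z → ↥ r ℤ.* + D ℤ.* + z) (sym (ℕP.^-distribˡ-+-* ℓ n k)) ⟩
      ↥ r ℤ.* + D ℤ.* + (ℓ ^ (n ℕ.+ k))         ∎))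
    where
    open ≡-Reasoning
    open ℤS

  ∣⇒InSmall-/ : ∀ (A : ℤ) n D .{{_ : NonZero D}} → ¬ ℓ ND.∣ D → (+ (ℓ ^ n)) ZD.∣ A → InSmall ℓ n (A / D)
  ∣⇒InSmall-/ A n D ℓ∤D ∣A = ∣⇒InSmall A n 0 D D (sym (ℕP.*-identityˡ D)) ℓ∤D (subst (λ z → (+ (ℓ ^ z)) ZD.∣ A) (sym (ℕP.+-identityʳ n)) ∣A)

  ∣↥⇒InSmall : ∀ n q → ¬ ℓ ND.∣ ↧ₙ q → (+ (ℓ ^ n)) ZD.∣ ↥ q → InSmall ℓ n q
  ∣↥⇒InSmall n q ℓ∤↧q ∣↥q = subst (InSmall ℓ n) (sym (p≡↥p/↧p q)) (∣⇒InSmall-/ (↥ q) n (↧ₙ q) ℓ∤↧q ∣↥q)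

  InSmall⇒∤↧ : ∀ n q → InSmall ℓ n q → ¬ ℓ ND.∣ ↧ₙ q
  InSmall⇒∤↧ n q (r , ℓ∤↧r , q≡) ℓ∣↧q = ℓ∤↧r (ND.∣-trans ℓ∣↧q ↧q∣↧r)
    where
    ↧q∣↧r : ↧ₙ q ND.∣ ↧ₙ r
    ↧q∣↧r = subst (λ z → ↧ₙ z ND.∣ ↧ₙ r) (sym (trans q≡ (pow*≡/ n r)))
              (subst (↧ₙ ((+ (ℓ ^ n) ℤ.* ↥ r) / (1 ℕ.* ↧ₙ r)) ND.∣_) (ℕP.*-identityˡ (↧ₙ r)) (↧ₙ-/-∣ (+ (ℓ ^ n) ℤ.* ↥ r) (1 ℕ.* ↧ₙ r)))

  InSmall⇒∣↥ : ∀ n q → InSmall ℓ n q → (+ (ℓ ^ n)) ZD.∣ ↥ q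
  InSmall⇒∣↥ n q s = subst (λ z → (+ (ℓ ^ z)) ZD.∣ ↥ q) (ℕP.+-identityʳ n)
    (InSmall⇒∣ (↥ q) n 0 (↧ₙ q) (↧ₙ q) (sym (ℕP.*-identityˡ (↧ₙ q))) (InSmall⇒∤↧ n q s) (subst (InSmall ℓ n) (p≡↥p/↧p q) s))

  InSmall? : ∀ n q → Dec (InSmall ℓ n q)
  InSmall? n q with ℓ ND.∣? ↧ₙ q | (+ (ℓ ^ n)) ZD.∣? ↥ q
  ... | yes ℓ∣↧q | _        = no (λ s → InSmall⇒∤↧ n q s ℓ∣↧q)
  ... | no ℓ∤↧q  | yes ∣↥q  = yes (∣↥⇒InSmall n q ℓ∤↧q ∣↥q)
  ... | no _     | no ∤↥q   = no (λ s → ∤↥q (InSmall⇒∣↥ n q s))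

  InSmall-+ : ∀ n p q → InSmall ℓ n p → InSmall ℓ n q → InSmall ℓ n (p ℚ.+ q)
  InSmall-+ n p q sp sq = subst (InSmall ℓ n) (sym p+q≡)
      (∣⇒InSmall-/ _ n (↧ₙ p ℕ.* ↧ₙ q) {{ℕP.m*n≢0 (↧ₙ p) (↧ₙ q)}} (∤-* (InSmall⇒∤↧ n p sp) (InSmall⇒∤↧ n q sq))
        (ZD.∣m∣n⇒∣m+n (ZD.∣m⇒∣m*n (↧ q) (InSmall⇒∣↥ n p sp)) (ZD.∣m⇒∣m*n (↧ p) (InSmall⇒∣↥ n q sq))))
    where
    p+q≡ : p ℚ.+ q ≡ _/_ (↥ p ℤ.* ↧ q ℤ.+ ↥ q ℤ.* ↧ p) (↧ₙ p ℕ.* ↧ₙ q) {{ℕP.m*n≢0 (↧ₙ p) (↧ₙ q)}}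
    p+q≡ = trans (cong₂ ℚ._+_ (p≡↥p/↧p p) (p≡↥p/↧p q)) (/+/≡ (↥ p) (↥ q) (↧ₙ p) (↧ₙ q))

  InSmall-neg : ∀ n p → InSmall ℓ n p → InSmall ℓ n (ℚ.- p)
  InSmall-neg n p sp = subst (InSmall ℓ n) (sym (trans (cong ℚ.-_ (p≡↥p/↧p p)) (-[/]≡ (↥ p) (↧ₙ p))))
    (∣⇒InSmall-/ (ℤ.- ↥ p) n (↧ₙ p) (InSmall⇒∤↧ n p sp) (ZD.∣m⇒∣-m (InSmall⇒∣↥ n p sp)))

  InSmall-0 : ∀ n → InSmall ℓ n 0ℚ
  InSmall-0 n = ∣↥⇒InSmall n 0ℚ ℓ∤1 (ZD.divides (+ 0) refl)

  InSmall-pred : ∀ n q → InSmall ℓ (suc n) q → InSmall ℓ n q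
  InSmall-pred n q s = ∣↥⇒InSmall n q (InSmall⇒∤↧ (suc n) q s)
    (ZD.∣-trans (ZD.divides (+ ℓ) (ℤP.pos-* ℓ (ℓ ^ n))) (InSmall⇒∣↥ (suc n) q s))

  InSmall-≤ : ∀ {m n} q → m ≤ n → InSmall ℓ n q → InSmall ℓ m q
  InSmall-≤ {n = zero}  q z≤n s = s
  InSmall-≤ {n = suc n} q m≤n s with ℕP.m≤n⇒m<n∨m≡n m≤n
  ... | inj₂ refl  = s
  ... | inj₁ (s≤s m≤n) = InSmall-≤ q m≤n (InSmall-pred n q s)

  Integral⇒InSmall₀ : ∀ q → Integral ℓ q → InSmall ℓ 0 q
  Integral⇒InSmall₀ q ℓ∤↧q = ∣↥⇒InSmall 0 q ℓ∤↧q (ZD.divides (↥ q) (sym (ℤP.*-identityʳ (↥ q))))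

  InSmall₀⇒Integral : ∀ q → InSmall ℓ 0 q → Integral ℓ q
  InSmall₀⇒Integral q = InSmall⇒∤↧ 0 q

  infix 4 _≈[_]_
  _≈[_]_ : ℚ → ℕ → ℚ → Set
  x ≈[ m ] y = InSmall ℓ m (x ℚ.- y)

  ≈-refl : ∀ m x → x ≈[ m ] x
  ≈-refl m x = subst (InSmall ℓ m) (sym (ℚP.+-inverseʳ x)) (InSmall-0 m)

  ≈-sym : ∀ m x y → x ≈[ m ] y → y ≈[ m ] x
  ≈-sym m x y x≈y = subst (InSmall ℓ m) (sym (y-x≡-[x-y] x y)) (InSmall-neg m (x ℚ.- y) x≈y)

  ≈-trans : ∀ m x y z → x ≈[ m ] y → y ≈[ m ] z → x ≈[ m ] z
  ≈-trans m x y z x≈y y≈z = subst (InSmall ℓ m) (sym (x-z≡[x-y]+[y-z] x y z)) (InSmall-+ m (x ℚ.- y) (y ℚ.- z) x≈y y≈z)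

  ≈-≤ : ∀ {m n} x y → m ≤ n → x ≈[ n ] y → x ≈[ m ] y
  ≈-≤ x y m≤n = InSmall-≤ (x ℚ.- y) m≤n

  frac : ℕ → ℕ → ℚ
  frac m a = _/_ (+ a) (ℓ ^ m) {{ℓ^≢0 m}}

  frac-injective : ∀ m x y → x < ℓ ^ (m ℕ.+ m) → y < ℓ ^ (m ℕ.+ m) → frac m x ≈[ m ] frac m y → x ≡ y
  frac-injective m x y x< y< x≈y = ∣-∧<⇒≡ (ℓ ^ (m ℕ.+ m)) x y x< y<
    (InSmall⇒∣ (+ x ℤ.- + y) m m 1 (ℓ ^ m) {{ℓ^≢0 m}} (sym (ℕP.*-identityʳ (ℓ ^ m))) ℓ∤1
      (subst (InSmall ℓ m) (/-/≡-sameDen (+ x) (+ y) (ℓ ^ m) {{ℓ^≢0 m}}) x≈y))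

  frac-lift : ∀ m d a → frac m a ≡ frac (m ℕ.+ d) (a ℕ.* ℓ ^ d)
  frac-lift m d a = *≡*⇒/≡/ (+ a) (+ (a ℕ.* ℓ ^ d)) (ℓ ^ m) (ℓ ^ (m ℕ.+ d)) {{ℓ^≢0 m}} {{ℓ^≢0 (m ℕ.+ d)}} (begin
      + a ℤ.* + (ℓ ^ (m ℕ.+ d))    ≡⟨ sym (ℤP.pos-* a (ℓ ^ (m ℕ.+ d))) ⟩
      + (a ℕ.* ℓ ^ (m ℕ.+ d))      ≡⟨ cong (λ z → + (a ℕ.* z)) (ℕP.^-distribˡ-+-* ℓ m d) ⟩
      + (a ℕ.* (ℓ ^ m ℕ.* ℓ ^ d))  ≡⟨ cong +_ (solve 3 (λ a x y → a :* (x :* y) := a :* y :* x) refl a (ℓ ^ m) (ℓ ^ d)) ⟩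
      + (a ℕ.* ℓ ^ d ℕ.* ℓ ^ m)    ≡⟨ ℤP.pos-* (a ℕ.* ℓ ^ d) (ℓ ^ m) ⟩
      + (a ℕ.* ℓ ^ d) ℤ.* + (ℓ ^ m) ∎)
    where
    open ≡-Reasoning
    open ℕS

  frac-*ℓ : ∀ k a → frac (suc k) (a ℕ.* ℓ) ≡ frac k a
  frac-*ℓ k a = *≡*⇒/≡/ (+ (a ℕ.* ℓ)) (+ a) (ℓ ^ suc k) (ℓ ^ k) {{ℓ^≢0 (suc k)}} {{ℓ^≢0 k}} (begin
      + (a ℕ.* ℓ) ℤ.* + (ℓ ^ k)  ≡⟨ sym (ℤP.pos-* (a ℕ.* ℓ) (ℓ ^ k)) ⟩
      + (a ℕ.* ℓ ℕ.* ℓ ^ k)      ≡⟨ cong +_ (ℕP.*-assoc a ℓ (ℓ ^ k)) ⟩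
      + (a ℕ.* (ℓ ℕ.* ℓ ^ k))    ≡⟨ ℤP.pos-* a (ℓ ^ suc k) ⟩
      + a ℤ.* + (ℓ ^ suc k)      ∎)
    where open ≡-Reasoning

  pow-+ : ∀ a b → pow ℓ b ℚ.* pow ℓ a ≡ pow ℓ (b ℕ.+ a)
  pow-+ a b = trans (/*/≡ (+ (ℓ ^ b)) (+ (ℓ ^ a)) 1 1) (*≡*⇒/≡/ (+ (ℓ ^ b) ℤ.* + (ℓ ^ a)) (+ (ℓ ^ (b ℕ.+ a))) 1 1 (begin
      + (ℓ ^ b) ℤ.* + (ℓ ^ a) ℤ.* + 1   ≡⟨ ℤP.*-identityʳ _ ⟩
      + (ℓ ^ b) ℤ.* + (ℓ ^ a)           ≡⟨ sym (ℤP.pos-* (ℓ ^ b) (ℓ ^ a)) ⟩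
      + (ℓ ^ b ℕ.* ℓ ^ a)               ≡⟨ cong +_ (sym (ℕP.^-distribˡ-+-* ℓ b a)) ⟩
      + (ℓ ^ (b ℕ.+ a))                 ≡⟨ sym (ℤP.*-identityʳ _) ⟩
      + (ℓ ^ (b ℕ.+ a)) ℤ.* + (1 ℕ.* 1) ∎))
    where open ≡-Reasoning

  InSmall-pow* : ∀ a b d → InSmall ℓ a d → InSmall ℓ (b ℕ.+ a) (pow ℓ b ℚ.* d)
  InSmall-pow* a b d (r , ℓ∤↧r , d≡) = r , ℓ∤↧r , (begin
      pow ℓ b ℚ.* d                 ≡⟨ cong (pow ℓ b ℚ.*_) d≡ ⟩
      pow ℓ b ℚ.* (pow ℓ a ℚ.* r)   ≡⟨ sym (ℚP.*-assoc (pow ℓ b) (pow ℓ a) r) ⟩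
      pow ℓ b ℚ.* pow ℓ a ℚ.* r     ≡⟨ cong (ℚ._* r) (pow-+ a b) ⟩
      pow ℓ (b ℕ.+ a) ℚ.* r         ∎)
    where open ≡-Reasoning

  Integral-+ : ∀ p q → Integral ℓ p → Integral ℓ q → Integral ℓ (p ℚ.+ q)
  Integral-+ p q ip iq = InSmall₀⇒Integral (p ℚ.+ q) (InSmall-+ 0 p q (Integral⇒InSmall₀ p ip) (Integral⇒InSmall₀ q iq))

  InBig-+ : ∀ n x d → InBig ℓ n x → InSmall ℓ n d → InBig ℓ n (x ℚ.+ d)
  InBig-+ n x d bx sd = subst (Integral ℓ) (sym (ℚP.*-distribˡ-+ (pow ℓ n) x d))
    (Integral-+ (pow ℓ n ℚ.* x) (pow ℓ n ℚ.* d) bx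
      (InSmall₀⇒Integral (pow ℓ n ℚ.* d) (InSmall-≤ {n = n ℕ.+ n} (pow ℓ n ℚ.* d) z≤n (InSmall-pow* n n d sd))))

  InBig-≈ : ∀ {m} x y → InBig ℓ m y → x ≈[ m ] y → InBig ℓ m x
  InBig-≈ {m} x y by x≈y = subst (InBig ℓ m) (x+[y-x]≡y y x) (InBig-+ m y (x ℚ.- y) by x≈y)

  InBig-suc : ∀ n x → InBig ℓ n x → InBig ℓ (suc n) x
  InBig-suc n x bx = subst (Integral ℓ) ℓ[ℓ^nx]≡ℓ^[n+1]x
      (InSmall₀⇒Integral _ (InSmall-≤ {n = 1} (pow ℓ 1 ℚ.* (pow ℓ n ℚ.* x)) z≤n (InSmall-pow* 0 1 (pow ℓ n ℚ.* x) (Integral⇒InSmall₀ (pow ℓ n ℚ.* x) bx))))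
    where
    ℓ[ℓ^nx]≡ℓ^[n+1]x : pow ℓ 1 ℚ.* (pow ℓ n ℚ.* x) ≡ pow ℓ (suc n) ℚ.* x
    ℓ[ℓ^nx]≡ℓ^[n+1]x = trans (sym (ℚP.*-assoc (pow ℓ 1) (pow ℓ n) x)) (cong (ℚ._* x) (pow-+ n 1))

  InBig-≤ : ∀ {m n} x → m ≤ n → InBig ℓ m x → InBig ℓ n x
  InBig-≤ {n = zero}  x z≤n b = b
  InBig-≤ {n = suc n} x m≤n b with ℕP.m≤n⇒m<n∨m≡n m≤n
  ... | inj₂ refl      = b
  ... | inj₁ (s≤s m≤n) = InBig-suc n x (InBig-≤ x m≤n b)

  InBig₀⇒Integral : ∀ x → InBig ℓ 0 x → Integral ℓ x
  InBig₀⇒Integral x = subst (Integral ℓ) (ℚP.*-identityˡ x)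

  Integral⇒InBig₀ : ∀ x → Integral ℓ x → InBig ℓ 0 x
  Integral⇒InBig₀ x = subst (Integral ℓ) (sym (ℚP.*-identityˡ x))

  Integral? : ∀ x → Dec (Integral ℓ x)
  Integral? x = ¬? (ℓ ND.∣? ↧ₙ x)

  InBig? : ∀ n q → Dec (InBig ℓ n q)
  InBig? n q = Integral? (pow ℓ n ℚ.* q)

  InBig-frac : ∀ m a → InBig ℓ m (frac m a)
  InBig-frac m a = subst (Integral ℓ) (sym ℓ^m[a/ℓ^m]≡a) (Integral-/ (+ a) 1 ℓ∤1)
    where
    ℓ^m[a/ℓ^m]≡a : pow ℓ m ℚ.* frac m a ≡ (+ a) / 1
    ℓ^m[a/ℓ^m]≡a = trans (/*/≡ (+ (ℓ ^ m)) (+ a) 1 (ℓ ^ m) {{_}} {{ℓ^≢0 m}})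
      (*≡*⇒/≡/ (+ (ℓ ^ m) ℤ.* + a) (+ a) (1 ℕ.* ℓ ^ m) 1 {{ℕP.m*n≢0 1 (ℓ ^ m) {{_}} {{ℓ^≢0 m}}}}
        (trans (ℤP.*-identityʳ _) (trans (ℤP.*-comm (+ (ℓ ^ m)) (+ a)) (cong (λ z → + a ℤ.* + z) (sym (ℕP.*-identityˡ (ℓ ^ m)))))))

  ¬InBig-frac : ∀ m a → ¬ ℓ ND.∣ a → ¬ InBig ℓ m (frac (suc m) a)
  ¬InBig-frac m a ℓ∤a b = ℓ∤a (subst (ND._∣ a) (ℕP.*-identityʳ ℓ) (ZD.∣⇒∣ᵤ ℓ∣a))
    where
    ℓ^m[a/ℓ^[m+1]]≡a/ℓ : pow ℓ m ℚ.* frac (suc m) a ≡ (+ a) / ℓ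
    ℓ^m[a/ℓ^[m+1]]≡a/ℓ = trans (/*/≡ (+ (ℓ ^ m)) (+ a) 1 (ℓ ^ suc m) {{_}} {{ℓ^≢0 (suc m)}})
      (*≡*⇒/≡/ (+ (ℓ ^ m) ℤ.* + a) (+ a) (1 ℕ.* ℓ ^ suc m) ℓ {{ℕP.m*n≢0 1 (ℓ ^ suc m) {{_}} {{ℓ^≢0 (suc m)}}}} (begin
        + (ℓ ^ m) ℤ.* + a ℤ.* + ℓ      ≡⟨ solve 3 (λ x y z → x :* y :* z := y :* (z :* x)) refl (+ (ℓ ^ m)) (+ a) (+ ℓ) ⟩
        + a ℤ.* (+ ℓ ℤ.* + (ℓ ^ m))    ≡⟨ cong (+ a ℤ.*_) (sym (ℤP.pos-* ℓ (ℓ ^ m))) ⟩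
        + a ℤ.* + (ℓ ^ suc m)          ≡⟨ cong (λ z → + a ℤ.* + z) (sym (ℕP.*-identityˡ (ℓ ^ suc m))) ⟩
        + a ℤ.* + (1 ℕ.* ℓ ^ suc m)    ∎))
      where
      open ≡-Reasoning
      open ℤS
    ℓ∣a : (+ (ℓ ^ (0 ℕ.+ 1))) ZD.∣ (+ a)
    ℓ∣a = InSmall⇒∣ (+ a) 0 1 1 ℓ (sym (trans (ℕP.*-identityʳ (ℓ ℕ.* 1)) (ℕP.*-identityʳ ℓ))) ℓ∤1
            (Integral⇒InSmall₀ ((+ a) / ℓ) (subst (Integral ℓ) ℓ^m[a/ℓ^[m+1]]≡a/ℓ b))

  approximate-/ : ∀ n k (A : ℤ) (M D : ℕ) .{{_ : NonZero D}} → ¬ ℓ ND.∣ M → ¬ ℓ ND.∣ D →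
                  Σ ℤ λ c → _/_ A (ℓ ^ k ℕ.* D) {{ℕP.m*n≢0 (ℓ ^ k) D {{ℓ^≢0 k}}}} ≈[ n ] _/_ (+ M ℤ.* c) (ℓ ^ k) {{ℓ^≢0 k}}
  approximate-/ n k A M D ℓ∤M ℓ∤D = c , subst (InSmall ℓ n) (sym A/ℓ^kD-Mc/ℓ^k≡)
      (∣⇒InSmall (A ℤ.- + M ℤ.* c ℤ.* + D) n k D (ℓ ^ k ℕ.* D) {{ℓ^kD≢0}} refl ℓ∤D ℓ^[n+k]∣)
    where
    ℓ^kD≢0 = ℕP.m*n≢0 (ℓ ^ k) D {{ℓ^≢0 k}}
    inverse = inverse-mod-ℓ^ (∤-* ℓ∤M ℓ∤D) (n ℕ.+ k)
    u = proj₁ inverse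
    c = A ℤ.* u
    A/ℓ^kD-Mc/ℓ^k≡ : _/_ A (ℓ ^ k ℕ.* D) {{ℓ^kD≢0}} ℚ.- _/_ (+ M ℤ.* c) (ℓ ^ k) {{ℓ^≢0 k}}
                   ≡ _/_ (A ℤ.- + M ℤ.* c ℤ.* + D) (ℓ ^ k ℕ.* D) {{ℓ^kD≢0}}
    A/ℓ^kD-Mc/ℓ^k≡ = /-/≡-common A (+ M ℤ.* c) (ℓ ^ k) D {{ℓ^≢0 k}}
    ℓ^[n+k]∣ : (+ (ℓ ^ (n ℕ.+ k))) ZD.∣ (A ℤ.- + M ℤ.* c ℤ.* + D)
    ℓ^[n+k]∣ = subst ((+ (ℓ ^ (n ℕ.+ k))) ZD.∣_) (sym (begin
        A ℤ.- + M ℤ.* (A ℤ.* u) ℤ.* + D         ≡⟨ solve 4 (λ a m u d → a :- m :* (a :* u) :* d := (:- a) :* (u :* (m :* d) :- con (+ 1))) refl A (+ M) u (+ D) ⟩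
        (ℤ.- A) ℤ.* (u ℤ.* (+ M ℤ.* + D) ℤ.- + 1) ≡⟨ cong (λ z → (ℤ.- A) ℤ.* (u ℤ.* z ℤ.- + 1)) (sym (ℤP.pos-* M D)) ⟩
        (ℤ.- A) ℤ.* (u ℤ.* + (M ℕ.* D) ℤ.- + 1)   ∎))
      (ZD.∣n⇒∣m*n (ℤ.- A) (proj₂ inverse))
      where
      open ≡-Reasoning
      open ℤS

  ≡↥[pow*]/ : ∀ m x → x ≡ _/_ (↥ (pow ℓ m ℚ.* x)) (ℓ ^ m ℕ.* ↧ₙ (pow ℓ m ℚ.* x)) {{ℕP.m*n≢0 (ℓ ^ m) _ {{ℓ^≢0 m}}}}
  ≡↥[pow*]/ m x = trans (p≡↥p/↧p x) (*≡*⇒/≡/ (↥ x) (↥ y) (↧ₙ x) (ℓ ^ m ℕ.* D) {{_}} {{ℕP.m*n≢0 (ℓ ^ m) D {{ℓ^≢0 m}}}} (begin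
      ↥ x ℤ.* + (ℓ ^ m ℕ.* D)              ≡⟨ cong (↥ x ℤ.*_) (ℤP.pos-* (ℓ ^ m) D) ⟩
      ↥ x ℤ.* (+ (ℓ ^ m) ℤ.* + D)          ≡⟨ solve 3 (λ a b c → a :* (b :* c) := (b :* a) :* c) refl (↥ x) (+ (ℓ ^ m)) (+ D) ⟩
      (+ (ℓ ^ m) ℤ.* ↥ x) ℤ.* + D          ≡⟨ /≡/⇒*≡* (+ (ℓ ^ m) ℤ.* ↥ x) (↥ y) (1 ℕ.* ↧ₙ x) D (trans (sym (pow*≡/ m x)) (p≡↥p/↧p y)) ⟩
      ↥ y ℤ.* + (1 ℕ.* ↧ₙ x)               ≡⟨ cong (λ z → ↥ y ℤ.* + z) (ℕP.*-identityˡ (↧ₙ x)) ⟩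
      ↥ y ℤ.* + ↧ₙ x                       ∎))
    where
    open ≡-Reasoning
    open ℤS
    y = pow ℓ m ℚ.* x
    D = ↧ₙ y

  nearest-frac : ∀ m x → InBig ℓ m x → Σ ℕ λ a → a < ℓ ^ (m ℕ.+ m) × x ≈[ m ] frac m a
  nearest-frac m x ℓ∤D = a , ZDM.n%ℕd<d c' (ℓ ^ (m ℕ.+ m)) {{ℓ^≢0 (m ℕ.+ m)}} ,
      ≈-trans m x c'/ℓ^m (frac m a) (subst (_≈[ m ] c'/ℓ^m) (sym (≡↥[pow*]/ m x)) (proj₂ approx)) c'/ℓ^m≈a/ℓ^m
    where
    y = pow ℓ m ℚ.* x
    approx = approximate-/ m m (↥ y) 1 (↧ₙ y) ℓ∤1 ℓ∤D
    c' = + 1 ℤ.* proj₁ approx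
    c'/ℓ^m = _/_ c' (ℓ ^ m) {{ℓ^≢0 m}}
    a = (c' ZDM.%ℕ ℓ ^ (m ℕ.+ m)) {{ℓ^≢0 (m ℕ.+ m)}}
    Q = (c' ZDM./ℕ ℓ ^ (m ℕ.+ m)) {{ℓ^≢0 (m ℕ.+ m)}}
    ℓ^[m+m]∣c'-a : (+ (ℓ ^ (m ℕ.+ m))) ZD.∣ (c' ℤ.- + a)
    ℓ^[m+m]∣c'-a = ZD.divides Q (begin
        c' ℤ.- + a                          ≡⟨ cong (ℤ._- + a) (ZDM.a≡a%ℕn+[a/ℕn]*n c' (ℓ ^ (m ℕ.+ m)) {{ℓ^≢0 (m ℕ.+ m)}}) ⟩
        + a ℤ.+ Q ℤ.* + (ℓ ^ (m ℕ.+ m)) ℤ.- + a ≡⟨ solve 2 (λ a q → a :+ q :- a := q) refl (+ a) (Q ℤ.* + (ℓ ^ (m ℕ.+ m))) ⟩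
        Q ℤ.* + (ℓ ^ (m ℕ.+ m))             ∎)
      where
      open ≡-Reasoning
      open ℤS
    c'/ℓ^m≈a/ℓ^m : c'/ℓ^m ≈[ m ] frac m a
    c'/ℓ^m≈a/ℓ^m = subst (InSmall ℓ m) (sym (/-/≡-sameDen c' (+ a) (ℓ ^ m) {{ℓ^≢0 m}}))
      (∣⇒InSmall (c' ℤ.- + a) m m 1 (ℓ ^ m) {{ℓ^≢0 m}} (sym (ℕP.*-identityʳ (ℓ ^ m))) ℓ∤1 ℓ^[m+m]∣c'-a)

  split-ℓ-power : ∀ fuel D → D ≤ fuel → NonZero D → Σ ℕ λ k → Σ ℕ λ D' → (D ≡ ℓ ^ k ℕ.* D') × ¬ ℓ ND.∣ D'
  split-ℓ-power fuel D D≤fuel D≢0 with ℓ ND.∣? D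
  ... | no ℓ∤D = 0 , D , sym (ℕP.*-identityˡ D) , ℓ∤D
  split-ℓ-power zero       (suc D) () D≢0 | yes _
  split-ℓ-power (suc fuel) D D≤fuel D≢0 | yes (ND.divides q D≡qℓ) =
    suc k , D' , trans D≡qℓ (trans (cong (ℕ._* ℓ) q≡) (solve 3 (λ x d l → x :* d :* l := l :* x :* d) refl (ℓ ^ k) D' ℓ)) , ℓ∤D'
    where
    open ℕS
    q≢0 = ℕP.m*n≢0⇒m≢0 q {ℓ} {{subst NonZero D≡qℓ D≢0}}
    q<D : q < D
    q<D = subst (q <_) (sym D≡qℓ) (ℕP.m<m*n q ℓ {{q≢0}} 1<ℓ)
    split-q = split-ℓ-power fuel q (ℕP.<⇒≤pred (ℕP.<-≤-trans q<D D≤fuel)) q≢0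
    k = proj₁ split-q
    D' = proj₁ (proj₂ split-q)
    q≡ = proj₁ (proj₂ (proj₂ split-q))
    ℓ∤D' = proj₂ (proj₂ (proj₂ split-q))

  -- The approximant has a power of ℓ as denominator and a multiple of M as numerator, so it is small at
  -- every prime dividing M.
  approximate : ∀ n (t : ℚ) (M : ℕ) → ¬ ℓ ND.∣ M → Σ ℤ λ c → Σ ℕ λ k → t ≈[ n ] _/_ (+ M ℤ.* c) (ℓ ^ k) {{ℓ^≢0 k}}
  approximate n t M ℓ∤M = proj₁ approx , k , subst (λ z → InSmall ℓ n (z ℚ.- Mc/ℓ^k)) (sym t≡) (proj₂ approx)
    where
    split = split-ℓ-power (↧ₙ t) (↧ₙ t) ℕP.≤-refl _
    k = proj₁ split
    D' = proj₁ (proj₂ split)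
    ℓ∤D' = proj₂ (proj₂ (proj₂ split))
    approx = approximate-/ n k (↥ t) M D' {{∤⇒≢0 ℓ∤D'}} ℓ∤M ℓ∤D'
    Mc/ℓ^k = _/_ (+ M ℤ.* proj₁ approx) (ℓ ^ k) {{ℓ^≢0 k}}
    t≡ : t ≡ _/_ (↥ t) (ℓ ^ k ℕ.* D') {{ℕP.m*n≢0 (ℓ ^ k) D' {{ℓ^≢0 k}} {{∤⇒≢0 ℓ∤D'}}}}
    t≡ = trans (p≡↥p/↧p t) (ℚP./-cong {↥ t} {↧ₙ t} {↥ t} {{_}} {{ℕP.m*n≢0 (ℓ ^ k) D' {{ℓ^≢0 k}} {{∤⇒≢0 ℓ∤D'}}}} refl (proj₁ (proj₂ (proj₂ split))))

-- The Haar basis of 𝒮(V_ℓ)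

-- base stands for f⁰; cell k a b for the indicator of the ball (a , b)/ℓ^(k+1) + ℓ^(k+1) ℤ_ℓ².
data Idx : Set where
  base : Idx
  cell : ℕ → ℕ → ℕ → Idx

level : Idx → ℕ
level base         = 0
level (cell k _ _) = suc k

cell-injective : ∀ {k a b k' a' b'} → cell k a b ≡ cell k' a' b' → k ≡ k' × a ≡ a' × b ≡ b'
cell-injective refl = refl , refl , refl

infix 4 _≟ᵢ_
_≟ᵢ_ : DecidableEquality Idx
base ≟ᵢ base = yes refl
base ≟ᵢ cell _ _ _ = no (λ ())
cell _ _ _ ≟ᵢ base = no (λ ())
cell k a b ≟ᵢ cell k' a' b' with k ℕ.≟ k' | a ℕ.≟ a' | b ℕ.≟ b'
... | yes refl | yes refl | yes refl = yes refl
... | no k≢k'  | _        | _        = no (λ eq → k≢k' (proj₁ (cell-injective eq)))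
... | yes _    | no a≢a'  | _        = no (λ eq → a≢a' (proj₁ (proj₂ (cell-injective eq))))
... | yes _    | yes _    | no b≢b'  = no (λ eq → b≢b' (proj₂ (proj₂ (cell-injective eq))))

𝟙 : ∀ {A : Set} → Dec A → ℤ
𝟙 (yes _) = + 1
𝟙 (no _)  = + 0

𝟙-yes : ∀ {A : Set} (d : Dec A) → A → 𝟙 d ≡ + 1
𝟙-yes (yes _) _ = refl
𝟙-yes (no ¬a) a = ⊥-elim (¬a a)

𝟙-no : ∀ {A : Set} (d : Dec A) → ¬ A → 𝟙 d ≡ + 0
𝟙-no (yes a) ¬a = ⊥-elim (¬a a)
𝟙-no (no _)  _  = refl

𝟙≢0⇒ : ∀ {A : Set} (d : Dec A) → ¬ 𝟙 d ≡ + 0 → A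
𝟙≢0⇒ (yes a) _    = a
𝟙≢0⇒ (no _)  𝟙≢0 = ⊥-elim (𝟙≢0 refl)

𝟙-cong : ∀ {A B : Set} (dA : Dec A) (dB : Dec B) → (A → B) → (B → A) → 𝟙 dA ≡ 𝟙 dB
𝟙-cong (yes a) dB A→B B→A = sym (𝟙-yes dB (A→B a))
𝟙-cong (no ¬a) dB A→B B→A = sym (𝟙-no dB (λ b → ¬a (B→A b)))

Is01 : ℤ → Set
Is01 z = z ≡ + 0 ⊎ z ≡ + 1

𝟙-01 : ∀ {A : Set} (d : Dec A) → Is01 (𝟙 d)
𝟙-01 (yes _) = inj₂ refl
𝟙-01 (no _)  = inj₁ refl

sumℤ-*𝟙 : ∀ {A : Set} {P : A → Set} (P? : ∀ x → Dec (P x)) (f : A → ℤ) L →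
           sumℤ (map (λ x → f x ℤ.* 𝟙 (P? x)) L) ≡ sumℤ (map f (filter P? L))
sumℤ-*𝟙 P? f []      = refl
sumℤ-*𝟙 P? f (x ∷ L) with P? x
... | yes _ = cong₂ ℤ._+_ (ℤP.*-identityʳ (f x)) (sumℤ-*𝟙 P? f L)
... | no _  = trans (cong₂ ℤ._+_ (ℤP.*-zeroʳ (f x)) (sumℤ-*𝟙 P? f L)) (ℤP.+-identityˡ _)

δ : Idx → Idx → ℤ
δ j j' = 𝟙 (j ≟ᵢ j')

δ-≢ : ∀ {j j'} → j ≢ j' → δ j j' ≡ + 0
δ-≢ {j} {j'} = 𝟙-no (j ≟ᵢ j')

f0-01 : ∀ ℓ v → Is01 (f0 ℓ v)
f0-01 ℓ (x , y) with ℓ ND.∣? ↧ₙ x | ℓ ND.∣? ↧ₙ y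
... | no _  | no _  = inj₂ refl
... | yes _ | _     = inj₁ refl
... | no _  | yes _ = inj₁ refl

≡0-unless : ∀ (z : ℤ) {P : Set} → (¬ z ≡ + 0 → P) → ¬ P → z ≡ + 0
≡0-unless z z≢0⇒P ¬P with z ℤ.≟ + 0
... | yes z≡0 = z≡0
... | no z≢0  = ⊥-elim (¬P (z≢0⇒P z≢0))

module LocalBasis (ℓ : ℕ) .(ℓ-prime₀ : Prime ℓ) where
  open Adic ℓ ℓ-prime₀ public

  -- The fractions a/ℓ^m with a < ℓ^(2m) represent ℓ^-m ℤ_ℓ / ℓ^m ℤ_ℓ.
  reps : ℕ → ℕ
  reps m = ℓ ^ (m ℕ.+ m)

  -- A level-(k+1) ball centred at a level-k centre gets no basis vector: the level-k ball replaces it.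
  Inherited : ℕ → ℕ → ℕ → Set
  Inherited k a b = Σ ℕ λ a' → Σ ℕ λ b' → a' < reps k × b' < reps k × a ≡ a' ℕ.* ℓ × b ≡ b' ℕ.* ℓ

  *ℓ-cancel : ∀ {x y} → x ℕ.* ℓ ≡ y ℕ.* ℓ → x ≡ y
  *ℓ-cancel {x} {y} = ℕP.*-cancelʳ-≡ x y ℓ

  inherited? : ∀ k a b → Dec (Inherited k a b)
  inherited? k a b with ℓ ND.∣? a | ℓ ND.∣? b
  ... | no ℓ∤a | _ = no (λ { (a' , _ , _ , _ , a≡ , _) → ℓ∤a (ND.divides a' a≡) })
  ... | yes _  | no ℓ∤b = no (λ { (_ , b' , _ , _ , _ , b≡) → ℓ∤b (ND.divides b' b≡) })
  ... | yes (ND.divides qa a≡) | yes (ND.divides qb b≡) with qa ℕ.<? reps k | qb ℕ.<? reps k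
  ...   | yes qa< | yes qb< = yes (qa , qb , qa< , qb< , a≡ , b≡)
  ...   | no qa≮  | _       = no (λ { (a' , _ , a'< , _ , a≡' , _) → qa≮ (subst (_< reps k) (*ℓ-cancel (trans (sym a≡') a≡)) a'<) })
  ...   | yes _   | no qb≮  = no (λ { (_ , b' , _ , b'< , _ , b≡') → qb≮ (subst (_< reps k) (*ℓ-cancel (trans (sym b≡') b≡)) b'<) })

  Valid : Idx → Set
  Valid base         = ⊤
  Valid (cell k a b) = a < reps (suc k) × b < reps (suc k) × ¬ Inherited k a b

  valid? : ∀ j → Dec (Valid j)
  valid? base = yes tt
  valid? (cell k a b) = a ℕ.<? reps (suc k) ×-dec (b ℕ.<? reps (suc k) ×-dec ¬? (inherited? k a b))

  ball : ℕ → ℕ → ℕ → V → ℤ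
  ball k a b (x , y) = 𝟙 (InSmall? (suc k) (x ℚ.- frac (suc k) a) ×-dec InSmall? (suc k) (y ℚ.- frac (suc k) b))

  basis : Idx → V → ℤ
  basis base         = f0 ℓ
  basis (cell k a b) = ball k a b

  basis-01 : ∀ j v → Is01 (basis j v)
  basis-01 base         v       = f0-01 ℓ v
  basis-01 (cell k a b) (x , y) = 𝟙-01 (InSmall? (suc k) (x ℚ.- frac (suc k) a) ×-dec InSmall? (suc k) (y ℚ.- frac (suc k) b))

  ball-1 : ∀ k a b x y → x ≈[ suc k ] frac (suc k) a → y ≈[ suc k ] frac (suc k) b → ball k a b (x , y) ≡ + 1
  ball-1 k a b x y x≈ y≈ = 𝟙-yes (InSmall? (suc k) (x ℚ.- frac (suc k) a) ×-dec InSmall? (suc k) (y ℚ.- frac (suc k) b)) (x≈ , y≈)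

  ball-0 : ∀ k a b x y → ¬ (x ≈[ suc k ] frac (suc k) a × y ≈[ suc k ] frac (suc k) b) → ball k a b (x , y) ≡ + 0
  ball-0 k a b x y ¬≈ = 𝟙-no (InSmall? (suc k) (x ℚ.- frac (suc k) a) ×-dec InSmall? (suc k) (y ℚ.- frac (suc k) b)) ¬≈

  ball≢0⇒ : ∀ k a b x y → ¬ ball k a b (x , y) ≡ + 0 → x ≈[ suc k ] frac (suc k) a × y ≈[ suc k ] frac (suc k) b
  ball≢0⇒ k a b x y = 𝟙≢0⇒ (InSmall? (suc k) (x ℚ.- frac (suc k) a) ×-dec InSmall? (suc k) (y ℚ.- frac (suc k) b))

  ball-invariant : ∀ k a b x y x' y' → x ≈[ suc k ] x' → y ≈[ suc k ] y' → ball k a b (x , y) ≡ ball k a b (x' , y')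
  ball-invariant k a b x y x' y' x≈x' y≈y' =
    𝟙-cong (InSmall? (suc k) (x ℚ.- frac (suc k) a) ×-dec InSmall? (suc k) (y ℚ.- frac (suc k) b))
           (InSmall? (suc k) (x' ℚ.- frac (suc k) a) ×-dec InSmall? (suc k) (y' ℚ.- frac (suc k) b))
           (λ { (x≈ , y≈) → ≈-trans (suc k) x' x _ (≈-sym (suc k) x x' x≈x') x≈ , ≈-trans (suc k) y' y _ (≈-sym (suc k) y y' y≈y') y≈ })
           (λ { (x'≈ , y'≈) → ≈-trans (suc k) x x' _ x≈x' x'≈ , ≈-trans (suc k) y y' _ y≈y' y'≈ })

  f0-1 : ∀ x y → Integral ℓ x → Integral ℓ y → f0 ℓ (x , y) ≡ + 1
  f0-1 x y ix iy with ℓ ND.∣? ↧ₙ x | ℓ ND.∣? ↧ₙ y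
  ... | no _     | no _     = refl
  ... | yes ℓ∣↧x | _        = ⊥-elim (ix ℓ∣↧x)
  ... | no _     | yes ℓ∣↧y = ⊥-elim (iy ℓ∣↧y)

  f0-0 : ∀ x y → ¬ (Integral ℓ x × Integral ℓ y) → f0 ℓ (x , y) ≡ + 0
  f0-0 x y ¬i with ℓ ND.∣? ↧ₙ x | ℓ ND.∣? ↧ₙ y
  ... | no ix | no iy = ⊥-elim (¬i (ix , iy))
  ... | yes _ | _     = refl
  ... | no _  | yes _ = refl

  f0≢0⇒ : ∀ x y → ¬ f0 ℓ (x , y) ≡ + 0 → Integral ℓ x × Integral ℓ y
  f0≢0⇒ x y f0≢0 with ℓ ND.∣? ↧ₙ x | ℓ ND.∣? ↧ₙ y
  ... | no ix | no iy = ix , iy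
  ... | yes _ | _     = ⊥-elim (f0≢0 refl)
  ... | no _  | yes _ = ⊥-elim (f0≢0 refl)

  Integral-≈ : ∀ x x' → x ≈[ 0 ] x' → Integral ℓ x → Integral ℓ x'
  Integral-≈ x x' x≈x' ix = InSmall₀⇒Integral x'
    (subst (InSmall ℓ 0) (sym (y≡x-[x-y] x x')) (InSmall-+ 0 x (ℚ.- (x ℚ.- x')) (Integral⇒InSmall₀ x ix) (InSmall-neg 0 (x ℚ.- x') x≈x')))

  f0-invariant : ∀ x y x' y' → x ≈[ 0 ] x' → y ≈[ 0 ] y' → f0 ℓ (x , y) ≡ f0 ℓ (x' , y')
  f0-invariant x y x' y' x≈x' y≈y' with Integral? x | Integral? y
  ... | yes ix | yes iy = trans (f0-1 x y ix iy) (sym (f0-1 x' y' (Integral-≈ x x' x≈x' ix) (Integral-≈ y y' y≈y' iy)))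
  ... | no ¬ix | _      = trans (f0-0 x y (λ i → ¬ix (proj₁ i)))
                                (sym (f0-0 x' y' (λ i → ¬ix (Integral-≈ x' x (≈-sym 0 x x' x≈x') (proj₁ i)))))
  ... | yes _  | no ¬iy = trans (f0-0 x y (λ i → ¬iy (proj₂ i)))
                                (sym (f0-0 x' y' (λ i → ¬iy (Integral-≈ y' y (≈-sym 0 y y' y≈y') (proj₂ i)))))

  AtLevel : ℕ → (V → ℤ) → Set
  AtLevel n g = (∀ v w → InSmall ℓ n (proj₁ (v -V w)) → InSmall ℓ n (proj₂ (v -V w)) → g v ≡ g w)
              × (∀ v → ¬ g v ≡ + 0 → InBig ℓ n (proj₁ v) × InBig ℓ n (proj₂ v))

  AtLevel-cong : ∀ {n f g} → (∀ v → f v ≡ g v) → AtLevel n f → AtLevel n g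
  AtLevel-cong f≗g (inv , supp) = (λ v w dx dy → trans (sym (f≗g v)) (trans (inv v w dx dy) (f≗g w))) ,
                                  (λ v gv≢0 → supp v (λ fv≡0 → gv≢0 (trans (sym (f≗g v)) fv≡0)))

  basis-level : ∀ j → AtLevel (level j) (basis j)
  basis-level base = (λ { (x , y) (x' , y') → f0-invariant x y x' y' }) ,
                     (λ { (x , y) f0≢0 → let i = f0≢0⇒ x y f0≢0 in Integral⇒InBig₀ x (proj₁ i) , Integral⇒InBig₀ y (proj₂ i) })
  basis-level (cell k a b) = (λ { (x , y) (x' , y') → ball-invariant k a b x y x' y' }) ,
                             (λ { (x , y) ball≢0 → let near = ball≢0⇒ k a b x y ball≢0 in
                                  InBig-≈ {suc k} x (frac (suc k) a) (InBig-frac (suc k) a) (proj₁ near) ,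
                                  InBig-≈ {suc k} y (frac (suc k) b) (InBig-frac (suc k) b) (proj₂ near) })

  AtLevel-≤ : ∀ {m n} g → m ≤ n → AtLevel m g → AtLevel n g
  AtLevel-≤ g m≤n (inv , supp) = (λ v w dx dy → inv v w (InSmall-≤ _ m≤n dx) (InSmall-≤ _ m≤n dy)) ,
                                 (λ v gv≢0 → InBig-≤ _ m≤n (proj₁ (supp v gv≢0)) , InBig-≤ _ m≤n (proj₂ (supp v gv≢0)))

  AtLevel-0̇ : ∀ n → AtLevel n (λ _ → + 0)
  AtLevel-0̇ n = (λ _ _ _ _ → refl) , (λ v 0≢0 → ⊥-elim (0≢0 refl))

  AtLevel-+ : ∀ n f g → AtLevel n f → AtLevel n g → AtLevel n (λ v → f v ℤ.+ g v)
  AtLevel-+ n f g (inv-f , supp-f) (inv-g , supp-g) = (λ v w dx dy → cong₂ ℤ._+_ (inv-f v w dx dy) (inv-g v w dx dy)) , supp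
    where
    supp : ∀ v → ¬ f v ℤ.+ g v ≡ + 0 → InBig ℓ n (proj₁ v) × InBig ℓ n (proj₂ v)
    supp v f+g≢0 with f v ℤ.≟ + 0
    ... | no fv≢0  = supp-f v fv≢0
    ... | yes fv≡0 = supp-g v (λ gv≡0 → f+g≢0 (cong₂ ℤ._+_ fv≡0 gv≡0))

  AtLevel-* : ∀ n c g → AtLevel n g → AtLevel n (λ v → c ℤ.* g v)
  AtLevel-* n c g (inv , supp) = (λ v w dx dy → cong (c ℤ.*_) (inv v w dx dy)) ,
                                 (λ v cg≢0 → supp v (λ gv≡0 → cg≢0 (trans (cong (c ℤ.*_) gv≡0) (ℤP.*-zeroʳ c))))

  AtLevel-- : ∀ n f g → AtLevel n f → AtLevel n g → AtLevel n (λ v → f v ℤ.- g v)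
  AtLevel-- n f g lf lg = AtLevel-cong {n} (λ v → cong (λ z → f v ℤ.+ z) (ℤP.-1*i≡-i (g v)))
                            (AtLevel-+ n f (λ v → ℤ.-1ℤ ℤ.* g v) lf (AtLevel-* n ℤ.-1ℤ g lg))

  ℓ∣both? : ∀ a b → Dec (ℓ ND.∣ a × ℓ ND.∣ b)
  ℓ∣both? a b = ℓ ND.∣? a ×-dec ℓ ND.∣? b

  parent : ℕ → ℕ → ℕ
  parent k a = NDM._%_ (NDM._/_ a ℓ) (reps k) {{ℓ^≢0 (k ℕ.+ k)}}

  parent<reps : ∀ k a → parent k a < reps k
  parent<reps k a = NDM.m%n<n (NDM._/_ a ℓ) (reps k) {{ℓ^≢0 (k ℕ.+ k)}}

  center : ℕ → ℕ → ℕ → V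
  center k a b = frac (suc k) a , frac (suc k) b

  parentCenter : ℕ → ℕ → ℕ → V
  parentCenter k a b = frac k (parent k a) , frac k (parent k b)

  -- The dual functional of the basis (coeff-basis): the value at the centre, minus the value at the parent
  -- centre when the ball lies in ℓ^-k ℤ_ℓ².
  coeffWith : ∀ {X : Set} → Dec X → (V → ℤ) → V → V → ℤ
  coeffWith (yes _) g c p = g c ℤ.- g p
  coeffWith (no _)  g c p = g c

  coeff : Idx → (V → ℤ) → ℤ
  coeff base         g = g (0ℚ , 0ℚ)
  coeff (cell k a b) g = coeffWith (ℓ∣both? a b) g (center k a b) (parentCenter k a b)

  frac-near-parent : ∀ k a → ℓ ND.∣ a → frac (suc k) a ≈[ k ] frac k (parent k a)
  frac-near-parent k a ℓ∣a = subst (InSmall ℓ k) (sym difference≡)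
      (∣⇒InSmall (+ q ℤ.- + P) k k 1 (ℓ ^ k) {{ℓ^≢0 k}} (sym (ℕP.*-identityʳ (ℓ ^ k))) ℓ∤1 ℓ^[k+k]∣q-P)
    where
    q = NDM._/_ a ℓ
    P = parent k a
    Q = NDM._/_ q (reps k) {{ℓ^≢0 (k ℕ.+ k)}}
    difference≡ : frac (suc k) a ℚ.- frac k P ≡ _/_ (+ q ℤ.- + P) (ℓ ^ k) {{ℓ^≢0 k}}
    difference≡ = trans (cong (λ z → frac (suc k) z ℚ.- frac k P) (sym (NDM.m/n*n≡m ℓ∣a)))
                        (trans (cong (ℚ._- frac k P) (frac-*ℓ k q)) (/-/≡-sameDen (+ q) (+ P) (ℓ ^ k) {{ℓ^≢0 k}}))
    ℓ^[k+k]∣q-P : (+ (ℓ ^ (k ℕ.+ k))) ZD.∣ (+ q ℤ.- + P)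
    ℓ^[k+k]∣q-P = ZD.divides (+ Q) (begin
        + q ℤ.- + P                             ≡⟨ cong (λ z → + z ℤ.- + P) (NDM.m≡m%n+[m/n]*n q (reps k) {{ℓ^≢0 (k ℕ.+ k)}}) ⟩
        + (P ℕ.+ Q ℕ.* reps k) ℤ.- + P          ≡⟨ cong (ℤ._- + P) (ℤP.pos-+ P (Q ℕ.* reps k)) ⟩
        + P ℤ.+ + (Q ℕ.* reps k) ℤ.- + P        ≡⟨ cong (λ z → + P ℤ.+ z ℤ.- + P) (ℤP.pos-* Q (reps k)) ⟩
        + P ℤ.+ + Q ℤ.* + (reps k) ℤ.- + P      ≡⟨ solve 3 (λ p x y → p :+ x :* y :- p := x :* y) refl (+ P) (+ Q) (+ (reps k)) ⟩
        + Q ℤ.* + (ℓ ^ (k ℕ.+ k))               ∎)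
      where
      open ≡-Reasoning
      open ℤS

  coarse-center⇒ℓ∣ : ∀ m k c a → m ≤ k → c < reps m → a < reps (suc k) →
                     frac m c ≈[ suc k ] frac (suc k) a → Σ ℕ λ a' → a' < reps k × a ≡ a' ℕ.* ℓ
  coarse-center⇒ℓ∣ m k c a m≤k c< a< c≈a = subst
      (λ K → a < reps (suc K) → frac m c ≈[ suc K ] frac (suc K) a → Σ ℕ λ a' → a' < reps K × a ≡ a' ℕ.* ℓ)
      (ℕP.m+[n∸m]≡n m≤k) (at-distance (k ℕ.∸ m)) a< c≈a
    where
    *ℓ^-< : ∀ A e → c < ℓ ^ A → c ℕ.* ℓ ^ e < ℓ ^ (A ℕ.+ e)
    *ℓ^-< A e c<ℓ^A = subst (c ℕ.* ℓ ^ e <_) (sym (ℕP.^-distribˡ-+-* ℓ A e)) (ℕP.*-monoˡ-< (ℓ ^ e) {{ℓ^≢0 e}} c<ℓ^A)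
    at-distance : ∀ e → a < reps (suc (m ℕ.+ e)) → frac m c ≈[ suc (m ℕ.+ e) ] frac (suc (m ℕ.+ e)) a →
                  Σ ℕ λ a' → a' < reps (m ℕ.+ e) × a ≡ a' ℕ.* ℓ
    at-distance e a< c≈a = c ℕ.* ℓ ^ e , cℓ^e< , a≡
      where
      open ℕS
      M = suc (m ℕ.+ e)
      c/ℓ^m≡ : frac m c ≡ frac M (c ℕ.* ℓ ^ suc e)
      c/ℓ^m≡ = trans (frac-lift m (suc e) c) (cong (λ z → frac z (c ℕ.* ℓ ^ suc e)) (ℕP.+-suc m e))
      cℓ^[e+1]< : c ℕ.* ℓ ^ suc e < reps M
      cℓ^[e+1]< = ℕP.<-≤-trans (*ℓ^-< (m ℕ.+ m) (suc e) c<) (ℕP.^-monoʳ-≤ ℓ (subst ((m ℕ.+ m) ℕ.+ suc e ≤_)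
                    (sym (solve 2 (λ m e → (con 1 :+ (m :+ e)) :+ (con 1 :+ (m :+ e)) := ((m :+ m) :+ (con 1 :+ e)) :+ (e :+ con 1)) refl m e))
                    (ℕP.m≤m+n ((m ℕ.+ m) ℕ.+ suc e) (e ℕ.+ 1))))
      cℓ^e< : c ℕ.* ℓ ^ e < reps (m ℕ.+ e)
      cℓ^e< = ℕP.<-≤-trans (*ℓ^-< (m ℕ.+ m) e c<) (ℕP.^-monoʳ-≤ ℓ (subst ((m ℕ.+ m) ℕ.+ e ≤_)
                (sym (solve 2 (λ m e → (m :+ e) :+ (m :+ e) := ((m :+ m) :+ e) :+ e) refl m e))
                (ℕP.m≤m+n ((m ℕ.+ m) ℕ.+ e) e)))
      a≡ : a ≡ c ℕ.* ℓ ^ e ℕ.* ℓ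
      a≡ = trans (sym (frac-injective M (c ℕ.* ℓ ^ suc e) a cℓ^[e+1]< a< (subst (λ z → z ≈[ M ] frac M a) c/ℓ^m≡ c≈a)))
                 (trans (cong (c ℕ.*_) (ℕP.*-comm ℓ (ℓ ^ e))) (sym (ℕP.*-assoc c (ℓ ^ e) ℓ)))

  coarse-center⇒Inherited : ∀ m k c d a b → m ≤ k → c < reps m → d < reps m → a < reps (suc k) → b < reps (suc k) →
                            frac m c ≈[ suc k ] frac (suc k) a → frac m d ≈[ suc k ] frac (suc k) b → Inherited k a b
  coarse-center⇒Inherited m k c d a b m≤k c< d< a< b< c≈a d≈b =
    proj₁ A , proj₁ B , proj₁ (proj₂ A) , proj₁ (proj₂ B) , proj₂ (proj₂ A) , proj₂ (proj₂ B)
    where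
    A = coarse-center⇒ℓ∣ m k c a m≤k c< a< c≈a
    B = coarse-center⇒ℓ∣ m k d b m≤k d< b< d≈b

  coeffWith-0 : ∀ {X : Set} (d : Dec X) g c p → g c ≡ + 0 → g p ≡ + 0 → coeffWith d g c p ≡ + 0
  coeffWith-0 (yes _) g c p gc≡0 gp≡0 = cong₂ ℤ._-_ gc≡0 gp≡0
  coeffWith-0 (no _)  g c p gc≡0 gp≡0 = gc≡0

  coeffWith-≡ : ∀ {X : Set} (d : Dec X) g c p → (X → g c ≡ g p) → (¬ X → g c ≡ + 0) → coeffWith d g c p ≡ + 0
  coeffWith-≡ (yes x) g c p gc≡gp _    = trans (cong (λ z → g c ℤ.- z) (sym (gc≡gp x))) (ℤP.+-inverseʳ (g c))
  coeffWith-≡ (no ¬x) g c p _    gc≡0 = gc≡0 ¬x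

  coeffWith-parent0 : ∀ {X : Set} (d : Dec X) g c p → g p ≡ + 0 → coeffWith d g c p ≡ g c
  coeffWith-parent0 (yes _) g c p gp≡0 = trans (cong (λ z → g c ℤ.- z) gp≡0) (ℤP.+-identityʳ (g c))
  coeffWith-parent0 (no _)  g c p gp≡0 = refl

  ¬InBig-center : ∀ k a b → ¬ (ℓ ND.∣ a × ℓ ND.∣ b) → ¬ (InBig ℓ k (frac (suc k) a) × InBig ℓ k (frac (suc k) b))
  ¬InBig-center k a b ¬ℓ∣ab (ba , bb) with ℓ ND.∣? a
  ... | no ℓ∤a  = ¬InBig-frac k a ℓ∤a ba
  ... | yes ℓ∣a = ¬InBig-frac k b (λ ℓ∣b → ¬ℓ∣ab (ℓ∣a , ℓ∣b)) bb

  coeff-base-ball : ∀ k a b → Valid (cell k a b) → coeff base (ball k a b) ≡ + 0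
  coeff-base-ball k a b (a< , b< , ¬inh) = ball-0 k a b 0ℚ 0ℚ
    (λ { (0≈a , 0≈b) → ¬inh (coarse-center⇒Inherited 0 k 0 0 a b z≤n (s≤s z≤n) (s≤s z≤n) a< b< 0≈a 0≈b) })

  coeff-cell-f0 : ∀ k a b → coeff (cell k a b) (f0 ℓ) ≡ + 0
  coeff-cell-f0 k a b = coeffWith-≡ (ℓ∣both? a b) (f0 ℓ) (center k a b) (parentCenter k a b)
    (λ { (ℓ∣a , ℓ∣b) → f0-invariant (frac (suc k) a) (frac (suc k) b) (frac k (parent k a)) (frac k (parent k b))
                          (≈-≤ {n = k} (frac (suc k) a) (frac k (parent k a)) z≤n (frac-near-parent k a ℓ∣a))
                          (≈-≤ {n = k} (frac (suc k) b) (frac k (parent k b)) z≤n (frac-near-parent k b ℓ∣b)) })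
    (λ ¬ℓ∣ab → f0-0 (frac (suc k) a) (frac (suc k) b) (λ { (ia , ib) → ¬InBig-center k a b ¬ℓ∣ab
         (InBig-≤ {n = k} (frac (suc k) a) z≤n (Integral⇒InBig₀ (frac (suc k) a) ia) , InBig-≤ {n = k} (frac (suc k) b) z≤n (Integral⇒InBig₀ (frac (suc k) b) ib)) }))

  coeff-coarser-ball : ∀ k a b k' a' b' → k < k' → Valid (cell k a b) → Valid (cell k' a' b') → coeff (cell k a b) (ball k' a' b') ≡ + 0
  coeff-coarser-ball k a b k' a' b' k<k' (a< , b< , _) (a'< , b'< , ¬inh') =
    coeffWith-0 (ℓ∣both? a b) (ball k' a' b') (center k a b) (parentCenter k a b)
      (ball-0 k' a' b' (frac (suc k) a) (frac (suc k) b)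
        (λ { (a≈a' , b≈b') → ¬inh' (coarse-center⇒Inherited (suc k) k' a b a' b' k<k' a< b< a'< b'< a≈a' b≈b') }))
      (ball-0 k' a' b' (frac k (parent k a)) (frac k (parent k b))
        (λ { (pa≈a' , pb≈b') → ¬inh' (coarse-center⇒Inherited k k' (parent k a) (parent k b) a' b' (ℕP.<⇒≤ k<k')
                                        (parent<reps k a) (parent<reps k b) a'< b'< pa≈a' pb≈b') }))

  coeff-finer-ball : ∀ k a b k' a' b' → k' < k → coeff (cell k a b) (ball k' a' b') ≡ + 0
  coeff-finer-ball k a b k' a' b' k'<k = coeffWith-≡ (ℓ∣both? a b) (ball k' a' b') (center k a b) (parentCenter k a b)
    (λ { (ℓ∣a , ℓ∣b) → ball-invariant k' a' b' (frac (suc k) a) (frac (suc k) b) (frac k (parent k a)) (frac k (parent k b))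
                          (≈-≤ (frac (suc k) a) (frac k (parent k a)) k'<k (frac-near-parent k a ℓ∣a))
                          (≈-≤ (frac (suc k) b) (frac k (parent k b)) k'<k (frac-near-parent k b ℓ∣b)) })
    (λ ¬ℓ∣ab → ball-0 k' a' b' (frac (suc k) a) (frac (suc k) b) (λ { (a≈a' , b≈b') → ¬InBig-center k a b ¬ℓ∣ab
         (InBig-≤ (frac (suc k) a) k'<k (InBig-≈ {suc k'} (frac (suc k) a) (frac (suc k') a') (InBig-frac (suc k') a') a≈a') ,
          InBig-≤ (frac (suc k) b) k'<k (InBig-≈ {suc k'} (frac (suc k) b) (frac (suc k') b') (InBig-frac (suc k') b') b≈b')) }))

  coeff-same-level-ball : ∀ k a b a' b' → Valid (cell k a b) → Valid (cell k a' b') →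
                          coeff (cell k a b) (ball k a' b') ≡ δ (cell k a b) (cell k a' b')
  coeff-same-level-ball k a b a' b' (a< , b< , _) (a'< , b'< , ¬inh') =
    trans (coeffWith-parent0 (ℓ∣both? a b) (ball k a' b') (center k a b) (parentCenter k a b)
            (ball-0 k a' b' (frac k (parent k a)) (frac k (parent k b))
              (λ { (pa≈a' , pb≈b') → ¬inh' (coarse-center⇒Inherited k k (parent k a) (parent k b) a' b' ℕP.≤-refl
                                              (parent<reps k a) (parent<reps k b) a'< b'< pa≈a' pb≈b') })))
          (at-center (a ℕ.≟ a') (b ℕ.≟ b'))
    where
    at-center : Dec (a ≡ a') → Dec (b ≡ b') → ball k a' b' (center k a b) ≡ δ (cell k a b) (cell k a' b')
    at-center (yes refl) (yes refl) = trans (ball-1 k a b (frac (suc k) a) (frac (suc k) b) (≈-refl (suc k) (frac (suc k) a)) (≈-refl (suc k) (frac (suc k) b)))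
                                            (sym (𝟙-yes (cell k a b ≟ᵢ cell k a b) refl))
    at-center (no a≢a') _ = trans (ball-0 k a' b' (frac (suc k) a) (frac (suc k) b) (λ { (a≈a' , _) → a≢a' (frac-injective (suc k) a a' a< a'< a≈a') }))
                                  (sym (δ-≢ (λ eq → a≢a' (proj₁ (proj₂ (cell-injective eq))))))
    at-center (yes _) (no b≢b') = trans (ball-0 k a' b' (frac (suc k) a) (frac (suc k) b) (λ { (_ , b≈b') → b≢b' (frac-injective (suc k) b b' b< b'< b≈b') }))
                                        (sym (δ-≢ (λ eq → b≢b' (proj₂ (proj₂ (cell-injective eq))))))

  coeff-basis : ∀ j j' → Valid j → Valid j' → coeff j (basis j') ≡ δ j j'
  coeff-basis base base _ _ = f0-1 0ℚ 0ℚ ℓ∤1 ℓ∤1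
  coeff-basis base (cell k' a' b') _ v' = coeff-base-ball k' a' b' v'
  coeff-basis (cell k a b) base _ _ = coeff-cell-f0 k a b
  coeff-basis (cell k a b) (cell k' a' b') v v' with ℕP.<-cmp k k'
  ... | tri< k<k' _ _ = trans (coeff-coarser-ball k a b k' a' b' k<k' v v') (sym (δ-≢ (λ eq → ℕP.<⇒≢ k<k' (proj₁ (cell-injective eq)))))
  ... | tri> _ _ k'<k = trans (coeff-finer-ball k a b k' a' b' k'<k) (sym (δ-≢ (λ eq → ℕP.<⇒≢ k'<k (sym (proj₁ (cell-injective eq))))))
  ... | tri≈ _ refl _ = coeff-same-level-ball k a b a' b' v v'

  -- A vanishing coefficient of a level-(k+1) ball carries the value of g at its centre to the parent centre,
  -- or shows that it is 0 when the ball is not in ℓ^-k ℤ_ℓ²; hence g is constant on level-k balls.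
  module Descend (k : ℕ) (g : V → ℤ) (g-level : AtLevel (suc k) g)
                 (coeff≡0 : ∀ j → Valid j → level j ≤ suc k → coeff j g ≡ + 0) where

    invariant = proj₁ g-level
    support   = proj₂ g-level

    Explained : ℚ → ℚ → Set
    Explained x y = (g (x , y) ≡ + 0 × ¬ (InBig ℓ k x × InBig ℓ k y))
                  ⊎ (Σ ℕ λ c → Σ ℕ λ d → c < reps k × d < reps k × x ≈[ k ] frac k c × y ≈[ k ] frac k d
                                        × g (x , y) ≡ g (frac k c , frac k d))

    explained-near-center : ∀ x y a b → x ≈[ suc k ] frac (suc k) a → y ≈[ suc k ] frac (suc k) b →
                            (d : Dec (ℓ ND.∣ a × ℓ ND.∣ b)) → coeffWith d g (center k a b) (parentCenter k a b) ≡ + 0 → Explained x y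
    explained-near-center x y a b x≈ y≈ (yes (ℓ∣a , ℓ∣b)) coeff≡0 = inj₂ (parent k a , parent k b , parent<reps k a , parent<reps k b ,
      ≈-trans k x (frac (suc k) a) (frac k (parent k a)) (InSmall-pred k _ x≈) (frac-near-parent k a ℓ∣a) ,
      ≈-trans k y (frac (suc k) b) (frac k (parent k b)) (InSmall-pred k _ y≈) (frac-near-parent k b ℓ∣b) ,
      trans (invariant (x , y) (center k a b) x≈ y≈) (ℤP.i-j≡0⇒i≡j (g (center k a b)) (g (parentCenter k a b)) coeff≡0))
    explained-near-center x y a b x≈ y≈ (no ¬ℓ∣ab) g≡0 = inj₁ (trans (invariant (x , y) (center k a b) x≈ y≈) g≡0 ,
      λ { (bx , by) → ¬InBig-center k a b ¬ℓ∣ab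
            (InBig-≈ {k} (frac (suc k) a) x bx (≈-sym k x (frac (suc k) a) (InSmall-pred k _ x≈)) ,
             InBig-≈ {k} (frac (suc k) b) y by (≈-sym k y (frac (suc k) b) (InSmall-pred k _ y≈))) })

    explained-near : ∀ x y a b → a < reps (suc k) → b < reps (suc k) → x ≈[ suc k ] frac (suc k) a → y ≈[ suc k ] frac (suc k) b →
                     Dec (Inherited k a b) → Explained x y
    explained-near x y a b a< b< x≈ y≈ (yes (a' , b' , a'< , b'< , a≡ , b≡)) = inj₂ (a' , b' , a'< , b'< ,
        subst (x ≈[ k ]_) a/ℓ^[k+1]≡ (InSmall-pred k _ x≈) ,
        subst (y ≈[ k ]_) b/ℓ^[k+1]≡ (InSmall-pred k _ y≈) ,
        trans (invariant (x , y) (center k a b) x≈ y≈) (cong₂ (λ u w → g (u , w)) a/ℓ^[k+1]≡ b/ℓ^[k+1]≡))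
      where
      a/ℓ^[k+1]≡ = trans (cong (frac (suc k)) a≡) (frac-*ℓ k a')
      b/ℓ^[k+1]≡ = trans (cong (frac (suc k)) b≡) (frac-*ℓ k b')
    explained-near x y a b a< b< x≈ y≈ (no ¬inh) =
      explained-near-center x y a b x≈ y≈ (ℓ∣both? a b) (coeff≡0 (cell k a b) (a< , b< , ¬inh) ℕP.≤-refl)

    explained : ∀ x y → Explained x y
    explained x y with InBig? (suc k) x | InBig? (suc k) y
    ... | yes bx | yes by = explained-near x y (proj₁ A) (proj₁ B) (proj₁ (proj₂ A)) (proj₁ (proj₂ B)) (proj₂ (proj₂ A)) (proj₂ (proj₂ B))
                              (inherited? k (proj₁ A) (proj₁ B))
      where
      A = nearest-frac (suc k) x bx
      B = nearest-frac (suc k) y by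
    ... | no ¬bx | _      = inj₁ (≡0-unless (g (x , y)) (support (x , y)) (λ b → ¬bx (proj₁ b)) , λ b → ¬bx (InBig-suc k x (proj₁ b)))
    ... | yes _  | no ¬by = inj₁ (≡0-unless (g (x , y)) (support (x , y)) (λ b → ¬by (proj₂ b)) , λ b → ¬by (InBig-suc k y (proj₂ b)))

    near-center⇒InBig : ∀ x y c d x' y' → x ≈[ k ] x' → y ≈[ k ] y' → x ≈[ k ] frac k c → y ≈[ k ] frac k d → InBig ℓ k x' × InBig ℓ k y'
    near-center⇒InBig x y c d x' y' x≈x' y≈y' x≈c y≈d =
      InBig-≈ {k} x' (frac k c) (InBig-frac k c) (≈-trans k x' x (frac k c) (≈-sym k x x' x≈x') x≈c) ,
      InBig-≈ {k} y' (frac k d) (InBig-frac k d) (≈-trans k y' y (frac k d) (≈-sym k y y' y≈y') y≈d)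

    invariant-k : ∀ x y x' y' → x ≈[ k ] x' → y ≈[ k ] y' → Explained x y → Explained x' y' → g (x , y) ≡ g (x' , y')
    invariant-k x y x' y' _ _ (inj₁ (g≡0 , _)) (inj₁ (g'≡0 , _)) = trans g≡0 (sym g'≡0)
    invariant-k x y x' y' x≈x' y≈y' (inj₁ (_ , outside)) (inj₂ (c , d , _ , _ , x'≈c , y'≈d , _)) =
      ⊥-elim (outside (near-center⇒InBig x' y' c d x y (≈-sym k x x' x≈x') (≈-sym k y y' y≈y') x'≈c y'≈d))
    invariant-k x y x' y' x≈x' y≈y' (inj₂ (c , d , _ , _ , x≈c , y≈d , _)) (inj₁ (_ , outside)) =
      ⊥-elim (outside (near-center⇒InBig x y c d x' y' x≈x' y≈y' x≈c y≈d))
    invariant-k x y x' y' x≈x' y≈y' (inj₂ (c , d , c< , d< , x≈c , y≈d , g≡)) (inj₂ (c' , d' , c'< , d'< , x'≈c' , y'≈d' , g'≡)) =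
      trans g≡ (trans (cong₂ (λ u w → g (frac k u , frac k w)) c≡c' d≡d') (sym g'≡))
      where
      c≡c' = frac-injective k c c' c< c'< (≈-trans k (frac k c) x (frac k c') (≈-sym k x (frac k c) x≈c) (≈-trans k x x' (frac k c') x≈x' x'≈c'))
      d≡d' = frac-injective k d d' d< d'< (≈-trans k (frac k d) y (frac k d') (≈-sym k y (frac k d) y≈d) (≈-trans k y y' (frac k d') y≈y' y'≈d'))

    support-k : ∀ x y → Explained x y → ¬ g (x , y) ≡ + 0 → InBig ℓ k x × InBig ℓ k y
    support-k x y (inj₁ (g≡0 , _)) g≢0 = ⊥-elim (g≢0 g≡0)
    support-k x y (inj₂ (c , d , _ , _ , x≈c , y≈d , _)) _ = near-center⇒InBig x y c d x y (≈-refl k x) (≈-refl k y) x≈c y≈d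

    descend : AtLevel k g
    descend = (λ { (x , y) (x' , y') x≈x' y≈y' → invariant-k x y x' y' x≈x' y≈y' (explained x y) (explained x' y') }) ,
              (λ { (x , y) g≢0 → support-k x y (explained x y) g≢0 })

  coeff≡0⇒≡0 : ∀ n g → AtLevel n g → (∀ j → Valid j → level j ≤ n → coeff j g ≡ + 0) → ∀ v → g v ≡ + 0
  coeff≡0⇒≡0 zero g (invariant , support) coeff≡0 (x , y) with Integral? x | Integral? y
  ... | yes ix | yes iy = trans (invariant (x , y) (0ℚ , 0ℚ) (Integral⇒InSmall₀ (x ℚ.- 0ℚ) (subst (Integral ℓ) (sym (x-0≡x x)) ix))
                                                          (Integral⇒InSmall₀ (y ℚ.- 0ℚ) (subst (Integral ℓ) (sym (x-0≡x y)) iy)))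
                                (coeff≡0 base tt z≤n)
  ... | no ¬ix | _      = ≡0-unless (g (x , y)) (support (x , y)) (λ b → ¬ix (InBig₀⇒Integral x (proj₁ b)))
  ... | yes _  | no ¬iy = ≡0-unless (g (x , y)) (support (x , y)) (λ b → ¬iy (InBig₀⇒Integral y (proj₂ b)))
  coeff≡0⇒≡0 (suc k) g g-level coeff≡0 =
    coeff≡0⇒≡0 k g (Descend.descend k g g-level coeff≡0) (λ j vj j≤k → coeff≡0 j vj (ℕP.m≤n⇒m≤1+n j≤k))

  coeffWith-+ : ∀ {X : Set} (d : Dec X) f h c p → coeffWith d (λ v → f v ℤ.+ h v) c p ≡ coeffWith d f c p ℤ.+ coeffWith d h c p
  coeffWith-+ (yes _) f h c p = solve 4 (λ a b c d → (a :+ b) :- (c :+ d) := (a :- c) :+ (b :- d)) refl (f c) (h c) (f p) (h p)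
    where open ℤS
  coeffWith-+ (no _)  f h c p = refl

  coeffWith-- : ∀ {X : Set} (d : Dec X) f h c p → coeffWith d (λ v → f v ℤ.- h v) c p ≡ coeffWith d f c p ℤ.- coeffWith d h c p
  coeffWith-- (yes _) f h c p = solve 4 (λ a b c d → (a :- b) :- (c :- d) := (a :- c) :- (b :- d)) refl (f c) (h c) (f p) (h p)
    where open ℤS
  coeffWith-- (no _)  f h c p = refl

  coeffWith-* : ∀ {X : Set} (d : Dec X) z f c p → coeffWith d (λ v → z ℤ.* f v) c p ≡ z ℤ.* coeffWith d f c p
  coeffWith-* (yes _) z f c p = solve 3 (λ z a b → z :* a :- z :* b := z :* (a :- b)) refl z (f c) (f p)
    where open ℤS
  coeffWith-* (no _)  z f c p = refl

  coeffWith-0̇ : ∀ {X : Set} (d : Dec X) c p → coeffWith d (λ _ → + 0) c p ≡ + 0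
  coeffWith-0̇ (yes _) c p = refl
  coeffWith-0̇ (no _)  c p = refl

  coeffWith-cong : ∀ {X : Set} (d : Dec X) f h c p → (∀ v → f v ≡ h v) → coeffWith d f c p ≡ coeffWith d h c p
  coeffWith-cong (yes _) f h c p f≗h = cong₂ ℤ._-_ (f≗h c) (f≗h p)
  coeffWith-cong (no _)  f h c p f≗h = f≗h c

  coeff-+ : ∀ j f h → coeff j (λ v → f v ℤ.+ h v) ≡ coeff j f ℤ.+ coeff j h
  coeff-+ base         f h = refl
  coeff-+ (cell k a b) f h = coeffWith-+ (ℓ∣both? a b) f h (center k a b) (parentCenter k a b)

  coeff-- : ∀ j f h → coeff j (λ v → f v ℤ.- h v) ≡ coeff j f ℤ.- coeff j h
  coeff-- base         f h = refl
  coeff-- (cell k a b) f h = coeffWith-- (ℓ∣both? a b) f h (center k a b) (parentCenter k a b)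

  coeff-* : ∀ j z f → coeff j (λ v → z ℤ.* f v) ≡ z ℤ.* coeff j f
  coeff-* base         z f = refl
  coeff-* (cell k a b) z f = coeffWith-* (ℓ∣both? a b) z f (center k a b) (parentCenter k a b)

  coeff-0̇ : ∀ j → coeff j (λ _ → + 0) ≡ + 0
  coeff-0̇ base         = refl
  coeff-0̇ (cell k a b) = coeffWith-0̇ (ℓ∣both? a b) (center k a b) (parentCenter k a b)

  coeff-cong : ∀ j f h → (∀ v → f v ≡ h v) → coeff j f ≡ coeff j h
  coeff-cong base         f h f≗h = f≗h (0ℚ , 0ℚ)
  coeff-cong (cell k a b) f h f≗h = coeffWith-cong (ℓ∣both? a b) f h (center k a b) (parentCenter k a b) f≗h

  coeff-sum : ∀ j {A : Set} (L : List A) (c : A → ℤ) (f : A → V → ℤ) →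
              coeff j (λ v → sumℤ (map (λ x → c x ℤ.* f x v) L)) ≡ sumℤ (map (λ x → c x ℤ.* coeff j (f x)) L)
  coeff-sum j []      c f = coeff-0̇ j
  coeff-sum j (x ∷ L) c f = trans (coeff-+ j (λ v → c x ℤ.* f x v) (λ v → sumℤ (map (λ x → c x ℤ.* f x v) L)))
                                  (cong₂ ℤ._+_ (coeff-* j (c x) (f x)) (coeff-sum j L c f))

  AtLevel-lincomb : ∀ n L (c : Idx → ℤ) → All (λ i → level i ≤ n) L → AtLevel n (λ v → sumℤ (map (λ i → c i ℤ.* basis i v) L))
  AtLevel-lincomb n []      c []            = AtLevel-0̇ n
  AtLevel-lincomb n (i ∷ L) c (i≤n ∷ L≤n) = AtLevel-+ n (λ v → c i ℤ.* basis i v) (λ v → sumℤ (map (λ i → c i ℤ.* basis i v) L))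
                                              (AtLevel-* n (c i) (basis i) (AtLevel-≤ (basis i) i≤n (basis-level i))) (AtLevel-lincomb n L c L≤n)

  sum-δ : ∀ L (c : Idx → ℤ) j → Unique L → j ∈ L → sumℤ (map (λ i → c i ℤ.* δ j i) L) ≡ c j
  sum-δ (i ∷ L) c .i (i∉L ∷ _) (here refl) =
    trans (cong₂ ℤ._+_ (trans (cong (c i ℤ.*_) (𝟙-yes (i ≟ᵢ i) refl)) (ℤP.*-identityʳ (c i)))
                       (sumℤ-0 (λ i' → c i' ℤ.* δ i i') L (All.map (λ i≢i' → trans (cong (c _ ℤ.*_) (δ-≢ i≢i')) (ℤP.*-zeroʳ (c _))) i∉L)))
          (ℤP.+-identityʳ (c i))
  sum-δ (i ∷ L) c j (i∉L ∷ unique) (there j∈L) =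
    trans (cong₂ ℤ._+_ (trans (cong (c i ℤ.*_) (δ-≢ (λ j≡i → All.lookup i∉L j∈L (sym j≡i)))) (ℤP.*-zeroʳ (c i))) (sum-δ L c j unique j∈L))
          (ℤP.+-identityˡ (c j))

  candidates : ℕ → List Idx
  candidates n = base ∷ concatMap (λ k → concatMap (λ a → map (cell k a) (upTo (reps (suc k)))) (upTo (reps (suc k)))) (upTo n)

  Indexed : ℕ → Idx → Set
  Indexed n j = Valid j × level j ≤ n

  indexed? : ∀ n j → Dec (Indexed n j)
  indexed? n j = valid? j ×-dec (level j ℕ.≤? n)

  indices : ℕ → List Idx
  indices n = deduplicate _≟ᵢ_ (filter (indexed? n) (candidates n))

  indices-sound : ∀ n {j} → j ∈ indices n → Indexed n j
  indices-sound n j∈ = proj₂ (∈-filter⁻ (indexed? n) {xs = candidates n} (∈-deduplicate⁻ _≟ᵢ_ (filter (indexed? n) (candidates n)) j∈))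

  candidates-complete : ∀ n j → Indexed n j → j ∈ candidates n
  candidates-complete n base         _                   = here refl
  candidates-complete n (cell k a b) ((a< , b< , _) , k<n) = there
    (∈-concatMap⁺ (λ k → concatMap (λ a → map (cell k a) (upTo (reps (suc k)))) (upTo (reps (suc k))))
      (lose (∈-upTo⁺ k<n) (∈-concatMap⁺ (λ a → map (cell k a) (upTo (reps (suc k))))
         (lose (∈-upTo⁺ a<) (∈-map⁺ (cell k a) (∈-upTo⁺ b<))))))

  indices-complete : ∀ n j → Indexed n j → j ∈ indices n
  indices-complete n j ix = ∈-deduplicate⁺ _≟ᵢ_ (∈-filter⁺ (indexed? n) (candidates-complete n j ix) ix)

  indices-unique : ∀ n → Unique (indices n)
  indices-unique n = deduplicate-! _≟ᵢ_ (filter (indexed? n) (candidates n))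

  expand : ∀ n φ → AtLevel n φ → ∀ v → φ v ≡ sumℤ (map (λ j → coeff j φ ℤ.* basis j v) (indices n))
  expand n φ φ-level v = ℤP.i-j≡0⇒i≡j _ _ (coeff≡0⇒≡0 n remainder remainder-level coeff-remainder v)
    where
    L = indices n
    c : Idx → ℤ
    c j = coeff j φ
    remainder : V → ℤ
    remainder v = φ v ℤ.- sumℤ (map (λ i → c i ℤ.* basis i v) L)
    remainder-level : AtLevel n remainder
    remainder-level = AtLevel-- n φ _ φ-level (AtLevel-lincomb n L c (All.tabulate (λ i∈ → proj₂ (indices-sound n i∈))))
    coeff-remainder : ∀ j → Valid j → level j ≤ n → coeff j remainder ≡ + 0
    coeff-remainder j vj j≤n = begin
      coeff j remainder                                                 ≡⟨ coeff-- j φ _ ⟩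
      c j ℤ.- coeff j (λ v → sumℤ (map (λ i → c i ℤ.* basis i v) L))    ≡⟨ cong (λ z → c j ℤ.- z) (coeff-sum j L c basis) ⟩
      c j ℤ.- sumℤ (map (λ i → c i ℤ.* coeff j (basis i)) L)            ≡⟨ cong (λ z → c j ℤ.- sumℤ z) (map-cong-local
                                                                             (All.tabulate (λ {i} i∈ → cong (c i ℤ.*_) (coeff-basis j i vj (proj₁ (indices-sound n i∈)))))) ⟩
      c j ℤ.- sumℤ (map (λ i → c i ℤ.* δ j i) L)                        ≡⟨ cong (λ z → c j ℤ.- z) (sum-δ L c j (indices-unique n) (indices-complete n j (vj , j≤n))) ⟩
      c j ℤ.- c j                                                       ≡⟨ ℤP.+-inverseʳ (c j) ⟩
      + 0                                                               ∎
      where open ≡-Reasoning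

-- Keys and the basis of 𝒮(V_𝒮)

-- restrict ignores the factors at non-primes, where the cells are sent to 0.
basisAt′ : ∀ {ℓ} → Dec (Prime ℓ) → Idx → V → ℤ
basisAt′ {ℓ} (yes ℓ-prime) j    = LocalBasis.basis ℓ ℓ-prime j
basisAt′ {ℓ} (no _)        base = f0 ℓ
basisAt′     (no _) (cell _ _ _) = λ _ → + 0

basisAt : ℕ → Idx → V → ℤ
basisAt ℓ = basisAt′ (prime? ℓ)

basisAt-prime : ∀ ℓ (ℓ-prime : Prime ℓ) j v → basisAt ℓ j v ≡ LocalBasis.basis ℓ ℓ-prime j v
basisAt-prime ℓ ℓ-prime j v with prime? ℓ
... | yes _ = refl
... | no ¬prime = ⊥-elim (¬prime ℓ-prime)

basisAt-base : ∀ ℓ v → basisAt ℓ base v ≡ f0 ℓ v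
basisAt-base ℓ v with prime? ℓ
... | yes _ = refl
... | no _  = refl

basisAt-01 : ∀ ℓ j v → Is01 (basisAt ℓ j v)
basisAt-01 ℓ j v with prime? ℓ
basisAt-01 ℓ j            v | yes ℓ-prime = LocalBasis.basis-01 ℓ ℓ-prime j v
basisAt-01 ℓ base         v | no _ = f0-01 ℓ v
basisAt-01 ℓ (cell _ _ _) v | no _ = inj₁ refl

height : V → ℕ
height (x , y) = ↧ₙ x ⊔ ↧ₙ y

f0-beyond-height : ∀ ℓ → Prime ℓ → ∀ v → height v < ℓ → f0 ℓ v ≡ + 1
f0-beyond-height ℓ ℓ-prime (x , y) h<ℓ = LocalBasis.f0-1 ℓ ℓ-prime x y
    (ℓ∤ x (ℕP.≤-<-trans (ℕP.m≤m⊔n (↧ₙ x) (↧ₙ y)) h<ℓ)) (ℓ∤ y (ℕP.≤-<-trans (ℕP.m≤n⊔m (↧ₙ x) (↧ₙ y)) h<ℓ))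
  where
  ℓ∤ : ∀ q → ↧ₙ q < ℓ → ¬ ℓ ND.∣ ↧ₙ q
  ℓ∤ q ↧q<ℓ ℓ∣↧q = ℕP.<⇒≱ ↧q<ℓ (ND.∣⇒≤ ℓ∣↧q)

onPrime : ∀ {A : Set} → Dec A → ℤ → ℤ
onPrime (yes _) z = z
onPrime (no _)  _ = + 1

factor : (ℕ → V → ℤ) → V → ℕ → ℤ
factor F v ℓ = onPrime (prime? ℓ) (F ℓ v)

AllOne : (ℕ → V → ℤ) → V → Set
AllOne F v = ∀ ℓ → Prime ℓ → F ℓ v ≡ + 1

OneBeyond : ℕ → (ℕ → V → ℤ) → V → Set
OneBeyond B F v = ∀ ℓ → Prime ℓ → B < ℓ → F ℓ v ≡ + 1

AllOne-or-counterexample : ∀ B F v → OneBeyond B F v → AllOne F v ⊎ (∃ λ ℓ → ℓ < suc B × Prime ℓ × ¬ F ℓ v ≡ + 1)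
AllOne-or-counterexample B F v one-beyond with ℕP.anyUpTo? (λ ℓ → prime? ℓ ×-dec ¬? (F ℓ v ℤ.≟ + 1)) (suc B)
... | yes (ℓ , ℓ≤B , ℓ-prime , Fℓ≢1) = inj₂ (ℓ , ℓ≤B , ℓ-prime , Fℓ≢1)
... | no none = inj₁ all-one
  where
  all-one : AllOne F v
  all-one ℓ ℓ-prime with ℓ ℕ.≤? B | F ℓ v ℤ.≟ + 1
  ... | _        | yes Fℓ≡1 = Fℓ≡1
  ... | yes ℓ≤B  | no Fℓ≢1  = ⊥-elim (none (ℓ , s≤s ℓ≤B , ℓ-prime , Fℓ≢1))
  ... | no ℓ≰B   | no Fℓ≢1  = ⊥-elim (Fℓ≢1 (one-beyond ℓ ℓ-prime (ℕP.≰⇒> ℓ≰B)))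

AllOne? : ∀ B F v → OneBeyond B F v → Dec (AllOne F v)
AllOne? B F v one-beyond with AllOne-or-counterexample B F v one-beyond
... | inj₁ all-one = yes all-one
... | inj₂ (ℓ , _ , ℓ-prime , Fℓ≢1) = no (λ all-one → Fℓ≢1 (all-one ℓ ℓ-prime))

Indicates : (ℕ → V → ℤ) → V → ℤ → Set
Indicates F v z = (AllOne F v → z ≡ + 1) × (¬ AllOne F v → z ≡ + 0)

Indicates-unique : ∀ {F G v w z z'} → Dec (AllOne F v) → Indicates F v z → Indicates G w z' →
                   (AllOne F v → AllOne G w) → (AllOne G w → AllOne F v) → z ≡ z'
Indicates-unique (yes all-one) (z≡1 , _) (z'≡1 , _) F⇒G G⇒F = trans (z≡1 all-one) (sym (z'≡1 (F⇒G all-one)))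
Indicates-unique (no ¬all-one) (_ , z≡0) (_ , z'≡0) F⇒G G⇒F = trans (z≡0 ¬all-one) (sym (z'≡0 (λ all-one → ¬all-one (G⇒F all-one))))

prodℤ-1 : ∀ (f : ℕ → ℤ) L → All (λ ℓ → f ℓ ≡ + 1) L → prodℤ (map f L) ≡ + 1
prodℤ-1 f []      []             = refl
prodℤ-1 f (ℓ ∷ L) (fℓ≡1 ∷ f≡1) = cong₂ ℤ._*_ fℓ≡1 (prodℤ-1 f L f≡1)

prodℤ-0 : ∀ (f : ℕ → ℤ) L {ℓ} → ℓ ∈ L → f ℓ ≡ + 0 → prodℤ (map f L) ≡ + 0
prodℤ-0 f (ℓ ∷ L)  (here refl) fℓ≡0 = cong (ℤ._* prodℤ (map f L)) fℓ≡0
prodℤ-0 f (ℓ' ∷ L) (there ℓ∈L) fℓ≡0 = trans (cong (f ℓ' ℤ.*_) (prodℤ-0 f L ℓ∈L fℓ≡0)) (ℤP.*-zeroʳ (f ℓ'))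

prod-factor-indicates : ∀ B F v → (∀ ℓ → Is01 (F ℓ v)) → OneBeyond B F v → Indicates F v (prodℤ (map (factor F v) (upTo (suc B))))
prod-factor-indicates B F v F-01 one-beyond = all-one⇒1 , ¬all-one⇒0
  where
  all-one⇒1 : AllOne F v → prodℤ (map (factor F v) (upTo (suc B))) ≡ + 1
  all-one⇒1 all-one = prodℤ-1 (factor F v) (upTo (suc B)) (All.tabulate (λ {ℓ} _ → on-prime ℓ (prime? ℓ)))
    where
    on-prime : ∀ ℓ (d : Dec (Prime ℓ)) → onPrime d (F ℓ v) ≡ + 1
    on-prime ℓ (yes ℓ-prime) = all-one ℓ ℓ-prime
    on-prime ℓ (no _)        = refl
  ¬all-one⇒0 : ¬ AllOne F v → prodℤ (map (factor F v) (upTo (suc B))) ≡ + 0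
  ¬all-one⇒0 ¬all-one with AllOne-or-counterexample B F v one-beyond
  ... | inj₁ all-one = ⊥-elim (¬all-one all-one)
  ... | inj₂ (ℓ , ℓ≤B , ℓ-prime , Fℓ≢1) = prodℤ-0 (factor F v) (upTo (suc B)) (∈-upTo⁺ ℓ≤B) (on-prime (prime? ℓ))
    where
    on-prime : (d : Dec (Prime ℓ)) → onPrime d (F ℓ v) ≡ + 0
    on-prime (yes _) with F-01 ℓ
    ... | inj₁ Fℓ≡0 = Fℓ≡0
    ... | inj₂ Fℓ≡1 = ⊥-elim (Fℓ≢1 Fℓ≡1)
    on-prime (no ¬prime) = ⊥-elim (¬prime ℓ-prime)

infixl 8 _‼_
_‼_ : List Idx → ℕ → Idx
[]       ‼ _     = base
(j ∷ ks) ‼ zero  = j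
(j ∷ ks) ‼ suc ℓ = ks ‼ ℓ

‼-beyond : ∀ ks ℓ → length ks ≤ ℓ → ks ‼ ℓ ≡ base
‼-beyond []       ℓ       _         = refl
‼-beyond (j ∷ ks) (suc ℓ) (s≤s len≤ℓ) = ‼-beyond ks ℓ len≤ℓ

ValidAt : ℕ → Idx → Set
ValidAt ℓ base         = ⊤
ValidAt ℓ (cell k a b) = Σ (Prime ℓ) λ ℓ-prime → LocalBasis.Valid ℓ ℓ-prime (cell k a b)

ValidAt⇒Valid : ∀ ℓ (ℓ-prime : Prime ℓ) j → ValidAt ℓ j → LocalBasis.Valid ℓ ℓ-prime j
ValidAt⇒Valid ℓ ℓ-prime base         _          = tt
ValidAt⇒Valid ℓ ℓ-prime (cell k a b) (_ , valid) = valid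

validAt? : ∀ ℓ j → Dec (ValidAt ℓ j)
validAt? ℓ base = yes tt
validAt? ℓ (cell k a b) with prime? ℓ
... | no ¬prime = no (λ v → ¬prime (proj₁ v))
... | yes ℓ-prime with LocalBasis.valid? ℓ ℓ-prime (cell k a b)
...   | yes valid = yes (ℓ-prime , valid)
...   | no ¬valid = no (λ v → ¬valid (proj₂ v))

ValidFrom : ℕ → List Idx → Set
ValidFrom o []       = ⊤
ValidFrom o (j ∷ ks) = ValidAt o j × ValidFrom (suc o) ks

validFrom? : ∀ o ks → Dec (ValidFrom o ks)
validFrom? o []       = yes tt
validFrom? o (j ∷ ks) = validAt? o j ×-dec validFrom? (suc o) ks

ValidFrom⇒ValidAt : ∀ o ks → ValidFrom o ks → ∀ i → ValidAt (o ℕ.+ i) (ks ‼ i)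
ValidFrom⇒ValidAt o []       _                 i       = tt
ValidFrom⇒ValidAt o (j ∷ ks) (valid-j , _)     zero    = subst (λ z → ValidAt z j) (sym (ℕP.+-identityʳ o)) valid-j
ValidFrom⇒ValidAt o (j ∷ ks) (_ , valid-ks)    (suc i) = subst (λ z → ValidAt z (ks ‼ i)) (sym (ℕP.+-suc o i)) (ValidFrom⇒ValidAt (suc o) ks valid-ks i)

ValidAt⇒ValidFrom : ∀ o ks → (∀ i → ValidAt (o ℕ.+ i) (ks ‼ i)) → ValidFrom o ks
ValidAt⇒ValidFrom o []       _     = tt
ValidAt⇒ValidFrom o (j ∷ ks) valid = subst (λ z → ValidAt z j) (ℕP.+-identityʳ o) (valid 0) ,
  ValidAt⇒ValidFrom (suc o) ks (λ i → subst (λ z → ValidAt z (ks ‼ i)) (ℕP.+-suc o i) (valid (suc i)))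

consTrim : Idx → List Idx → List Idx
consTrim j (k ∷ ks) = j ∷ k ∷ ks
consTrim j []       with j ≟ᵢ base
... | yes _ = []
... | no _  = j ∷ []

trim : List Idx → List Idx
trim []       = []
trim (j ∷ js) = consTrim j (trim js)

‼-consTrim : ∀ j ks i → consTrim j ks ‼ i ≡ (j ∷ ks) ‼ i
‼-consTrim j (k ∷ ks) i = refl
‼-consTrim j [] i with j ≟ᵢ base
‼-consTrim j [] zero    | yes j≡base = sym j≡base
‼-consTrim j [] (suc i) | yes _      = refl
‼-consTrim j [] i       | no _       = refl

‼-trim : ∀ js i → trim js ‼ i ≡ js ‼ i
‼-trim []       i       = refl
‼-trim (j ∷ js) zero    = ‼-consTrim j (trim js) zero
‼-trim (j ∷ js) (suc i) = trans (‼-consTrim j (trim js) (suc i)) (‼-trim js i)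

trim-all-base : ∀ js → (∀ i → js ‼ i ≡ base) → trim js ≡ []
trim-all-base []       _        = refl
trim-all-base (j ∷ js) all-base rewrite trim-all-base js (λ i → all-base (suc i)) | all-base 0 = refl

trim-≗ : ∀ js js' → (∀ i → js ‼ i ≡ js' ‼ i) → trim js ≡ trim js'
trim-≗ []       js'       js≗js' = sym (trim-all-base js' (λ i → sym (js≗js' i)))
trim-≗ (j ∷ js) []        js≗js' = trim-all-base (j ∷ js) js≗js'
trim-≗ (j ∷ js) (j' ∷ js') js≗js' = cong₂ consTrim (js≗js' 0) (trim-≗ js js' (λ i → js≗js' (suc i)))

trim-idem : ∀ js → trim (trim js) ≡ trim js
trim-idem js = trim-≗ (trim js) js (‼-trim js)

length-trim : ∀ js → length (trim js) ≤ length js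
length-trim []       = z≤n
length-trim (j ∷ js) = length-consTrim (trim js) (length-trim js)
  where
  length-consTrim : ∀ t → length t ≤ length js → length (consTrim j t) ≤ suc (length js)
  length-consTrim (k ∷ ks) t≤js = s≤s t≤js
  length-consTrim []       _    with j ≟ᵢ base
  ... | yes _ = z≤n
  ... | no _  = s≤s z≤n

Canonical : List Idx → Set
Canonical ks = ValidFrom 0 ks × trim ks ≡ ks

canonical? : ∀ ks → Dec (Canonical ks)
canonical? ks = validFrom? 0 ks ×-dec ListP.≡-dec _≟ᵢ_ (trim ks) ks

-- Entry ℓ of idxs is the local index at ℓ; being canonical (no trailing base) makes the key of a basis
-- vector unique.
record Key (S : ℕ → Set) : Set where
  constructor key
  field
    idxs       : List Idx
    .canonical : Canonical idxs
    .avoids-S  : ∀ ℓ → idxs ‼ ℓ ≢ base → ¬ S ℓ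

key-≡ : ∀ {S} (K K' : Key S) → Key.idxs K ≡ Key.idxs K' → K ≡ K'
key-≡ (key ks _ _) (key .ks _ _) refl = refl

canonical : ∀ {S} (K : Key S) → Canonical (Key.idxs K)
canonical (key ks canon _) = recompute (canonical? ks) canon

keyFactors : List Idx → ℕ → V → ℤ
keyFactors ks ℓ = basisAt ℓ (ks ‼ ℓ)

keyTensor : ∀ {S} → Key S → PureTensor S
keyTensor {S} (key ks _ avoids-S) = record
  { φ        = keyFactors ks
  ; N        = length ks
  ; local    = λ ℓ ℓ-prime → level (ks ‼ ℓ) , LocalBasis.AtLevel-cong ℓ ℓ-prime {level (ks ‼ ℓ)} (λ v → sym (basisAt-prime ℓ ℓ-prime (ks ‼ ℓ) v))
                                                  (LocalBasis.basis-level ℓ ℓ-prime (ks ‼ ℓ))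
  ; onS      = λ ℓ _ ℓ∈S v → on-S ℓ v (ks ‼ ℓ ≟ᵢ base) (avoids-S ℓ) ℓ∈S
  ; cofinite = λ ℓ _ N<ℓ v → trans (cong (λ j → basisAt ℓ j v) (‼-beyond ks ℓ (ℕP.<⇒≤ N<ℓ))) (basisAt-base ℓ v)
  }
  where
  on-S : ∀ ℓ v → Dec (ks ‼ ℓ ≡ base) → .(ks ‼ ℓ ≢ base → ¬ S ℓ) → S ℓ → basisAt ℓ (ks ‼ ℓ) v ≡ f0 ℓ v
  on-S ℓ v (yes ‼≡base) _        _   = trans (cong (λ j → basisAt ℓ j v) ‼≡base) (basisAt-base ℓ v)
  on-S ℓ v (no ‼≢base)  avoids-S ℓ∈S = ⊥-elim-irr (avoids-S ‼≢base ℓ∈S)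

keyBasis : ∀ {S} → Key S → V → ℤ
keyBasis K = restrict (keyTensor K)

-- The factor function of restrict is local to its where-block; unification recovers it.
restrict-factor : ∀ {S} (t : PureTensor S) x y →
                  Σ (ℕ → ℤ) λ h → restrict t (x , y) ≡ + 1 ℤ.* prodℤ (map h (applyUpTo suc (PureTensor.N t ⊔ height (x , y))))
restrict-factor t x y = _ , refl

restrict-factor-≗ : ∀ {S} (t : PureTensor S) x y ℓ → proj₁ (restrict-factor t x y) ℓ ≡ factor (PureTensor.φ t) (x , y) ℓ
restrict-factor-≗ t x y ℓ with prime? ℓ
... | yes _ = refl
... | no _  = refl

restrict-≡ : ∀ {S} (t : PureTensor S) v → restrict t v ≡ prodℤ (map (factor (PureTensor.φ t) v) (upTo (suc (PureTensor.N t ⊔ height v))))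
restrict-≡ t (x , y) = trans (proj₂ (restrict-factor t x y))
  (cong (λ z → + 1 ℤ.* prodℤ z) (map-cong (restrict-factor-≗ t x y) (applyUpTo suc (PureTensor.N t ⊔ height (x , y)))))

keyFactors-beyond : ∀ ks v → OneBeyond (length ks ⊔ height v) (keyFactors ks) v
keyFactors-beyond ks v ℓ ℓ-prime B<ℓ =
  trans (cong (λ j → basisAt ℓ j v) (‼-beyond ks ℓ (ℕP.<⇒≤ (ℕP.≤-<-trans (ℕP.m≤m⊔n (length ks) (height v)) B<ℓ))))
        (trans (basisAt-base ℓ v) (f0-beyond-height ℓ ℓ-prime v (ℕP.≤-<-trans (ℕP.m≤n⊔m (length ks) (height v)) B<ℓ)))

keyBasis-indicates : ∀ {S} (K : Key S) v → Indicates (keyFactors (Key.idxs K)) v (keyBasis K v)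
keyBasis-indicates K@(key ks _ _) v = subst (Indicates (keyFactors ks) v) (sym (restrict-≡ (keyTensor K) v))
  (prod-factor-indicates (length ks ⊔ height v) (keyFactors ks) v (λ ℓ → basisAt-01 ℓ (ks ‼ ℓ) v) (keyFactors-beyond ks v))

-- Linear independence

excludeIf : Bool → (V → ℤ) → V → ℤ
excludeIf true  _ _ = + 1
excludeIf false f v = f v

maskedFactors : (ℕ → Bool) → (ℕ → Idx) → ℕ → V → ℤ
maskedFactors X k ℓ = excludeIf (X ℓ) (basisAt ℓ (k ℓ))

maskedFactors-01 : ∀ X k ℓ v → Is01 (maskedFactors X k ℓ v)
maskedFactors-01 X k ℓ v with X ℓ
... | true  = inj₂ refl
... | false = basisAt-01 ℓ (k ℓ) v

BaseBeyond : ℕ → (ℕ → Idx) → Set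
BaseBeyond B k = ∀ ℓ → B < ℓ → k ℓ ≡ base

maskedFactors-beyond : ∀ X k B v → BaseBeyond B k → OneBeyond (B ⊔ height v) (maskedFactors X k) v
maskedFactors-beyond X k B v k-beyond ℓ ℓ-prime B⊔h<ℓ with X ℓ
... | true  = refl
... | false = trans (cong (λ j → basisAt ℓ j v) (k-beyond ℓ (ℕP.≤-<-trans (ℕP.m≤m⊔n B (height v)) B⊔h<ℓ)))
                    (trans (basisAt-base ℓ v) (f0-beyond-height ℓ ℓ-prime v (ℕP.≤-<-trans (ℕP.m≤n⊔m B (height v)) B⊔h<ℓ)))

partialBasis : (ℕ → Bool) → (ℕ → Idx) → ℕ → V → ℤ
partialBasis X k B v = prodℤ (map (factor (maskedFactors X k) v) (upTo (suc (B ⊔ height v))))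

partialBasis-indicates : ∀ X k B v → BaseBeyond B k → Indicates (maskedFactors X k) v (partialBasis X k B v)
partialBasis-indicates X k B v k-beyond =
  prod-factor-indicates (B ⊔ height v) (maskedFactors X k) v (λ ℓ → maskedFactors-01 X k ℓ v) (maskedFactors-beyond X k B v k-beyond)

AllOne-masked? : ∀ X k B v → BaseBeyond B k → Dec (AllOne (maskedFactors X k) v)
AllOne-masked? X k B v k-beyond = AllOne? (B ⊔ height v) (maskedFactors X k) v (maskedFactors-beyond X k B v k-beyond)

keyBasis≡partialBasis : ∀ {S} (K : Key S) B v → length (Key.idxs K) ≤ B →
                        keyBasis K v ≡ partialBasis (λ _ → false) (Key.idxs K ‼_) B v
keyBasis≡partialBasis K B v len≤B = Indicates-unique {keyFactors (Key.idxs K)} {maskedFactors (λ _ → false) (Key.idxs K ‼_)} {v} {v} (AllOne-masked? (λ _ → false) (Key.idxs K ‼_) B v k-beyond)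
  (keyBasis-indicates K v) (partialBasis-indicates (λ _ → false) (Key.idxs K ‼_) B v k-beyond) (λ all-one → all-one) (λ all-one → all-one)
  where
  k-beyond : BaseBeyond B (Key.idxs K ‼_)
  k-beyond ℓ B<ℓ = ‼-beyond (Key.idxs K) ℓ (ℕP.≤-trans len≤B (ℕP.<⇒≤ B<ℓ))

exclude : (ℕ → Bool) → ℕ → ℕ → Bool
exclude X ℓ₁ ℓ with ℓ ℕ.≟ ℓ₁
... | yes _ = true
... | no _  = X ℓ

exclude-other : ∀ X ℓ₁ ℓ → ℓ ≢ ℓ₁ → exclude X ℓ₁ ℓ ≡ X ℓ
exclude-other X ℓ₁ ℓ ℓ≢ℓ₁ with ℓ ℕ.≟ ℓ₁
... | yes ℓ≡ℓ₁ = ⊥-elim (ℓ≢ℓ₁ ℓ≡ℓ₁)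
... | no _     = refl

exclude-false : ∀ X ℓ₁ ℓ → exclude X ℓ₁ ℓ ≡ false → ℓ ≢ ℓ₁ × X ℓ ≡ false
exclude-false X ℓ₁ ℓ excluded≡false with ℓ ℕ.≟ ℓ₁
... | no ℓ≢ℓ₁ = ℓ≢ℓ₁ , excluded≡false

partialBasis-split : ∀ X k B v ℓ₁ → Prime ℓ₁ → X ℓ₁ ≡ false → BaseBeyond B k →
                     partialBasis X k B v ≡ basisAt ℓ₁ (k ℓ₁) v ℤ.* partialBasis (exclude X ℓ₁) k B v
partialBasis-split X k B v ℓ₁ ℓ₁-prime X-ℓ₁ k-beyond with AllOne-masked? (exclude X ℓ₁) k B v k-beyond | basisAt-01 ℓ₁ (k ℓ₁) v
... | yes all-one' | inj₂ a≡1 = trans (proj₁ (partialBasis-indicates X k B v k-beyond) all-one)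
                                     (sym (cong₂ ℤ._*_ a≡1 (proj₁ (partialBasis-indicates (exclude X ℓ₁) k B v k-beyond) all-one')))
  where
  all-one : AllOne (maskedFactors X k) v
  all-one ℓ ℓ-prime with ℓ ℕ.≟ ℓ₁
  ... | yes refl = trans (cong (λ b → excludeIf b (basisAt ℓ (k ℓ)) v) X-ℓ₁) a≡1
  ... | no ℓ≢ℓ₁  = trans (cong (λ b → excludeIf b (basisAt ℓ (k ℓ)) v) (sym (exclude-other X ℓ₁ ℓ ℓ≢ℓ₁))) (all-one' ℓ ℓ-prime)
... | yes _ | inj₁ a≡0 = trans (proj₂ (partialBasis-indicates X k B v k-beyond) ¬all-one) (sym (cong (ℤ._* partialBasis (exclude X ℓ₁) k B v) a≡0))
  where
  ¬all-one : ¬ AllOne (maskedFactors X k) v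
  ¬all-one all-one = 0≢1 (trans (sym a≡0) (trans (cong (λ b → excludeIf b (basisAt ℓ₁ (k ℓ₁)) v) (sym X-ℓ₁)) (all-one ℓ₁ ℓ₁-prime)))
    where
    0≢1 : + 0 ≢ + 1
    0≢1 ()
... | no ¬all-one' | _ = trans (proj₂ (partialBasis-indicates X k B v k-beyond) ¬all-one)
                               (sym (trans (cong (basisAt ℓ₁ (k ℓ₁) v ℤ.*_) (proj₂ (partialBasis-indicates (exclude X ℓ₁) k B v k-beyond) ¬all-one'))
                                           (ℤP.*-zeroʳ (basisAt ℓ₁ (k ℓ₁) v))))
  where
  ¬all-one : ¬ AllOne (maskedFactors X k) v
  ¬all-one all-one = ¬all-one' all-one'
    where
    all-one' : AllOne (maskedFactors (exclude X ℓ₁) k) v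
    all-one' ℓ ℓ-prime with ℓ ℕ.≟ ℓ₁
    ... | yes refl = refl
    ... | no _     = all-one ℓ ℓ-prime

prime∤prime : ∀ {p q} → Prime p → Prime q → p ≢ q → ¬ p ND.∣ q
prime∤prime p-prime q-prime p≢q p∣q with prime⇒irreducible q-prime p∣q
... | inj₁ p≡1 = ¬prime[1] (subst Prime p≡1 p-prime)
... | inj₂ p≡q = p≢q p≡q

modulus : ℕ → List ℕ → ℕ
modulus L = foldr (λ ℓ M → ℓ ^ L ℕ.* M) 1

modulus-∤ : ∀ L {ℓ₁} (ℓ₁-prime : Prime ℓ₁) U → All Prime U → ℓ₁ ∉ U → ¬ ℓ₁ ND.∣ modulus L U
modulus-∤ L ℓ₁-prime []      []                 _    = Adic.ℓ∤1 _ ℓ₁-prime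
modulus-∤ L ℓ₁-prime (ℓ ∷ U) (ℓ-prime ∷ U-prime) ℓ₁∉ =
  Adic.∤-* _ ℓ₁-prime (Adic.∤-^ _ ℓ₁-prime (prime∤prime ℓ₁-prime ℓ-prime (λ ℓ₁≡ℓ → ℓ₁∉ (here ℓ₁≡ℓ))) L)
                      (modulus-∤ L ℓ₁-prime U U-prime (λ ℓ₁∈U → ℓ₁∉ (there ℓ₁∈U)))

modulus-∣ : ∀ L {ℓ} U → ℓ ∈ U → ℓ ^ L ND.∣ modulus L U
modulus-∣ L (ℓ ∷ U)  (here refl)  = ND.∣m⇒∣m*n (modulus L U) ND.∣-refl
modulus-∣ L (ℓ' ∷ U) (there ℓ∈U) = ND.∣n⇒∣m*n (ℓ' ^ L) (modulus-∣ L U ℓ∈U)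

∣⇒InSmall-/ℓ₁^ : ∀ {ℓ ℓ₁} (ℓ-prime : Prime ℓ) (ℓ₁-prime : Prime ℓ₁) → ℓ ≢ ℓ₁ → ∀ n k M c → ℓ ^ n ND.∣ M →
                 InSmall ℓ n (_/_ (+ M ℤ.* c) (ℓ₁ ^ k) {{Adic.ℓ^≢0 ℓ₁ ℓ₁-prime k}})
∣⇒InSmall-/ℓ₁^ {ℓ} {ℓ₁} ℓ-prime ℓ₁-prime ℓ≢ℓ₁ n k M c ℓ^n∣M =
  Adic.∣⇒InSmall ℓ ℓ-prime (+ M ℤ.* c) n 0 (ℓ₁ ^ k) (ℓ₁ ^ k) {{Adic.ℓ^≢0 ℓ₁ ℓ₁-prime k}} (sym (ℕP.*-identityˡ (ℓ₁ ^ k)))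
    (Adic.∤-^ ℓ ℓ-prime (prime∤prime ℓ-prime ℓ₁-prime ℓ≢ℓ₁) k)
    (subst (λ z → (+ (ℓ ^ z)) ZD.∣ (+ M ℤ.* c)) (sym (ℕP.+-identityʳ n)) (ZD.∣m⇒∣m*n {+ (ℓ ^ n)} {+ M} c (ZD.∣ᵤ⇒∣ {+ (ℓ ^ n)} {+ M} ℓ^n∣M)))

basisAt-invariant : ∀ ℓ (ℓ-prime : Prime ℓ) j n → level j ≤ n → ∀ x y x' y' →
                    InSmall ℓ n (x ℚ.- x') → InSmall ℓ n (y ℚ.- y') → basisAt ℓ j (x , y) ≡ basisAt ℓ j (x' , y')
basisAt-invariant ℓ ℓ-prime j n j≤n x y x' y' x≈x' y≈y' = trans (basisAt-prime ℓ ℓ-prime j (x , y))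
  (trans (proj₁ (LocalBasis.AtLevel-≤ ℓ ℓ-prime (LocalBasis.basis ℓ ℓ-prime j) j≤n (LocalBasis.basis-level ℓ ℓ-prime j)) (x , y) (x' , y') x≈x' y≈y')
         (sym (basisAt-prime ℓ ℓ-prime j (x' , y'))))

record Admissible (B L : ℕ) (X : ℕ → Bool) (U : List ℕ) (k : ℕ → Idx) : Set where
  field
    supported : ∀ ℓ → ℓ ∉ U → X ℓ ≡ false → k ℓ ≡ base
    valid     : ∀ ℓ → ValidAt ℓ (k ℓ)
    bounded   : BaseBeyond B k
    leveled   : ∀ ℓ → level (k ℓ) ≤ L

Term : Set
Term = ℤ × (ℕ → Idx)

combination : (ℕ → Bool) → ℕ → List Term → V → ℤ
combination X B ts v = sumℤ (map (λ t → proj₁ t ℤ.* partialBasis X (proj₂ t) B v) ts)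

Separated : (ℕ → Bool) → Term → Term → Set
Separated X t t' = ∃ λ ℓ → X ℓ ≡ false × proj₂ t ℓ ≢ proj₂ t' ℓ

_≟at_ : (j : Idx) (ℓ : ℕ) (t : Term) → Dec (j ≡ proj₂ t ℓ)
(j ≟at ℓ) t = j ≟ᵢ proj₂ t ℓ

excludeIf-invariant : ∀ b (f : V → ℤ) v w → (b ≡ false → f v ≡ f w) → excludeIf b f v ≡ excludeIf b f w
excludeIf-invariant true  f v w _       = refl
excludeIf-invariant false f v w f-invar = f-invar refl

-- Moving a point by an offset prescribes its ℓ₁-adic position up to ℓ₁^L while keeping its class at every
-- other prime where a key is not base, so only the ℓ₁-factors see the target; the ℓ₁-dual functionals then
-- isolate the terms with a given index at ℓ₁.
module Step (B L ℓ₁ : ℕ) (ℓ₁-prime : Prime ℓ₁) (U : List ℕ) (U-prime : All Prime U) (ℓ₁∉U : ℓ₁ ∉ U)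
            (X : ℕ → Bool) (ℓ₁-active : X ℓ₁ ≡ false) where

  open LocalBasis ℓ₁ ℓ₁-prime using (coeff; coeff-basis; coeff-cong; coeff-sum; coeff-0̇)

  M : ℕ
  M = modulus L U

  approximation : ∀ x₀ p → Σ ℤ λ c → Σ ℕ λ k → InSmall ℓ₁ L ((p ℚ.- x₀) ℚ.- _/_ (+ M ℤ.* c) (ℓ₁ ^ k) {{Adic.ℓ^≢0 ℓ₁ ℓ₁-prime k}})
  approximation x₀ p = Adic.approximate ℓ₁ ℓ₁-prime L (p ℚ.- x₀) M (modulus-∤ L ℓ₁-prime U U-prime ℓ₁∉U)

  offset : ℚ → ℚ → ℚ
  offset x₀ p = _/_ (+ M ℤ.* proj₁ (approximation x₀ p)) (ℓ₁ ^ proj₁ (proj₂ (approximation x₀ p))) {{Adic.ℓ^≢0 ℓ₁ ℓ₁-prime (proj₁ (proj₂ (approximation x₀ p)))}}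

  nudge : ℚ → ℚ → ℚ
  nudge x₀ p = x₀ ℚ.+ offset x₀ p

  nudge≈target : ∀ x₀ p → InSmall ℓ₁ L (nudge x₀ p ℚ.- p)
  nudge≈target x₀ p = subst (InSmall ℓ₁ L) (sym [x₀+w]-p≡)
      (Adic.InSmall-neg ℓ₁ ℓ₁-prime L ((p ℚ.- x₀) ℚ.- offset x₀ p) (proj₂ (proj₂ (approximation x₀ p))))
    where
    [x₀+w]-p≡ : nudge x₀ p ℚ.- p ≡ ℚ.- ((p ℚ.- x₀) ℚ.- offset x₀ p)
    [x₀+w]-p≡ = solve 3 (λ x₀ w p → (x₀ :+ w) :- p := :- ((p :- x₀) :- w)) refl x₀ (offset x₀ p) p
      where open ℚS

  nudge≈start : ∀ {ℓ} → Prime ℓ → ℓ ≢ ℓ₁ → ∀ n → ℓ ^ n ND.∣ M → ∀ x₀ p → InSmall ℓ n (nudge x₀ p ℚ.- x₀)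
  nudge≈start ℓ-prime ℓ≢ℓ₁ n ℓ^n∣M x₀ p = subst (InSmall _ n) (sym [x₀+w]-x₀≡w)
      (∣⇒InSmall-/ℓ₁^ ℓ-prime ℓ₁-prime ℓ≢ℓ₁ n (proj₁ (proj₂ (approximation x₀ p))) M (proj₁ (approximation x₀ p)) ℓ^n∣M)
    where
    [x₀+w]-x₀≡w : nudge x₀ p ℚ.- x₀ ≡ offset x₀ p
    [x₀+w]-x₀≡w = solve 2 (λ x₀ w → (x₀ :+ w) :- x₀ := w) refl x₀ (offset x₀ p)
      where open ℚS

  ℓ^level∣M : ∀ k → Admissible B L X (ℓ₁ ∷ U) k → ∀ ℓ → ℓ ≢ ℓ₁ → X ℓ ≡ false → ℓ ^ level (k ℓ) ND.∣ M
  ℓ^level∣M k admissible ℓ ℓ≢ℓ₁ X-ℓ with k ℓ ≟ᵢ base | ℓ ∈? U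
  ... | yes kℓ≡base | _    = subst (λ j → ℓ ^ level j ND.∣ M) (sym kℓ≡base) (ND.1∣ M)
  ... | no _        | yes ℓ∈U = ND.∣-trans (ℓ^-mono-∣ ℓ (Admissible.leveled admissible ℓ)) (modulus-∣ L U ℓ∈U)
  ... | no kℓ≢base  | no ℓ∉U  = ⊥-elim (kℓ≢base (Admissible.supported admissible ℓ ℓ∉ℓ₁∷U X-ℓ))
    where
    ℓ∉ℓ₁∷U : ℓ ∉ ℓ₁ ∷ U
    ℓ∉ℓ₁∷U (here ℓ≡ℓ₁) = ℓ≢ℓ₁ ℓ≡ℓ₁
    ℓ∉ℓ₁∷U (there ℓ∈U) = ℓ∉U ℓ∈U

  partialBasis-nudge : ∀ k → Admissible B L X (ℓ₁ ∷ U) k → ∀ x₀ y₀ px py →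
                       partialBasis X k B (nudge x₀ px , nudge y₀ py) ≡ basisAt ℓ₁ (k ℓ₁) (px , py) ℤ.* partialBasis (exclude X ℓ₁) k B (x₀ , y₀)
  partialBasis-nudge k admissible x₀ y₀ px py =
    trans (partialBasis-split X k B v' ℓ₁ ℓ₁-prime ℓ₁-active bounded) (cong₂ ℤ._*_ at-ℓ₁ elsewhere)
    where
    open Admissible admissible
    v' = nudge x₀ px , nudge y₀ py
    at-ℓ₁ : basisAt ℓ₁ (k ℓ₁) v' ≡ basisAt ℓ₁ (k ℓ₁) (px , py)
    at-ℓ₁ = basisAt-invariant ℓ₁ ℓ₁-prime (k ℓ₁) L (leveled ℓ₁) (nudge x₀ px) (nudge y₀ py) px py (nudge≈target x₀ px) (nudge≈target y₀ py)
    factor-invariant : ∀ ℓ → Prime ℓ → maskedFactors (exclude X ℓ₁) k ℓ v' ≡ maskedFactors (exclude X ℓ₁) k ℓ (x₀ , y₀)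
    factor-invariant ℓ ℓ-prime = excludeIf-invariant (exclude X ℓ₁ ℓ) (basisAt ℓ (k ℓ)) v' (x₀ , y₀) λ excluded≡false →
      let (ℓ≢ℓ₁ , X-ℓ) = exclude-false X ℓ₁ ℓ excluded≡false
          ℓ^n∣M = ℓ^level∣M k admissible ℓ ℓ≢ℓ₁ X-ℓ
      in basisAt-invariant ℓ ℓ-prime (k ℓ) (level (k ℓ)) ℕP.≤-refl (nudge x₀ px) (nudge y₀ py) x₀ y₀
           (nudge≈start ℓ-prime ℓ≢ℓ₁ (level (k ℓ)) ℓ^n∣M x₀ px) (nudge≈start ℓ-prime ℓ≢ℓ₁ (level (k ℓ)) ℓ^n∣M y₀ py)
    elsewhere : partialBasis (exclude X ℓ₁) k B v' ≡ partialBasis (exclude X ℓ₁) k B (x₀ , y₀)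
    elsewhere = Indicates-unique {maskedFactors (exclude X ℓ₁) k} {maskedFactors (exclude X ℓ₁) k} {v'} {x₀ , y₀}
      (AllOne-masked? (exclude X ℓ₁) k B v' bounded)
      (partialBasis-indicates (exclude X ℓ₁) k B v' bounded) (partialBasis-indicates (exclude X ℓ₁) k B (x₀ , y₀) bounded)
      (λ all-one ℓ ℓ-prime → trans (sym (factor-invariant ℓ ℓ-prime)) (all-one ℓ ℓ-prime))
      (λ all-one ℓ ℓ-prime → trans (factor-invariant ℓ ℓ-prime) (all-one ℓ ℓ-prime))

  coefficients-at-ℓ₁ : ∀ ts → All (λ t → Admissible B L X (ℓ₁ ∷ U) (proj₂ t)) ts → (∀ v → combination X B ts v ≡ + 0) →
                       ∀ j → ValidAt ℓ₁ j → ∀ v₀ → combination (exclude X ℓ₁) B (filter (j ≟at ℓ₁) ts) v₀ ≡ + 0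
  coefficients-at-ℓ₁ ts admissible vanishes j valid-j v₀@(x₀ , y₀) = begin
      sumℤ (map a (filter (j ≟at ℓ₁) ts))                                  ≡⟨ sumℤ-*𝟙 (j ≟at ℓ₁) a ts ⟨
      sumℤ (map (λ t → a t ℤ.* δ j (proj₂ t ℓ₁)) ts)                        ≡⟨ cong sumℤ (map-cong-local (All.map (λ {t} → coeff≡δ {t}) admissible)) ⟨
      sumℤ (map (λ t → a t ℤ.* coeff j (basisAt ℓ₁ (proj₂ t ℓ₁))) ts)       ≡⟨ coeff-sum j ts a (λ t → basisAt ℓ₁ (proj₂ t ℓ₁)) ⟨
      coeff j (λ p → sumℤ (map (λ t → a t ℤ.* basisAt ℓ₁ (proj₂ t ℓ₁) p) ts)) ≡⟨ coeff-cong j _ (λ _ → + 0) vanishes-at-ℓ₁ ⟩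
      coeff j (λ _ → + 0)                                                  ≡⟨ coeff-0̇ j ⟩
      + 0                                                                  ∎
    where
    open ≡-Reasoning
    a : Term → ℤ
    a t = proj₁ t ℤ.* partialBasis (exclude X ℓ₁) (proj₂ t) B v₀
    coeff≡δ : ∀ {t} → Admissible B L X (ℓ₁ ∷ U) (proj₂ t) → a t ℤ.* coeff j (basisAt ℓ₁ (proj₂ t ℓ₁)) ≡ a t ℤ.* δ j (proj₂ t ℓ₁)
    coeff≡δ {t} admissible-t = cong (a t ℤ.*_)
      (trans (coeff-cong j (basisAt ℓ₁ (proj₂ t ℓ₁)) _ (basisAt-prime ℓ₁ ℓ₁-prime (proj₂ t ℓ₁)))
             (coeff-basis j (proj₂ t ℓ₁) (ValidAt⇒Valid ℓ₁ ℓ₁-prime j valid-j)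
                                        (ValidAt⇒Valid ℓ₁ ℓ₁-prime (proj₂ t ℓ₁) (Admissible.valid admissible-t ℓ₁))))
    vanishes-at-ℓ₁ : ∀ p → sumℤ (map (λ t → a t ℤ.* basisAt ℓ₁ (proj₂ t ℓ₁) p) ts) ≡ + 0
    vanishes-at-ℓ₁ (px , py) = trans (cong sumℤ (map-cong-local (All.map (λ {t} → nudged {t}) admissible))) (vanishes (nudge x₀ px , nudge y₀ py))
      where
      nudged : ∀ {t} → Admissible B L X (ℓ₁ ∷ U) (proj₂ t) →
               a t ℤ.* basisAt ℓ₁ (proj₂ t ℓ₁) (px , py) ≡ proj₁ t ℤ.* partialBasis X (proj₂ t) B (nudge x₀ px , nudge y₀ py)
      nudged {c , k} admissible-t = trans
        (solve 3 (λ c p b → (c :* p) :* b := c :* (b :* p)) refl c (partialBasis (exclude X ℓ₁) k B v₀) (basisAt ℓ₁ (k ℓ₁) (px , py)))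
        (cong (c ℤ.*_) (sym (partialBasis-nudge k admissible-t x₀ y₀ px py)))
        where open ℤS

AllPairs-refine : ∀ {A : Set} {P : A → Set} {R R' : A → A → Set} {xs} →
                  (∀ {x y} → P x → P y → R x y → R' x y) → All P xs → AllPairs R xs → AllPairs R' xs
AllPairs-refine refine []         []          = []
AllPairs-refine refine (px ∷ pxs) (rx ∷ rxs) =
  All.zipWith (λ { (r , py) → refine px py r }) (rx , pxs) ∷ AllPairs-refine refine pxs rxs

partialBasis-origin : ∀ B L X k → Admissible B L X [] k → partialBasis X k B 0V ≡ + 1
partialBasis-origin B L X k admissible = proj₁ (partialBasis-indicates X k B 0V (Admissible.bounded admissible)) all-one
  where
  all-one : AllOne (maskedFactors X k) 0V
  all-one ℓ ℓ-prime = excludeIf-1 (X ℓ) refl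
    where
    excludeIf-1 : ∀ b → X ℓ ≡ b → excludeIf b (basisAt ℓ (k ℓ)) 0V ≡ + 1
    excludeIf-1 true  _   = refl
    excludeIf-1 false X-ℓ = trans (cong (λ j → basisAt ℓ j 0V) (Admissible.supported admissible ℓ (λ ()) X-ℓ))
                                  (trans (basisAt-base ℓ 0V) (f0-beyond-height ℓ ℓ-prime 0V (Adic.1<ℓ ℓ ℓ-prime)))

Admissible-drop : ∀ {B L X ℓ₁ U k} → X ℓ₁ ≡ true → Admissible B L X (ℓ₁ ∷ U) k → Admissible B L X U k
Admissible-drop {X = X} {ℓ₁} {U} {k} X-ℓ₁ admissible = record { Admissible admissible ; supported = supported }
  where
  supported : ∀ ℓ → ℓ ∉ U → X ℓ ≡ false → k ℓ ≡ base
  supported ℓ ℓ∉U X-ℓ = Admissible.supported admissible ℓ ℓ∉ℓ₁∷U X-ℓ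
    where
    ℓ∉ℓ₁∷U : ℓ ∉ ℓ₁ ∷ U
    ℓ∉ℓ₁∷U (here refl) with () ← trans (sym X-ℓ₁) X-ℓ
    ℓ∉ℓ₁∷U (there ℓ∈U) = ℓ∉U ℓ∈U

Admissible-exclude : ∀ {B L X ℓ₁ U k} → Admissible B L X (ℓ₁ ∷ U) k → Admissible B L (exclude X ℓ₁) U k
Admissible-exclude {X = X} {ℓ₁} {U} {k} admissible = record { Admissible admissible ; supported = supported }
  where
  supported : ∀ ℓ → ℓ ∉ U → exclude X ℓ₁ ℓ ≡ false → k ℓ ≡ base
  supported ℓ ℓ∉U X'-ℓ = Admissible.supported admissible ℓ ℓ∉ℓ₁∷U X-ℓ
    where
    ℓ≢ℓ₁ = proj₁ (exclude-false X ℓ₁ ℓ X'-ℓ)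
    X-ℓ = proj₂ (exclude-false X ℓ₁ ℓ X'-ℓ)
    ℓ∉ℓ₁∷U : ℓ ∉ ℓ₁ ∷ U
    ℓ∉ℓ₁∷U (here ℓ≡ℓ₁) = ℓ≢ℓ₁ ℓ≡ℓ₁
    ℓ∉ℓ₁∷U (there ℓ∈U) = ℓ∉U ℓ∈U

Separated-exclude : ∀ X ℓ₁ j ts → AllPairs (Separated X) ts → AllPairs (Separated (exclude X ℓ₁)) (filter (j ≟at ℓ₁) ts)
Separated-exclude X ℓ₁ j ts separated =
  AllPairs-refine (λ {t} {t'} → refine {t} {t'}) (AllP.all-filter (j ≟at ℓ₁) ts) (AllPairsP.filter⁺ (j ≟at ℓ₁) separated)
  where
  refine : ∀ {t t'} → j ≡ proj₂ t ℓ₁ → j ≡ proj₂ t' ℓ₁ → Separated X t t' → Separated (exclude X ℓ₁) t t'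
  refine j≡kℓ₁ j≡k'ℓ₁ (ℓ , X-ℓ , kℓ≢k'ℓ) = ℓ , trans (exclude-other X ℓ₁ ℓ ℓ≢ℓ₁) X-ℓ , kℓ≢k'ℓ
    where
    ℓ≢ℓ₁ : ℓ ≢ ℓ₁
    ℓ≢ℓ₁ refl = kℓ≢k'ℓ (trans (sym j≡kℓ₁) j≡k'ℓ₁)

coefficients-vanish : ∀ B L U X ts → All Prime U → Unique U → All (λ t → Admissible B L X U (proj₂ t)) ts →
                      AllPairs (Separated X) ts → (∀ v → combination X B ts v ≡ + 0) → All (λ t → proj₁ t ≡ + 0) ts
coefficients-vanish B L [] X [] _ _ _ _ _ = []
coefficients-vanish B L [] X ((c , k) ∷ []) _ _ (admissible ∷ []) _ vanishes = c≡0 ∷ []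
  where
  c≡0 : c ≡ + 0
  c≡0 = begin
    c                                 ≡⟨ ℤP.*-identityʳ c ⟨
    c ℤ.* + 1                         ≡⟨ cong (c ℤ.*_) (partialBasis-origin B L X k admissible) ⟨
    c ℤ.* partialBasis X k B 0V       ≡⟨ ℤP.+-identityʳ _ ⟨
    combination X B ((c , k) ∷ []) 0V ≡⟨ vanishes 0V ⟩
    + 0                               ∎
    where open ≡-Reasoning
coefficients-vanish B L [] X (t ∷ t' ∷ _) _ _ (admissible ∷ admissible' ∷ _) (((ℓ , X-ℓ , kℓ≢k'ℓ) ∷ _) ∷ _) _ =
  ⊥-elim (kℓ≢k'ℓ (trans (Admissible.supported admissible ℓ (λ ()) X-ℓ) (sym (Admissible.supported admissible' ℓ (λ ()) X-ℓ))))
coefficients-vanish B L (ℓ₁ ∷ U) X ts (ℓ₁-prime ∷ U-prime) (ℓ₁∉U ∷ U-unique) admissible separated vanishes with X ℓ₁ in X-ℓ₁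
... | true  = coefficients-vanish B L U X ts U-prime U-unique (All.map (Admissible-drop X-ℓ₁) admissible) separated vanishes
... | false = All.tabulate (λ {t} t∈ts → All.lookup (by-index-at-ℓ₁ (proj₂ t ℓ₁) (Admissible.valid (All.lookup admissible t∈ts) ℓ₁))
                                                     (∈-filter⁺ (proj₂ t ℓ₁ ≟at ℓ₁) t∈ts refl))
  where
  by-index-at-ℓ₁ : ∀ j → ValidAt ℓ₁ j → All (λ t → proj₁ t ≡ + 0) (filter (j ≟at ℓ₁) ts)
  by-index-at-ℓ₁ j valid-j = coefficients-vanish B L U (exclude X ℓ₁) (filter (j ≟at ℓ₁) ts) U-prime U-unique
    (AllP.filter⁺ (j ≟at ℓ₁) (All.map Admissible-exclude admissible)) (Separated-exclude X ℓ₁ j ts separated)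
    (Step.coefficients-at-ℓ₁ B L ℓ₁ ℓ₁-prime U U-prime (AllP.All¬⇒¬Any ℓ₁∉U) X X-ℓ₁ ts admissible vanishes j valid-j)

maxLevel : List Idx → ℕ
maxLevel []       = 0
maxLevel (j ∷ ks) = level j ⊔ maxLevel ks

level-‼≤maxLevel : ∀ ks ℓ → level (ks ‼ ℓ) ≤ maxLevel ks
level-‼≤maxLevel []       ℓ       = z≤n
level-‼≤maxLevel (j ∷ ks) zero    = ℕP.m≤m⊔n (level j) (maxLevel ks)
level-‼≤maxLevel (j ∷ ks) (suc ℓ) = ℕP.≤-trans (level-‼≤maxLevel ks ℓ) (ℕP.m≤n⊔m (level j) (maxLevel ks))

primesBelow : ℕ → List ℕ
primesBelow B = filter prime? (upTo B)

primesBelow-prime : ∀ B → All Prime (primesBelow B)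
primesBelow-prime B = AllP.all-filter prime? (upTo B)

primesBelow-unique : ∀ B → Unique (primesBelow B)
primesBelow-unique B = UniqueP.filter⁺ prime? (UniqueP.upTo⁺ B)

‼-≢ : ∀ ks ks' → trim ks ≢ trim ks' → ∃ λ ℓ → ks ‼ ℓ ≢ ks' ‼ ℓ
‼-≢ ks ks' trims≢ with ℕP.anyUpTo? (λ ℓ → ¬? (ks ‼ ℓ ≟ᵢ ks' ‼ ℓ)) (length ks ⊔ length ks')
... | yes (ℓ , _ , ks‼ℓ≢) = ℓ , ks‼ℓ≢
... | no none = ⊥-elim (trims≢ (trim-≗ ks ks' all-equal))
  where
  all-equal : ∀ ℓ → ks ‼ ℓ ≡ ks' ‼ ℓ
  all-equal ℓ with ks ‼ ℓ ≟ᵢ ks' ‼ ℓ | ℓ ℕ.<? length ks ⊔ length ks'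
  ... | yes ks‼ℓ≡ | _     = ks‼ℓ≡
  ... | no ks‼ℓ≢  | yes ℓ< = ⊥-elim (none (ℓ , ℓ< , ks‼ℓ≢))
  ... | no ks‼ℓ≢  | no ℓ≮  = ⊥-elim (ks‼ℓ≢ (trans (‼-beyond ks ℓ (ℕP.≤-trans (ℕP.m≤m⊔n _ _) (ℕP.≮⇒≥ ℓ≮)))
                                                   (sym (‼-beyond ks' ℓ (ℕP.≤-trans (ℕP.m≤n⊔m _ _) (ℕP.≮⇒≥ ℓ≮))))))

module _ {S : ℕ → Set} where

  keyTerm : ℤ × Key S → Term
  keyTerm (c , K) = c , Key.idxs K ‼_

  key-admissible : ∀ B L (K : Key S) → length (Key.idxs K) ≤ B → maxLevel (Key.idxs K) ≤ L →
                   Admissible B L (λ _ → false) (primesBelow B) (Key.idxs K ‼_)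
  key-admissible B L K len≤B maxLevel≤L = record
    { supported = supported
    ; valid     = valid
    ; bounded   = λ ℓ B<ℓ → ‼-beyond ks ℓ (ℕP.≤-trans len≤B (ℕP.<⇒≤ B<ℓ))
    ; leveled   = λ ℓ → ℕP.≤-trans (level-‼≤maxLevel ks ℓ) maxLevel≤L
    }
    where
    ks = Key.idxs K
    valid : ∀ ℓ → ValidAt ℓ (ks ‼ ℓ)
    valid = ValidFrom⇒ValidAt 0 ks (proj₁ (canonical K))
    supported : ∀ ℓ → ℓ ∉ primesBelow B → false ≡ false → ks ‼ ℓ ≡ base
    supported ℓ ℓ∉ _ with ks ‼ ℓ in ks‼ℓ≡ | valid ℓ
    ... | base       | _            = refl
    ... | cell _ _ _ | ℓ-prime , _  = ⊥-elim (ℓ∉ (∈-filter⁺ prime? (∈-upTo⁺ ℓ<B) ℓ-prime))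
      where
      ℓ<B : ℓ < B
      ℓ<B = ℕP.≰⇒> (λ B≤ℓ → case-base (trans (sym ks‼ℓ≡) (‼-beyond ks ℓ (ℕP.≤-trans len≤B B≤ℓ))))
        where
        case-base : ∀ {k a b} → cell k a b ≢ base
        case-base ()

  distinct-keys-separated : ∀ {c c'} {K K' : Key S} → K ≢ K' → Separated (λ _ → false) (keyTerm (c , K)) (keyTerm (c' , K'))
  distinct-keys-separated {K = K} {K'} K≢K' =
    let (ℓ , ‼ℓ≢) = ‼-≢ (Key.idxs K) (Key.idxs K') (λ trims≡ → K≢K' (key-≡ K K'
                      (trans (sym (proj₂ (canonical K))) (trans trims≡ (proj₂ (canonical K'))))))
    in ℓ , refl , ‼ℓ≢

  keyBasis-independent : ∀ (cs : List (ℤ × Key S)) → Unique (map proj₂ cs) →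
                         (∀ v → lincomb keyBasis cs v ≡ + 0) → All (λ ci → proj₁ ci ≡ + 0) cs
  keyBasis-independent cs unique vanishes = AllP.map⁻ (coefficients-vanish B L (primesBelow B) (λ _ → false) (map keyTerm cs)
      (primesBelow-prime B) (primesBelow-unique B) (AllP.map⁺ (All.zipWith (λ {ci} → admissible {ci}) (len≤B , maxLevel≤L)))
      (AllPairsP.map⁺ (AllPairs.map (λ {ci} {ci'} → distinct-keys-separated {proj₁ ci} {proj₁ ci'} {proj₂ ci} {proj₂ ci'}) (AllPairsP.map⁻ unique)))
      (λ v → trans (combination≡lincomb cs v len≤B) (vanishes v)))
    where
    B = max 0 (map (λ ci → length (Key.idxs (proj₂ ci))) cs)
    L = max 0 (map (λ ci → maxLevel (Key.idxs (proj₂ ci))) cs)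
    len≤B : All (λ ci → length (Key.idxs (proj₂ ci)) ≤ B) cs
    len≤B = AllP.map⁻ (xs≤max 0 (map (λ ci → length (Key.idxs (proj₂ ci))) cs))
    maxLevel≤L : All (λ ci → maxLevel (Key.idxs (proj₂ ci)) ≤ L) cs
    maxLevel≤L = AllP.map⁻ (xs≤max 0 (map (λ ci → maxLevel (Key.idxs (proj₂ ci))) cs))
    admissible : ∀ {ci} → length (Key.idxs (proj₂ ci)) ≤ B × maxLevel (Key.idxs (proj₂ ci)) ≤ L →
                 Admissible B L (λ _ → false) (primesBelow B) (proj₂ (keyTerm ci))
    admissible {c , K} (len≤ , lvl≤) = key-admissible B L K len≤ lvl≤
    combination≡lincomb : ∀ cs v → All (λ ci → length (Key.idxs (proj₂ ci)) ≤ B) cs →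
                          combination (λ _ → false) B (map keyTerm cs) v ≡ lincomb keyBasis cs v
    combination≡lincomb []              v []             = refl
    combination≡lincomb ((c , K) ∷ cs) v (len≤ ∷ lens≤) =
      cong₂ ℤ._+_ (cong (c ℤ.*_) (sym (keyBasis≡partialBasis K B v len≤))) (combination≡lincomb cs v lens≤)

-- Spanning

range : ℕ → ℕ → List ℕ
range o zero    = []
range o (suc m) = o ∷ range (suc o) m

range-++ : ∀ o m d → range o (m ℕ.+ d) ≡ range o m ++ range (o ℕ.+ m) d
range-++ o zero    d = cong (λ z → range z d) (sym (ℕP.+-identityʳ o))
range-++ o (suc m) d = cong (o ∷_) (trans (range-++ (suc o) m d) (cong (λ z → range (suc o) m ++ range z d) (sym (ℕP.+-suc o m))))

range-0≡upTo : ∀ m → range 0 m ≡ upTo m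
range-0≡upTo m = range≡applyUpTo 0 m
  where
  applyUpTo-cong : ∀ {f g : ℕ → ℕ} → (∀ i → f i ≡ g i) → ∀ m → applyUpTo f m ≡ applyUpTo g m
  applyUpTo-cong f≗g zero    = refl
  applyUpTo-cong f≗g (suc m) = cong₂ _∷_ (f≗g 0) (applyUpTo-cong (λ i → f≗g (suc i)) m)
  range≡applyUpTo : ∀ o m → range o m ≡ applyUpTo (o ℕ.+_) m
  range≡applyUpTo o zero    = refl
  range≡applyUpTo o (suc m) = cong₂ _∷_ (sym (ℕP.+-identityʳ o))
    (trans (range≡applyUpTo (suc o) m) (applyUpTo-cong (λ i → sym (ℕP.+-suc o i)) m))

∈-range⇒≤ : ∀ o m {ℓ} → ℓ ∈ range o m → o ≤ ℓ
∈-range⇒≤ o (suc m) (here refl)  = ℕP.≤-refl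
∈-range⇒≤ o (suc m) (there ℓ∈) = ℕP.<⇒≤ (∈-range⇒≤ (suc o) m ℓ∈)

onPrime-cong : ∀ {ℓ} (d : Dec (Prime ℓ)) a b → (Prime ℓ → a ≡ b) → onPrime d a ≡ onPrime d b
onPrime-cong (yes ℓ-prime) a b a≡b = a≡b ℓ-prime
onPrime-cong (no _)        a b _   = refl

module Expansion {S : ℕ → Set} (t : PureTensor S) where
  open PureTensor t

  Kept : ∀ ℓ → Prime ℓ → Idx → Set
  Kept ℓ ℓ-prime j = j ≡ base ⊎ ¬ LocalBasis.coeff ℓ ℓ-prime j (φ ℓ) ≡ + 0

  kept? : ∀ ℓ (ℓ-prime : Prime ℓ) → Decidable (Kept ℓ ℓ-prime)
  kept? ℓ ℓ-prime j with j ≟ᵢ base | LocalBasis.coeff ℓ ℓ-prime j (φ ℓ) ℤ.≟ + 0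
  ... | yes j≡base | _         = yes (inj₁ j≡base)
  ... | no _       | no coeff≢0 = yes (inj₂ coeff≢0)
  ... | no j≢base  | yes coeff≡0 = no (λ { (inj₁ j≡base) → j≢base j≡base ; (inj₂ coeff≢0) → coeff≢0 coeff≡0 })

  options′ : ∀ ℓ → Dec (Prime ℓ) → List (ℤ × Idx)
  options′ ℓ (yes ℓ-prime) = map (λ j → LocalBasis.coeff ℓ ℓ-prime j (φ ℓ) , j)
                                 (filter (kept? ℓ ℓ-prime) (LocalBasis.indices ℓ ℓ-prime (proj₁ (local ℓ ℓ-prime))))
  options′ ℓ (no _)        = (+ 1 , base) ∷ []

  options : ℕ → List (ℤ × Idx)
  options ℓ = options′ ℓ (prime? ℓ)

  optionTerm : ℕ → ℤ × Idx → V → ℤ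
  optionTerm ℓ o v = proj₁ o ℤ.* onPrime (prime? ℓ) (basisAt ℓ (proj₂ o) v)

  factor-expansion′ : ∀ v ℓ (d : Dec (Prime ℓ)) →
                      onPrime d (φ ℓ v) ≡ sumℤ (map (λ o → proj₁ o ℤ.* onPrime d (basisAt ℓ (proj₂ o) v)) (options′ ℓ d))
  factor-expansion′ v ℓ (no _)        = refl
  factor-expansion′ v ℓ (yes ℓ-prime) = begin
      φ ℓ v                                                  ≡⟨ expand n (φ ℓ) (proj₂ (local ℓ ℓ-prime)) v ⟩
      sumℤ (map (λ j → c j ℤ.* basis j v) (indices n))       ≡⟨ cong sumℤ (map-cong-local {xs = indices n} (All.tabulate (λ {j} _ → cong (c j ℤ.*_) (sym (basisAt-prime ℓ ℓ-prime j v))))) ⟩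
      sumℤ (map summand (indices n))                            ≡⟨ sumℤ-filter (kept? ℓ ℓ-prime) summand (indices n) dropped≡0 ⟨
      sumℤ (map summand (filter (kept? ℓ ℓ-prime) (indices n))) ≡⟨ cong sumℤ (map-∘ {g = λ o → proj₁ o ℤ.* basisAt ℓ (proj₂ o) v} {f = λ j → c j , j} (filter (kept? ℓ ℓ-prime) (indices n))) ⟩
      sumℤ (map (λ o → proj₁ o ℤ.* basisAt ℓ (proj₂ o) v) (map (λ j → c j , j) (filter (kept? ℓ ℓ-prime) (indices n)))) ∎
    where
    open ≡-Reasoning
    open LocalBasis ℓ ℓ-prime using (expand; basis; indices; coeff)
    n = proj₁ (local ℓ ℓ-prime)
    c : Idx → ℤ
    c j = coeff j (φ ℓ)
    summand : Idx → ℤ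
    summand j = c j ℤ.* basisAt ℓ j v
    dropped≡0 : ∀ j → ¬ Kept ℓ ℓ-prime j → summand j ≡ + 0
    dropped≡0 j ¬kept with c j ℤ.≟ + 0
    ... | yes cj≡0 = cong (ℤ._* basisAt ℓ j v) cj≡0
    ... | no cj≢0  = ⊥-elim (¬kept (inj₂ cj≢0))

  factor-expansion : ∀ v ℓ → factor φ v ℓ ≡ sumℤ (map (λ o → optionTerm ℓ o v) (options ℓ))
  factor-expansion v ℓ = factor-expansion′ v ℓ (prime? ℓ)

  choices : ℕ → ℕ → List (List (ℤ × Idx))
  choices o zero    = [] ∷ []
  choices o (suc m) = concatMap (λ x → map (x ∷_) (choices (suc o) m)) (options o)

  choiceTerm : ℕ → List (ℤ × Idx) → V → ℤ
  choiceTerm o []       v = + 1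
  choiceTerm o (x ∷ os) v = optionTerm o x v ℤ.* choiceTerm (suc o) os v

  choiceCoeff : List (ℤ × Idx) → ℤ
  choiceCoeff []       = + 1
  choiceCoeff (x ∷ os) = proj₁ x ℤ.* choiceCoeff os

  choiceBasis : ℕ → List (ℤ × Idx) → V → ℤ
  choiceBasis o []       v = + 1
  choiceBasis o (x ∷ os) v = onPrime (prime? o) (basisAt o (proj₂ x) v) ℤ.* choiceBasis (suc o) os v

  choiceTerm≡ : ∀ o os v → choiceTerm o os v ≡ choiceCoeff os ℤ.* choiceBasis o os v
  choiceTerm≡ o []       v = refl
  choiceTerm≡ o (x ∷ os) v = trans (cong (optionTerm o x v ℤ.*_) (choiceTerm≡ (suc o) os v))
    (solve 4 (λ c f C B → (c :* f) :* (C :* B) := (c :* C) :* (f :* B)) refl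
       (proj₁ x) (onPrime (prime? o) (basisAt o (proj₂ x) v)) (choiceCoeff os) (choiceBasis (suc o) os v))
    where open ℤS

  product-of-sums : ∀ o m v → prodℤ (map (λ ℓ → sumℤ (map (λ x → optionTerm ℓ x v) (options ℓ))) (range o m))
                            ≡ sumℤ (map (λ os → choiceTerm o os v) (choices o m))
  product-of-sums o zero    v = refl
  product-of-sums o (suc m) v = begin
      sumℤ (map (λ x → optionTerm o x v) (options o)) ℤ.* prodℤ (map (λ ℓ → sumℤ (map (λ x → optionTerm ℓ x v) (options ℓ))) (range (suc o) m))
        ≡⟨ cong (sumℤ (map (λ x → optionTerm o x v) (options o)) ℤ.*_) (product-of-sums (suc o) m v) ⟩
      sumℤ (map (λ x → optionTerm o x v) (options o)) ℤ.* rest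
        ≡⟨ sumℤ-* rest (λ x → optionTerm o x v) (options o) ⟩
      sumℤ (map (λ x → optionTerm o x v ℤ.* rest) (options o))
        ≡⟨ cong sumℤ (map-cong-local {xs = options o} (All.tabulate (λ {x} _ →
             trans (*-sumℤ (optionTerm o x v) (λ os → choiceTerm (suc o) os v) (choices (suc o) m))
                   (cong sumℤ (map-∘ {g = λ os → choiceTerm o os v} {f = x ∷_} (choices (suc o) m)))))) ⟩
      sumℤ (map (λ x → sumℤ (map (λ os → choiceTerm o os v) (map (x ∷_) (choices (suc o) m)))) (options o))
        ≡⟨ sumℤ-concatMap (λ os → choiceTerm o os v) (λ x → map (x ∷_) (choices (suc o) m)) (options o) ⟨
      sumℤ (map (λ os → choiceTerm o os v) (choices o (suc m))) ∎
    where
    open ≡-Reasoning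
    rest = sumℤ (map (λ os → choiceTerm (suc o) os v) (choices (suc o) m))

  Chosen : ℕ → List (ℤ × Idx) → Set
  Chosen o []       = ⊤
  Chosen o (x ∷ os) = x ∈ options o × Chosen (suc o) os

  choices-chosen : ∀ o m → All (λ os → Chosen o os × length os ≡ m) (choices o m)
  choices-chosen o zero    = (tt , refl) ∷ []
  choices-chosen o (suc m) = AllP.concat⁺ (AllP.map⁺ (All.tabulate (λ {x} x∈ →
    AllP.map⁺ (All.map (λ { (chosen , len≡m) → (x∈ , chosen) , cong suc len≡m }) (choices-chosen (suc o) m)))))

  OptionIdx : ℕ → Idx → Set
  OptionIdx ℓ j = j ≡ base ⊎ Σ (Prime ℓ) λ ℓ-prime → LocalBasis.Valid ℓ ℓ-prime j × ¬ LocalBasis.coeff ℓ ℓ-prime j (φ ℓ) ≡ + 0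

  options′-idx : ∀ ℓ (d : Dec (Prime ℓ)) {x} → x ∈ options′ ℓ d → OptionIdx ℓ (proj₂ x)
  options′-idx ℓ (no _) (here refl) = inj₁ refl
  options′-idx ℓ (yes ℓ-prime) x∈ with ∈-map⁻ (λ j → LocalBasis.coeff ℓ ℓ-prime j (φ ℓ) , j) x∈
  ... | j , j∈ , refl with ∈-filter⁻ (kept? ℓ ℓ-prime) {xs = LocalBasis.indices ℓ ℓ-prime (proj₁ (local ℓ ℓ-prime))} j∈
  ...   | _  , inj₁ j≡base = inj₁ j≡base
  ...   | j∈indices , inj₂ coeff≢0 = inj₂ (ℓ-prime , proj₁ (LocalBasis.indices-sound ℓ ℓ-prime (proj₁ (local ℓ ℓ-prime)) j∈indices) , coeff≢0)

  chosen-‼ : ∀ o os → Chosen o os → ∀ i → OptionIdx (o ℕ.+ i) (map proj₂ os ‼ i)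
  chosen-‼ o []       _               i       = inj₁ refl
  chosen-‼ o (x ∷ os) (x∈ , _)      zero    = subst (λ ℓ → OptionIdx ℓ (proj₂ x)) (sym (ℕP.+-identityʳ o)) (options′-idx o (prime? o) x∈)
  chosen-‼ o (x ∷ os) (_ , chosen) (suc i) = subst (λ ℓ → OptionIdx ℓ (map proj₂ os ‼ i)) (sym (ℕP.+-suc o i)) (chosen-‼ (suc o) os chosen i)

  OptionIdx⇒ValidAt : ∀ ℓ j → OptionIdx ℓ j → ValidAt ℓ j
  OptionIdx⇒ValidAt ℓ base         _                              = tt
  OptionIdx⇒ValidAt ℓ (cell k a b) (inj₂ (ℓ-prime , valid , _)) = ℓ-prime , valid

  coeff≢0⇒∉S : ∀ ℓ (ℓ-prime : Prime ℓ) j → LocalBasis.Valid ℓ ℓ-prime j → j ≢ base →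
               ¬ LocalBasis.coeff ℓ ℓ-prime j (φ ℓ) ≡ + 0 → ¬ S ℓ
  coeff≢0⇒∉S ℓ ℓ-prime j valid j≢base coeff≢0 ℓ∈S = coeff≢0 (begin
      coeff j (φ ℓ)      ≡⟨ coeff-cong j (φ ℓ) (f0 ℓ) (onS ℓ ℓ-prime ℓ∈S) ⟩
      coeff j (f0 ℓ)     ≡⟨ coeff-basis j base valid tt ⟩
      δ j base           ≡⟨ δ-≢ j≢base ⟩
      + 0                ∎)
    where
    open ≡-Reasoning
    open LocalBasis ℓ ℓ-prime using (coeff; coeff-cong; coeff-basis)

  choiceKey : ∀ os → Chosen 0 os → Key S
  choiceKey os chosen = key ks (ValidAt⇒ValidFrom 0 ks valid , trim-idem (map proj₂ os)) avoids-S
    where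
    ks = trim (map proj₂ os)
    valid : ∀ i → ValidAt i (ks ‼ i)
    valid i = subst (ValidAt i) (sym (‼-trim (map proj₂ os) i)) (OptionIdx⇒ValidAt i _ (chosen-‼ 0 os chosen i))
    avoids-S : ∀ ℓ → ks ‼ ℓ ≢ base → ¬ S ℓ
    avoids-S ℓ ks‼ℓ≢base with chosen-‼ 0 os chosen ℓ
    ... | inj₁ ‼ℓ≡base = ⊥-elim (ks‼ℓ≢base (trans (‼-trim (map proj₂ os) ℓ) ‼ℓ≡base))
    ... | inj₂ (ℓ-prime , valid , coeff≢0) = coeff≢0⇒∉S ℓ ℓ-prime _ valid (λ ‼ℓ≡base → ks‼ℓ≢base (trans (‼-trim (map proj₂ os) ℓ) ‼ℓ≡base)) coeff≢0

  choiceBasis-‼ : ∀ o os ks v → (∀ i → ks ‼ (o ℕ.+ i) ≡ map proj₂ os ‼ i) →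
                  choiceBasis o os v ≡ prodℤ (map (factor (keyFactors ks) v) (range o (length os)))
  choiceBasis-‼ o []       ks v _      = refl
  choiceBasis-‼ o (x ∷ os) ks v agrees = cong₂ ℤ._*_
    (cong (λ j → onPrime (prime? o) (basisAt o j v)) (sym (trans (cong (ks ‼_) (sym (ℕP.+-identityʳ o))) (agrees 0))))
    (choiceBasis-‼ (suc o) os ks v (λ i → trans (cong (ks ‼_) (sym (ℕP.+-suc o i))) (agrees (suc i))))

  choiceBasis*tail≡keyBasis : ∀ os (chosen : Chosen 0 os) → length os ≡ suc N → ∀ v →
    choiceBasis 0 os v ℤ.* prodℤ (map (factor φ v) (range (suc N) (N ⊔ height v ℕ.∸ N))) ≡ keyBasis (choiceKey os chosen) v
  choiceBasis*tail≡keyBasis os chosen len≡ v = begin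
      choiceBasis 0 os v ℤ.* prodℤ (map (factor φ v) (range (suc N) d))
        ≡⟨ cong₂ ℤ._*_ (trans (choiceBasis-‼ 0 os ks v (‼-trim (map proj₂ os))) (cong (λ m → prodℤ (map (factor (keyFactors ks) v) (range 0 m))) len≡))
                       (cong prodℤ (map-cong-local (All.tabulate (λ {ℓ} ℓ∈ → onPrime-cong (prime? ℓ) _ _ (beyond-N ℓ (∈-range⇒≤ (suc N) d ℓ∈)))))) ⟩
      prodℤ (map (factor (keyFactors ks) v) (range 0 (suc N))) ℤ.* prodℤ (map (factor (keyFactors ks) v) (range (suc N) d))
        ≡⟨ prodℤ-++ (factor (keyFactors ks) v) (range 0 (suc N)) (range (suc N) d) ⟨
      prodℤ (map (factor (keyFactors ks) v) (range 0 (suc N) ++ range (suc N) d))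
        ≡⟨ cong (λ ℓs → prodℤ (map (factor (keyFactors ks) v) ℓs)) (trans (sym (range-++ 0 (suc N) d)) (trans (cong (range 0) N+d≡B) (range-0≡upTo (suc B)))) ⟩
      prodℤ (map (factor (keyFactors ks) v) (upTo (suc B)))
        ≡⟨ Indicates-unique {keyFactors ks} {keyFactors ks} {v} {v} (AllOne? B (keyFactors ks) v one-beyond)
             (prod-factor-indicates B (keyFactors ks) v (λ ℓ → basisAt-01 ℓ (ks ‼ ℓ) v) one-beyond)
             (keyBasis-indicates (choiceKey os chosen) v) (λ all-one → all-one) (λ all-one → all-one) ⟩
      keyBasis (choiceKey os chosen) v ∎
    where
    open ≡-Reasoning
    ks = trim (map proj₂ os)
    B = N ⊔ height v
    d = B ℕ.∸ N
    N+d≡B : suc N ℕ.+ d ≡ suc B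
    N+d≡B = cong suc (ℕP.m+[n∸m]≡n (ℕP.m≤m⊔n N (height v)))
    ks-short : length ks ≤ suc N
    ks-short = subst (length ks ≤_) (trans (length-map proj₂ os) len≡) (length-trim (map proj₂ os))
    base-beyond-N : ∀ ℓ → suc N ≤ ℓ → keyFactors ks ℓ v ≡ f0 ℓ v
    base-beyond-N ℓ N<ℓ = trans (cong (λ j → basisAt ℓ j v) (‼-beyond ks ℓ (ℕP.≤-trans ks-short N<ℓ))) (basisAt-base ℓ v)
    beyond-N : ∀ ℓ → suc N ≤ ℓ → Prime ℓ → φ ℓ v ≡ keyFactors ks ℓ v
    beyond-N ℓ N<ℓ ℓ-prime = trans (cofinite ℓ ℓ-prime N<ℓ v) (sym (base-beyond-N ℓ N<ℓ))
    one-beyond : OneBeyond B (keyFactors ks) v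
    one-beyond ℓ ℓ-prime B<ℓ = trans (base-beyond-N ℓ (ℕP.≤-trans (s≤s (ℕP.m≤m⊔n N (height v))) B<ℓ))
                                     (f0-beyond-height ℓ ℓ-prime v (ℕP.≤-<-trans (ℕP.m≤n⊔m N (height v)) B<ℓ))

  expansion : List (ℤ × Key S)
  expansion = mapWith∈ (choices 0 (suc N)) (λ {os} os∈ → choiceCoeff os , choiceKey os (proj₁ (All.lookup (choices-chosen 0 (suc N)) os∈)))

  restrict≡lincomb : ∀ v → restrict t v ≡ lincomb keyBasis expansion v
  restrict≡lincomb v = begin
      restrict t v
        ≡⟨ restrict-≡ t v ⟩
      prodℤ (map (factor φ v) (upTo (suc B)))
        ≡⟨ cong (λ ℓs → prodℤ (map (factor φ v) ℓs)) (sym (trans (cong (range 0) N+d≡B) (range-0≡upTo (suc B)))) ⟩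
      prodℤ (map (factor φ v) (range 0 (suc N ℕ.+ d)))
        ≡⟨ cong (λ ℓs → prodℤ (map (factor φ v) ℓs)) (range-++ 0 (suc N) d) ⟩
      prodℤ (map (factor φ v) (range 0 (suc N) ++ range (suc N) d))
        ≡⟨ prodℤ-++ (factor φ v) (range 0 (suc N)) (range (suc N) d) ⟩
      prodℤ (map (factor φ v) (range 0 (suc N))) ℤ.* tail
        ≡⟨ cong (ℤ._* tail) (cong prodℤ (map-cong-local {xs = range 0 (suc N)} (All.tabulate (λ {ℓ} _ → factor-expansion v ℓ)))) ⟩
      prodℤ (map (λ ℓ → sumℤ (map (λ x → optionTerm ℓ x v) (options ℓ))) (range 0 (suc N))) ℤ.* tail
        ≡⟨ cong (ℤ._* tail) (product-of-sums 0 (suc N) v) ⟩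
      sumℤ (map (λ os → choiceTerm 0 os v) (choices 0 (suc N))) ℤ.* tail
        ≡⟨ sumℤ-* tail (λ os → choiceTerm 0 os v) (choices 0 (suc N)) ⟩
      sumℤ (map (λ os → choiceTerm 0 os v ℤ.* tail) (choices 0 (suc N)))
        ≡⟨ sumℤ-mapWith∈ (choices 0 (suc N)) _ term≡ ⟩
      lincomb keyBasis expansion v ∎
    where
    open ≡-Reasoning
    B = N ⊔ height v
    d = B ℕ.∸ N
    N+d≡B : suc N ℕ.+ d ≡ suc B
    N+d≡B = cong suc (ℕP.m+[n∸m]≡n (ℕP.m≤m⊔n N (height v)))
    tail = prodℤ (map (factor φ v) (range (suc N) d))
    term≡ : ∀ {os} (os∈ : os ∈ choices 0 (suc N)) →
            choiceTerm 0 os v ℤ.* tail ≡ choiceCoeff os ℤ.* keyBasis (choiceKey os (proj₁ (All.lookup (choices-chosen 0 (suc N)) os∈))) v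
    term≡ {os} os∈ = let (chosen , len≡) = All.lookup (choices-chosen 0 (suc N)) os∈ in begin
      choiceTerm 0 os v ℤ.* tail                          ≡⟨ cong (ℤ._* tail) (choiceTerm≡ 0 os v) ⟩
      choiceCoeff os ℤ.* choiceBasis 0 os v ℤ.* tail      ≡⟨ ℤP.*-assoc (choiceCoeff os) (choiceBasis 0 os v) tail ⟩
      choiceCoeff os ℤ.* (choiceBasis 0 os v ℤ.* tail)    ≡⟨ cong (choiceCoeff os ℤ.*_) (choiceBasis*tail≡keyBasis os chosen len≡ v) ⟩
      choiceCoeff os ℤ.* keyBasis (choiceKey os chosen) v ∎
    sumℤ-mapWith∈ : ∀ xs (g : ∀ {os} → os ∈ xs → ℤ × Key S) → (∀ {os} (os∈ : os ∈ xs) → choiceTerm 0 os v ℤ.* tail ≡ proj₁ (g os∈) ℤ.* keyBasis (proj₂ (g os∈)) v) →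
                    sumℤ (map (λ os → choiceTerm 0 os v ℤ.* tail) xs) ≡ lincomb keyBasis (mapWith∈ xs g) v
    sumℤ-mapWith∈ []       g g≡ = refl
    sumℤ-mapWith∈ (x ∷ xs) g g≡ = cong₂ ℤ._+_ (g≡ (here refl)) (sumℤ-mapWith∈ xs (λ x∈ → g (there x∈)) (λ x∈ → g≡ (there x∈)))

-- Freeness

module _ {S : ℕ → Set} where

  keyBasis∈SVS : ∀ (K : Key S) → InSVS S (keyBasis K)
  keyBasis∈SVS K = (+ 1 , keyTensor K) ∷ [] , λ v → sym (trans (ℤP.+-identityʳ _) (ℤP.*-identityˡ (keyBasis K v)))

  scale : ℤ → List (ℤ × Key S) → List (ℤ × Key S)
  scale c = map (λ dK → c ℤ.* proj₁ dK , proj₂ dK)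

  lincomb-scale : ∀ c L v → lincomb keyBasis (scale c L) v ≡ c ℤ.* lincomb keyBasis L v
  lincomb-scale c []            v = sym (ℤP.*-zeroʳ c)
  lincomb-scale c ((d , K) ∷ L) v = trans (cong₂ ℤ._+_ (ℤP.*-assoc c d (keyBasis K v)) (lincomb-scale c L v))
                                          (sym (ℤP.*-distribˡ-+ c (d ℤ.* keyBasis K v) (lincomb keyBasis L v)))

  keyBasis-spans : ∀ f → InSVS S f → Σ (List (ℤ × Key S)) λ cs → ∀ v → f v ≡ lincomb keyBasis cs v
  keyBasis-spans f (cts , f≡) = concatMap expand-term cts , λ v → trans (f≡ v) (sym (begin
      lincomb keyBasis (concatMap expand-term cts) v
        ≡⟨ sumℤ-concatMap (λ cK → proj₁ cK ℤ.* keyBasis (proj₂ cK) v) expand-term cts ⟩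
      sumℤ (map (λ ct → lincomb keyBasis (expand-term ct) v) cts)
        ≡⟨ cong sumℤ (map-cong (λ { (c , t) → trans (lincomb-scale c (Expansion.expansion t) v) (cong (c ℤ.*_) (sym (Expansion.restrict≡lincomb t v))) }) cts) ⟩
      sumℤ (map (λ ct → proj₁ ct ℤ.* restrict (proj₂ ct) v) cts) ∎))
    where
    open ≡-Reasoning
    expand-term : ℤ × PureTensor S → List (ℤ × Key S)
    expand-term (c , t) = scale c (Expansion.expansion t)

  SVS-free : IsFree (InSVS S)
  SVS-free = Key S , keyBasis , keyBasis∈SVS , keyBasis-spans , keyBasis-independent

  -- The basis vector of unitKey is 1 at the origin, so subtracting multiples of it lands in 𝒮(V_𝒮').
  unitKey : Key S
  unitKey = key [] (tt , refl) (λ _ base≢base → ⊥-elim (base≢base refl))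

  keyBasis-unitKey-0 : keyBasis unitKey 0V ≡ + 1
  keyBasis-unitKey-0 = proj₁ (keyBasis-indicates unitKey 0V)
    (λ ℓ ℓ-prime → trans (basisAt-base ℓ 0V) (f0-beyond-height ℓ ℓ-prime 0V (Adic.1<ℓ ℓ ℓ-prime)))

  NonUnitKey : Set
  NonUnitKey = Σ (Key S) λ K → T (not (null (Key.idxs K)))

  reduced : NonUnitKey → V → ℤ
  reduced (K , _) v = keyBasis K v ℤ.- keyBasis K 0V ℤ.* keyBasis unitKey v

  reduced∈SVS' : ∀ i → InSVS' S (reduced i)
  reduced∈SVS' (K , _) =
    ((+ 1 , keyTensor K) ∷ (ℤ.- keyBasis K 0V , keyTensor unitKey) ∷ [] ,
     λ v → solve 3 (λ b b₀ u → b :- b₀ :* u := con (+ 1) :* b :+ ((:- b₀) :* u :+ con (+ 0))) refl (keyBasis K v) (keyBasis K 0V) (keyBasis unitKey v)) ,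
    trans (cong (λ u → keyBasis K 0V ℤ.- keyBasis K 0V ℤ.* u) keyBasis-unitKey-0)
          (trans (cong (λ z → keyBasis K 0V ℤ.- z) (ℤP.*-identityʳ (keyBasis K 0V))) (ℤP.+-inverseʳ (keyBasis K 0V)))
    where open ℤS

  dropUnit : List (ℤ × Key S) → List (ℤ × NonUnitKey)
  dropUnit []                              = []
  dropUnit ((c , key [] _ _) ∷ L)          = dropUnit L
  dropUnit ((c , K@(key (_ ∷ _) _ _)) ∷ L) = (c , (K , tt)) ∷ dropUnit L

  lincomb-dropUnit : ∀ L v → lincomb keyBasis L v ≡ lincomb reduced (dropUnit L) v ℤ.+ lincomb keyBasis L 0V ℤ.* keyBasis unitKey v
  lincomb-dropUnit [] v = refl
  lincomb-dropUnit ((c , key [] _ _) ∷ L) v = begin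
      c ℤ.* u ℤ.+ lincomb keyBasis L v
        ≡⟨ cong (λ z → c ℤ.* u ℤ.+ z) (lincomb-dropUnit L v) ⟩
      c ℤ.* u ℤ.+ (lincomb reduced (dropUnit L) v ℤ.+ lincomb keyBasis L 0V ℤ.* u)
        ≡⟨ solve 4 (λ c r l u → c :* u :+ (r :+ l :* u) := r :+ (c :* con (+ 1) :+ l) :* u) refl c (lincomb reduced (dropUnit L) v) (lincomb keyBasis L 0V) u ⟩
      lincomb reduced (dropUnit L) v ℤ.+ (c ℤ.* + 1 ℤ.+ lincomb keyBasis L 0V) ℤ.* u
        ≡⟨ cong (λ z → lincomb reduced (dropUnit L) v ℤ.+ (c ℤ.* z ℤ.+ lincomb keyBasis L 0V) ℤ.* u) (sym keyBasis-unitKey-0) ⟩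
      lincomb reduced (dropUnit L) v ℤ.+ (c ℤ.* keyBasis unitKey 0V ℤ.+ lincomb keyBasis L 0V) ℤ.* u ∎
    where
    open ≡-Reasoning
    open ℤS
    u = keyBasis unitKey v
  lincomb-dropUnit ((c , K@(key (_ ∷ _) _ _)) ∷ L) v = trans (cong (λ z → c ℤ.* keyBasis K v ℤ.+ z) (lincomb-dropUnit L v))
    (solve 6 (λ c b b₀ r l u → c :* b :+ (r :+ l :* u) := (c :* (b :- b₀ :* u) :+ r) :+ (c :* b₀ :+ l) :* u) refl
       c (keyBasis K v) (keyBasis K 0V) (lincomb reduced (dropUnit L) v) (lincomb keyBasis L 0V) (keyBasis unitKey v))
    where open ℤS

  reduced-spans : ∀ f → InSVS' S f → Σ (List (ℤ × NonUnitKey)) λ cs → ∀ v → f v ≡ lincomb reduced cs v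
  reduced-spans f (f∈SVS , f0≡0) = dropUnit L , λ v → begin
      f v                                                                          ≡⟨ f≡ v ⟩
      lincomb keyBasis L v                                                         ≡⟨ lincomb-dropUnit L v ⟩
      lincomb reduced (dropUnit L) v ℤ.+ lincomb keyBasis L 0V ℤ.* keyBasis unitKey v ≡⟨ cong (λ z → lincomb reduced (dropUnit L) v ℤ.+ z ℤ.* keyBasis unitKey v) L0≡0 ⟩
      lincomb reduced (dropUnit L) v ℤ.+ + 0                                       ≡⟨ ℤP.+-identityʳ _ ⟩
      lincomb reduced (dropUnit L) v                                               ∎
    where
    open ≡-Reasoning
    L = proj₁ (keyBasis-spans f f∈SVS)
    f≡ = proj₂ (keyBasis-spans f f∈SVS)
    L0≡0 = trans (sym (f≡ 0V)) f0≡0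

  forget : ℤ × NonUnitKey → ℤ × Key S
  forget ci = proj₁ ci , proj₁ (proj₂ ci)

  lincomb-forget : ∀ cs v → lincomb reduced cs v ≡ lincomb keyBasis (map forget cs) v ℤ.- lincomb keyBasis (map forget cs) 0V ℤ.* keyBasis unitKey v
  lincomb-forget []                  v = refl
  lincomb-forget ((c , (K , p)) ∷ cs) v = trans (cong (λ z → c ℤ.* reduced (K , p) v ℤ.+ z) (lincomb-forget cs v))
    (solve 6 (λ c b b₀ r l u → c :* (b :- b₀ :* u) :+ (r :- l :* u) := (c :* b :+ r) :- (c :* b₀ :+ l) :* u) refl
       c (keyBasis K v) (keyBasis K 0V) (lincomb keyBasis (map forget cs) v) (lincomb keyBasis (map forget cs) 0V) (keyBasis unitKey v))
    where open ℤS

  reduced-independent : ∀ (cs : List (ℤ × NonUnitKey)) → Unique (map proj₂ cs) →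
                        (∀ v → lincomb reduced cs v ≡ + 0) → All (λ ci → proj₁ ci ≡ + 0) cs
  reduced-independent cs unique vanishes =
    AllP.map⁻ (All.tail (keyBasis-independent ((d , unitKey) ∷ map forget cs) (unitKey-fresh ∷ forget-unique) combination≡0))
    where
    d = ℤ.- lincomb keyBasis (map forget cs) 0V
    unitKey≢ : ∀ (i : NonUnitKey) → unitKey ≢ proj₁ i
    unitKey≢ (key [] _ _ , ())
    unitKey≢ (key (_ ∷ _) _ _ , _) ()
    unitKey-fresh : All (unitKey ≢_) (map proj₂ (map forget cs))
    unitKey-fresh = AllP.map⁺ (AllP.map⁺ (All.universal (λ ci → unitKey≢ (proj₂ ci)) cs))
    forget-unique : Unique (map proj₂ (map forget cs))
    forget-unique = AllPairsP.map⁺ (AllPairsP.map⁺ (AllPairs.map (λ {ci} {cj} → forget-≢ {ci} {cj}) (AllPairsP.map⁻ unique)))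
      where
      forget-≢ : ∀ {ci cj : ℤ × NonUnitKey} → proj₂ ci ≢ proj₂ cj → proj₁ (proj₂ ci) ≢ proj₁ (proj₂ cj)
      forget-≢ {_ , (K , p)} {_ , (.K , q)} i≢j refl = i≢j (cong (K ,_) (T-irrelevant p q))
    combination≡0 : ∀ v → lincomb keyBasis ((d , unitKey) ∷ map forget cs) v ≡ + 0
    combination≡0 v = trans (solve 3 (λ l₀ u l → (:- l₀) :* u :+ l := l :- l₀ :* u) refl
                               (lincomb keyBasis (map forget cs) 0V) (keyBasis unitKey v) (lincomb keyBasis (map forget cs) v))
                            (trans (sym (lincomb-forget cs v)) (vanishes v))
      where open ℤS

  SVS'-free : IsFree (InSVS' S)
  SVS'-free = NonUnitKey , reduced , reduced∈SVS' , reduced-spans , reduced-independent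

mainTheorem7 : (S : ℕ → Set) → (∀ ℓ → S ℓ → Prime ℓ) → IsFree (InSVS S) × IsFree (InSVS' S)
mainTheorem7 S _ = SVS-free , SVS'-free
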